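{- Let $n\ge1$ and $\beta$ a parameter. Let $\Phi^{BC}$ be the operator acting on the variables $y_1,\dots,y_n$ $$\Phi^{BC}:=(\pi_n^{BC}\pi_{n-1}\cdots\pi_1)(\pi_n^{BC}\pi_{n-1}\cdots\pi_2)\cdots(\pi_n^{BC}\pi_{n-1})(\pi_n^{BC}).$$ Then $\Omega^A\,\Phi^{BC}=\Omega^{BC}$, where $$\Omega^A=\prod_{i+j\le n+1}\frac1{1-x_iy_j},\qquad \Omega^{BC}=\frac{\prod_{i<j}(1-x_ix_j)\prod_i(1+\beta x_i)}{\prod_{i,j=1}^n(1-x_iy_j)\prod_{1\le i\le j\le n}(1-x_i/y_j)}.$$
   Context: Both kernels are formal power series in $x_1,\dots,x_n$ with coefficients Laurent polynomials in $y$ (and polynomials in $\beta$); operators in $y$ act coefficientwise and are written on the right ($f\pi\pi'$: apply $\pi$ then $\pi'$). In the variables $y$: $f\pi_i=\frac{y_if-y_{i+1}f^{s_i}}{y_i-y_{i+1}}$ with $s_i$ exchanging $y_i,y_{i+1}$ ($1\le i<n$), and $f\pi_n^{BC}=\frac{(y_n+\beta)f-(y_n^{ -1}+\beta)f^{s_n}}{y_n-y_n^{ -1}}$ with $s_n:y_n\mapsto y_n^{ -1}$. -}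

module Defs where

open import Data.Nat as ℕ using (ℕ; zero; suc)
open import Data.Integer as ℤ using (ℤ)
open import Data.Fin as Fin using (Fin; toℕ; inject₁; fromℕ)
open import Data.Vec as Vec using (Vec; []; _∷_; replicate; lookup; _[_]≔_; zipWith)
open import Data.List as List using (List; []; _∷_; _++_; concatMap; map; foldr; filter; upTo; reverse; allFin)
open import Data.Product using (_×_; _,_; Σ; Σ-syntax)
open import Data.Bool using (if_then_else_)
open import Relation.Nullary using (does)
open import Relation.Binary.PropositionalEquality using (_≡_)
import Data.Vec.Properties as VecP
import Data.Product.Properties as ProdP

-- Laurent polynomials in y₁..yₙ with coefficients in ℤ[β]
-- A monomial β^b y^u is a pair (b , u) with b : ℕ and u : Vec ℤ n.
-- A Laurent polynomial is a finite list of terms (c , monomial), c : ℤ,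
-- read as the sum of its terms; equality ≈L is equality of all
-- coefficients.

Mon : ℕ → Set
Mon n = ℕ × Vec ℤ n

_≟M_ : ∀ {n} (μ ν : Mon n) → _
_≟M_ = ProdP.≡-dec ℕ._≟_ (VecP.≡-dec ℤ._≟_)

LP : ℕ → Set
LP n = List (ℤ × Mon n)

coeffL : ∀ {n} → LP n → Mon n → ℤ
coeffL [] μ = ℤ.0ℤ
coeffL ((c , ν) ∷ p) μ = if does (ν ≟M μ) then c ℤ.+ coeffL p μ else coeffL p μ

_≈L_ : ∀ {n} → LP n → LP n → Set
p ≈L q = ∀ μ → coeffL p μ ≡ coeffL q μ

zeroL : ∀ {n} → LP n
zeroL = []

oneL : ∀ {n} → LP n
oneL = (ℤ.1ℤ , (0 , replicate _ ℤ.0ℤ)) ∷ []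

_+L_ : ∀ {n} → LP n → LP n → LP n
p +L q = p ++ q

-L_ : ∀ {n} → LP n → LP n
-L p = map (λ { (c , μ) → (ℤ.- c , μ) }) p

_-L_ : ∀ {n} → LP n → LP n → LP n
p -L q = p +L (-L q)

mulM : ∀ {n} → Mon n → Mon n → Mon n
mulM (a , u) (b , v) = (a ℕ.+ b , zipWith ℤ._+_ u v)

_*L_ : ∀ {n} → LP n → LP n → LP n
p *L q = concatMap (λ { (c , μ) → map (λ { (d , ν) → (c ℤ.* d , mulM μ ν) }) q }) p

powL : ∀ {n} → LP n → ℕ → LP n
powL p zero = oneL
powL p (suc k) = p *L powL p k

yL : ∀ {n} → Fin n → LP n
yL {n} j = (ℤ.1ℤ , (0 , (replicate n ℤ.0ℤ [ j ]≔ ℤ.1ℤ))) ∷ []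

yinvL : ∀ {n} → Fin n → LP n
yinvL {n} j = (ℤ.1ℤ , (0 , (replicate n ℤ.0ℤ [ j ]≔ ℤ.-1ℤ))) ∷ []

βL : ∀ {n} → LP n
βL {n} = (ℤ.1ℤ , (1 , replicate n ℤ.0ℤ)) ∷ []

substL : ∀ {n} → (Vec ℤ n → Vec ℤ n) → LP n → LP n
substL σ p = map (λ { (c , (b , u)) → (c , (b , σ u)) }) p

swapExp : ∀ {n} → Fin n → Fin n → Vec ℤ n → Vec ℤ n
swapExp i j u = (u [ i ]≔ lookup u j) [ j ]≔ lookup u i

invExp : ∀ {n} → Fin n → Vec ℤ n → Vec ℤ n
invExp j u = u [ j ]≔ ℤ.- lookup u j

-- A i (i : Fin m, 0-based) is π_{i+1} (exchanging y_{i+1}, y_{i+2});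
-- BC is π_n^{BC}.  Since the operators are defined by an exact division
-- in the integral domain ℤ[β][y^{±1}], "g = f π" is expressed as
-- "denominator · g = numerator(f)" (which determines g uniquely).

data Op (m : ℕ) : Set where
  A  : Fin m → Op m
  BC : Op m

Step : ∀ {m} → Op m → LP (suc m) → LP (suc m) → Set
Step (A i) f g =
  ((yL (inject₁ i) -L yL (Fin.suc i)) *L g)
    ≈L ((yL (inject₁ i) *L f) -L (yL (Fin.suc i) *L substL (swapExp (inject₁ i) (Fin.suc i)) f))
Step {m} BC f g =
  ((yL (fromℕ m) -L yinvL (fromℕ m)) *L g)
    ≈L (((yL (fromℕ m) +L βL) *L f) -L ((yinvL (fromℕ m) +L βL) *L substL (invExp (fromℕ m)) f))

-- Chain ops f g : g = f op₁ op₂ … opₖ (operators applied left to right)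
Chain : ∀ {m} → List (Op m) → LP (suc m) → LP (suc m) → Set
Chain [] f g = f ≈L g
Chain {m} (o ∷ os) f g = Σ[ h ∈ LP (suc m) ] (Step o f h × Chain os h g)

-- block s (0-based s = k-1): π_n^{BC} π_{n-1} ⋯ π_k
block : (m : ℕ) → ℕ → List (Op m)
block m s = BC ∷ map A (reverse (filter (λ t → s ℕ.≤? toℕ t) (allFin m)))

Φops : (m : ℕ) → List (Op m)
Φops m = concatMap (block m) (upTo (suc m))

-- Formal power series in x₁..xₙ with coefficients in LP n:
-- the coefficient of x^a for every exponent vector a.

PS : ℕ → Set
PS n = Vec ℕ n → LP n

_≟V_ : ∀ {n} (a b : Vec ℕ n) → _
_≟V_ = VecP.≡-dec ℕ._≟_

splits : ∀ {n} → Vec ℕ n → List (Vec ℕ n × Vec ℕ n)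
splits [] = ([] , []) ∷ []
splits (k ∷ a) =
  concatMap (λ j → map (λ { (b , c) → (j ∷ b , (k ℕ.∸ j) ∷ c) }) (splits a)) (upTo (suc k))

_*S_ : ∀ {n} → PS n → PS n → PS n
(f *S g) a = foldr _+L_ zeroL (map (λ { (b , c) → f b *L g c }) (splits a))

poly : ∀ {n} → List (Vec ℕ n × LP n) → PS n
poly [] a = zeroL
poly ((e , c) ∷ ts) a = if does (e ≟V a) then c +L poly ts a else poly ts a

oneS : ∀ {n} → PS n
oneS {n} = poly ((replicate n 0 , oneL) ∷ [])

prodS : ∀ {n} → List (PS n) → PS n
prodS = foldr _*S_ oneS

unitV : ∀ {n} → Fin n → Vec ℕ n
unitV {n} i = replicate n 0 [ i ]≔ 1

-- 1 / (1 - x_i c) = Σ_k c^k x_i^k   (c a Laurent polynomial in y, β)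
geom : ∀ {n} → Fin n → LP n → PS n
geom {n} i c a =
  if does (a ≟V (replicate n 0 [ i ]≔ lookup a i)) then powL c (lookup a i) else zeroL

-- Ω^A = ∏_{i+j ≤ n+1} 1/(1 - x_i y_j)   (1-based; i+j < n 0-based)
ΩA : (n : ℕ) → PS n
ΩA n = prodS (concatMap (λ i → map (λ j → geom i (yL j))
                 (filter (λ j → toℕ i ℕ.+ toℕ j ℕ.<? n) (allFin n))) (allFin n))

ΩBC : (n : ℕ) → PS n
ΩBC n = prodS (numer ++ (denA ++ denB))
  where
  numer1 : List (PS n)
  numer1 = concatMap (λ i → map (λ j → poly ((replicate n 0 , oneL) ∷ (zipWith ℕ._+_ (unitV i) (unitV j) , -L oneL) ∷ []))
             (filter (λ j → toℕ i ℕ.<? toℕ j) (allFin n))) (allFin n)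
  numer2 : List (PS n)
  numer2 = map (λ i → poly ((replicate n 0 , oneL) ∷ (unitV i , βL) ∷ [])) (allFin n)
  numer : List (PS n)
  numer = numer1 ++ numer2
  denA : List (PS n)
  denA = concatMap (λ i → map (λ j → geom i (yL j)) (allFin n)) (allFin n)
  denB : List (PS n)
  denB = concatMap (λ i → map (λ j → geom i (yinvL j))
             (filter (λ j → toℕ i ℕ.≤? toℕ j) (allFin n))) (allFin n)

-- Φ^BC is a word of n(n+1)/2 operators, and the kernel can be tracked through every prefix of it: each
-- intermediate kernel is a product of factors 1/(1 - xᵢyⱼ), 1/(1 - xᵢ/yⱼ), 1 - xᵢxⱼ and 1 + βxᵢ over index
-- sets of staircase shape, each operator adding a few factors. Applying πₖ (resp. π_n^BC) to such a product,
-- all factors symmetric in yₖ, yₖ₊₁ (resp. invariant under yₙ ↦ yₙ⁻¹) pass through the divided difference,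
-- and what remains is a rational identity in four (resp. two) geometric series, such as
--   (y - y⁻¹)(1 + βx) / ((1 - xy)(1 - x/y)) = (y + β)/(1 - xy) - (y⁻¹ + β)/(1 - x/y).
-- These identities hold in the ring of power series over ℤ[β][y^{±1}], in which 1/(1 - xc) is the geometric
-- series of c; comparing coefficients of x^a gives the defining equations of the operators.

module Submission where

open import Defs
open import Level using (0ℓ)
open import Function using (_∘_; id)
open import Function.Bundles using (_⇔_; mk⇔; Equivalence)
open import Data.Nat as ℕ using (ℕ; zero; suc; _∸_; _≤ᵇ_)
import Data.Nat.Properties as ℕP
open import Data.Integer as ℤ using (ℤ; 0ℤ; 1ℤ)
import Data.Integer.Properties as ℤP
open import Data.Integer.Solver using (module +-*-Solver)
open import Data.Fin using (Fin; zero; suc; toℕ; fromℕ; fromℕ<; inject₁)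
import Data.Fin.Properties as FinP
open FinP using (_≟_)
import Data.Fin.Permutation as Perm
import Data.Fin.Permutation.Components as PC
open import Data.Vec as Vec using (Vec; []; _∷_; replicate; zipWith; lookup; _[_]≔_)
import Data.Vec.Properties as VecP
open import Data.List as List using (List; []; _∷_; _++_; map; concatMap; foldr; filter; allFin; upTo; reverse)
import Data.List.Properties as ListP
open import Data.List.Membership.Propositional using (_∈_)
open import Data.List.Relation.Unary.Any using (here; there)
open import Data.Product using (_×_; _,_; proj₁; proj₂)
open import Data.Bool using (Bool; true; false; if_then_else_; _∧_; _∨_; T)
import Data.Bool.Properties as BoolP
open import Data.Maybe using (Maybe; just; nothing)
open import Data.Unit using (tt)
open import Data.Empty using (⊥-elim)
open import Relation.Nullary using (does; yes; no; ¬_; Dec)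
open import Relation.Nullary.Decidable using (dec-true; dec-false)
open import Relation.Unary using (Decidable)
import Relation.Binary.PropositionalEquality as P
open P using (_≡_; _≢_)
import Relation.Binary.Reasoning.Setoid as SetoidReasoning
open import Algebra.Bundles using (CommutativeRing)
open import Algebra.Structures using (IsCommutativeRing)
import Algebra.Properties.CommutativeMonoid.Sum as MonoidSum
import Algebra.Properties.CommutativeSemigroup as CommutativeSemigroupProperties
import Algebra.Properties.Monoid.Mult as MonoidMultiplication
import Algebra.Properties.Ring as RingProperties
import Algebra.Properties.Semiring.Mult as SemiringMultiplication
import Algebra.Solver.Ring as RingSolver
open import Algebra.Solver.Ring.AlmostCommutativeRing using (_-Raw-AlmostCommutative⟶_; fromCommutativeRing)

module ListSums (R : CommutativeRing 0ℓ 0ℓ) where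
  open CommutativeRing R
  open CommutativeSemigroupProperties +-commutativeSemigroup using (interchange)

  ∑ : {A : Set} → (A → Carrier) → List A → Carrier
  ∑ f xs = foldr _+_ 0# (map f xs)

  module _ {A : Set} where
    ∑-cong : {f g : A → Carrier} → (∀ x → f x ≈ g x) → ∀ xs → ∑ f xs ≈ ∑ g xs
    ∑-cong e [] = refl
    ∑-cong e (x ∷ xs) = +-cong (e x) (∑-cong e xs)

    ∑-++ : ∀ (f : A → Carrier) xs ys → ∑ f (xs ++ ys) ≈ ∑ f xs + ∑ f ys
    ∑-++ f [] ys = sym (+-identityˡ _)
    ∑-++ f (x ∷ xs) ys = trans (+-congˡ (∑-++ f xs ys)) (sym (+-assoc (f x) _ _))

    ∑-+ : ∀ (f g : A → Carrier) xs → ∑ (λ x → f x + g x) xs ≈ ∑ f xs + ∑ g xs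
    ∑-+ f g [] = sym (+-identityˡ 0#)
    ∑-+ f g (x ∷ xs) = trans (+-congˡ (∑-+ f g xs)) (interchange (f x) (g x) _ _)

    ∑-0 : ∀ (xs : List A) → ∑ (λ _ → 0#) xs ≈ 0#
    ∑-0 [] = refl
    ∑-0 (x ∷ xs) = trans (+-identityˡ _) (∑-0 xs)

    ∑-*ˡ : ∀ c (f : A → Carrier) xs → c * ∑ f xs ≈ ∑ (λ x → c * f x) xs
    ∑-*ˡ c f [] = zeroʳ c
    ∑-*ˡ c f (x ∷ xs) = trans (distribˡ c (f x) _) (+-congˡ (∑-*ˡ c f xs))

    ∑-*ʳ : ∀ c (f : A → Carrier) xs → ∑ f xs * c ≈ ∑ (λ x → f x * c) xs
    ∑-*ʳ c f xs = trans (*-comm _ c) (trans (∑-*ˡ c f xs) (∑-cong (λ x → *-comm c (f x)) xs))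

  module _ {A B : Set} where
    ∑-map : ∀ (f : B → Carrier) (g : A → B) xs → ∑ f (map g xs) ≈ ∑ (f ∘ g) xs
    ∑-map f g [] = refl
    ∑-map f g (x ∷ xs) = +-congˡ (∑-map f g xs)

    ∑-concatMap : ∀ (f : B → Carrier) (g : A → List B) xs → ∑ f (concatMap g xs) ≈ ∑ (λ x → ∑ f (g x)) xs
    ∑-concatMap f g [] = refl
    ∑-concatMap f g (x ∷ xs) = trans (∑-++ f (g x) (concatMap g xs)) (+-congˡ (∑-concatMap f g xs))

    ∑-comm : ∀ (f : A → B → Carrier) xs ys → ∑ (λ x → ∑ (f x) ys) xs ≈ ∑ (λ y → ∑ (λ x → f x y) xs) ys
    ∑-comm f [] ys = sym (∑-0 ys)
    ∑-comm f (x ∷ xs) ys = trans (+-congˡ (∑-comm f xs ys)) (sym (∑-+ (f x) (λ y → ∑ (λ x → f x y) xs) ys))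

-- The Laurent polynomial ring ℤ[β][y₁^{±1}, …, yₙ^{±1}]

module Monomials {n : ℕ} where

  mulM-comm : (μ ν : Mon n) → mulM μ ν ≡ mulM ν μ
  mulM-comm (a , u) (b , v) = P.cong₂ _,_ (ℕP.+-comm a b) (VecP.zipWith-comm ℤP.+-comm u v)

  mulM-assoc : (μ ν κ : Mon n) → mulM (mulM μ ν) κ ≡ mulM μ (mulM ν κ)
  mulM-assoc (a , u) (b , v) (c , w) = P.cong₂ _,_ (ℕP.+-assoc a b c) (VecP.zipWith-assoc ℤP.+-assoc u v w)

  oneM : Mon n
  oneM = (0 , replicate n 0ℤ)

  mulM-identityˡ : (μ : Mon n) → mulM oneM μ ≡ μ
  mulM-identityˡ (a , u) = P.cong (a ,_) (VecP.zipWith-identityˡ ℤP.+-identityˡ u)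

  -- β-exponents are natural numbers, so the quotient is meaningful only when ν divides μ.
  divM : Mon n → Mon n → Mon n
  divM (a , u) (b , v) = (a ∸ b , zipWith ℤ._-_ u v)

  mulM-divM : ∀ μ ν κ → mulM ν κ ≡ μ → κ ≡ divM μ ν
  mulM-divM (a , u) (b , v) (c , w) e =
    P.cong₂ _,_ (P.trans (P.sym (ℕP.m+n∸m≡n b c)) (P.cong (_∸ b) (P.cong proj₁ e))) (cancel v w u (P.cong proj₂ e))
    where
    open +-*-Solver
    cancel : ∀ {k} (v w u : Vec ℤ k) → zipWith ℤ._+_ v w ≡ u → w ≡ zipWith ℤ._-_ u v
    cancel [] [] [] _ = P.refl
    cancel (x ∷ v) (y ∷ w) (z ∷ u) e = P.cong₂ _∷_
      (P.trans (solve 2 (λ x y → y := x :+ y :- x) P.refl x y) (P.cong (ℤ._- x) (P.cong Vec.head e)))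
      (cancel v w u (P.cong Vec.tail e))

  divM-mulM : ∀ μ ν → proj₁ ν ℕ.≤ proj₁ μ → mulM ν (divM μ ν) ≡ μ
  divM-mulM (a , u) (b , v) b≤a = P.cong₂ _,_ (ℕP.m+[n∸m]≡n b≤a) (uncancel v u)
    where
    open +-*-Solver
    uncancel : ∀ {k} (v u : Vec ℤ k) → zipWith ℤ._+_ v (zipWith ℤ._-_ u v) ≡ u
    uncancel [] [] = P.refl
    uncancel (x ∷ v) (z ∷ u) = P.cong₂ _∷_ (solve 2 (λ x z → x :+ (z :- x) := z) P.refl x z) (uncancel v u)

module LaurentRing (n : ℕ) where
  open Monomials {n}
  open ListSums ℤP.+-*-commutativeRing
  open P.≡-Reasoning

  Term : Set
  Term = ℤ × Mon n

  _⊗_ : Term → Term → Term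
  (c , μ) ⊗ (d , ν) = (c ℤ.* d , mulM μ ν)

  ⊗-comm : ∀ s t → s ⊗ t ≡ t ⊗ s
  ⊗-comm (c , μ) (d , ν) = P.cong₂ _,_ (ℤP.*-comm c d) (mulM-comm μ ν)

  ⊗-assoc : ∀ s t u → (s ⊗ t) ⊗ u ≡ s ⊗ (t ⊗ u)
  ⊗-assoc (c , μ) (d , ν) (e , κ) = P.cong₂ _,_ (ℤP.*-assoc c d e) (mulM-assoc μ ν κ)

  termCoeff : Mon n → Term → ℤ
  termCoeff μ (c , ν) = if does (ν ≟M μ) then c else 0ℤ

  coeffL-∑ : ∀ (p : LP n) μ → coeffL p μ ≡ ∑ (termCoeff μ) p
  coeffL-∑ [] μ = P.refl
  coeffL-∑ ((c , ν) ∷ p) μ with ν ≟M μ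
  ... | yes _ = P.cong (ℤ._+_ c) (coeffL-∑ p μ)
  ... | no _ = P.trans (coeffL-∑ p μ) (P.sym (ℤP.+-identityˡ _))

  coeffL-++ : ∀ (p q : LP n) μ → coeffL (p ++ q) μ ≡ coeffL p μ ℤ.+ coeffL q μ
  coeffL-++ p q μ = begin
    coeffL (p ++ q) μ                         ≡⟨ coeffL-∑ (p ++ q) μ ⟩
    ∑ (termCoeff μ) (p ++ q)                  ≡⟨ ∑-++ (termCoeff μ) p q ⟩
    ∑ (termCoeff μ) p ℤ.+ ∑ (termCoeff μ) q   ≡⟨ P.sym (P.cong₂ ℤ._+_ (coeffL-∑ p μ) (coeffL-∑ q μ)) ⟩
    coeffL p μ ℤ.+ coeffL q μ                 ∎

  coeffL-neg : ∀ (p : LP n) μ → coeffL (-L p) μ ≡ ℤ.- coeffL p μ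
  coeffL-neg [] μ = P.refl
  coeffL-neg ((c , ν) ∷ p) μ with ν ≟M μ
  ... | yes _ = P.trans (P.cong (ℤ._+_ (ℤ.- c)) (coeffL-neg p μ)) (P.sym (ℤP.neg-distrib-+ c _))
  ... | no _ = coeffL-neg p μ

  coeffL-* : ∀ (p q : LP n) μ → coeffL (p *L q) μ ≡ ∑ (λ t → ∑ (λ s → termCoeff μ (t ⊗ s)) q) p
  coeffL-* p q μ = P.trans (coeffL-∑ (p *L q) μ)
    (P.trans (∑-concatMap (termCoeff μ) (λ t → map (t ⊗_) q) p)
      (∑-cong (λ t → ∑-map (termCoeff μ) (t ⊗_) q) p))

  onlyIf : {A : Set} → Dec A → ℤ → ℤ
  onlyIf (yes _) x = x
  onlyIf (no _) x = 0ℤ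

  -- Multiplying by a single term shifts exponents, so the coefficient of μ in t ⊗ q is read off q at μ / t.
  termCoeff-⊗ : ∀ μ (t s : Term) → termCoeff μ (t ⊗ s) ≡
    onlyIf (proj₁ (proj₂ t) ℕ.≤? proj₁ μ) (proj₁ t ℤ.* termCoeff (divM μ (proj₂ t)) s)
  termCoeff-⊗ μ@(a , u) (c , ν@(b , v)) (d , κ@(b' , w)) with b ℕ.≤? a
  ... | no ν∤μ with mulM ν κ ≟M μ
  ...   | yes e = ⊥-elim (ν∤μ (P.subst (b ℕ.≤_) (P.cong proj₁ e) (ℕP.m≤m+n b b')))
  ...   | no _ = P.refl
  termCoeff-⊗ μ@(a , u) (c , ν@(b , v)) (d , κ@(b' , w)) | yes ν∣μ with mulM ν κ ≟M μ | κ ≟M divM μ ν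
  ... | yes _ | yes _ = P.refl
  ... | yes e | no ne = ⊥-elim (ne (mulM-divM μ ν κ e))
  ... | no ne | yes e = ⊥-elim (ne (P.trans (P.cong (mulM ν) e) (divM-mulM μ ν ν∣μ)))
  ... | no _ | no _ = P.sym (ℤP.*-zeroʳ c)

  coeffL-⊗ : ∀ μ (t : Term) (q : LP n) → ∑ (λ s → termCoeff μ (t ⊗ s)) q ≡
    onlyIf (proj₁ (proj₂ t) ℕ.≤? proj₁ μ) (proj₁ t ℤ.* coeffL q (divM μ (proj₂ t)))
  coeffL-⊗ μ t q with proj₁ (proj₂ t) ℕ.≤? proj₁ μ | termCoeff-⊗ μ t
  ... | yes _ | shift = P.trans (∑-cong shift q) (P.trans (P.sym (∑-*ˡ (proj₁ t) _ q)) (P.cong (proj₁ t ℤ.*_) (P.sym (coeffL-∑ q _))))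
  ... | no _ | shift = P.trans (∑-cong shift q) (∑-0 q)

  -- Coefficientwise equality, wrapped in a record so that unification can recover both sides.
  infix 4 _≋_
  record _≋_ (p q : LP n) : Set where
    constructor mk≋
    field get≋ : p ≈L q
  open _≋_ public

  +L-cong : ∀ {p p' q q'} → p ≋ p' → q ≋ q' → p +L q ≋ p' +L q'
  +L-cong {p} {p'} {q} {q'} (mk≋ e) (mk≋ f) = mk≋ λ μ →
    P.trans (coeffL-++ p q μ) (P.trans (P.cong₂ ℤ._+_ (e μ) (f μ)) (P.sym (coeffL-++ p' q' μ)))

  +L-assoc : ∀ p q r → (p +L q) +L r ≋ p +L (q +L r)
  +L-assoc p q r = mk≋ λ μ → P.cong (λ z → coeffL z μ) (ListP.++-assoc p q r)

  +L-comm : ∀ p q → p +L q ≋ q +L p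
  +L-comm p q = mk≋ λ μ →
    P.trans (coeffL-++ p q μ) (P.trans (ℤP.+-comm (coeffL p μ) (coeffL q μ)) (P.sym (coeffL-++ q p μ)))

  +L-identityʳ : ∀ p → p +L zeroL ≋ p
  +L-identityʳ p = mk≋ λ μ → P.trans (coeffL-++ p [] μ) (ℤP.+-identityʳ _)

  -L-cong : ∀ {p q} → p ≋ q → -L p ≋ -L q
  -L-cong {p} {q} (mk≋ e) = mk≋ λ μ → P.trans (coeffL-neg p μ) (P.trans (P.cong ℤ.-_ (e μ)) (P.sym (coeffL-neg q μ)))

  -L-inverseˡ : ∀ p → (-L p) +L p ≋ zeroL
  -L-inverseˡ p = mk≋ λ μ →
    P.trans (coeffL-++ (-L p) p μ) (P.trans (P.cong (ℤ._+ coeffL p μ) (coeffL-neg p μ)) (ℤP.+-inverseˡ (coeffL p μ)))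

  -L-inverseʳ : ∀ p → p +L (-L p) ≋ zeroL
  -L-inverseʳ p = mk≋ λ μ →
    P.trans (coeffL-++ p (-L p) μ) (P.trans (P.cong (ℤ._+_ (coeffL p μ)) (coeffL-neg p μ)) (ℤP.+-inverseʳ (coeffL p μ)))

  *L-comm : ∀ p q → p *L q ≋ q *L p
  *L-comm p q = mk≋ λ μ → P.trans (coeffL-* p q μ) (P.trans (∑-comm _ p q)
    (P.trans (∑-cong (λ s → ∑-cong (λ t → P.cong (termCoeff μ) (⊗-comm t s)) p) q) (P.sym (coeffL-* q p μ))))

  *L-congˡ : ∀ p {q q'} → q ≋ q' → p *L q ≋ p *L q'
  *L-congˡ p {q} {q'} (mk≋ e) = mk≋ λ μ →
    P.trans (coeffL-* p q μ) (P.trans (∑-cong (shifted μ) p) (P.sym (coeffL-* p q' μ)))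
    where
    shifted : ∀ μ t → ∑ (λ s → termCoeff μ (t ⊗ s)) q ≡ ∑ (λ s → termCoeff μ (t ⊗ s)) q'
    shifted μ t = P.trans (coeffL-⊗ μ t q)
      (P.trans (P.cong (λ z → onlyIf (proj₁ (proj₂ t) ℕ.≤? proj₁ μ) (proj₁ t ℤ.* z)) (e _)) (P.sym (coeffL-⊗ μ t q')))

  *L-cong : ∀ {p p' q q'} → p ≋ p' → q ≋ q' → p *L q ≋ p' *L q'
  *L-cong {p} {p'} {q} {q'} e f = mk≋ λ μ → P.trans (get≋ (*L-congˡ p f) μ)
    (P.trans (get≋ (*L-comm p q') μ) (P.trans (get≋ (*L-congˡ q' e) μ) (get≋ (*L-comm q' p') μ)))

  *L-assoc : ∀ p q r → (p *L q) *L r ≋ p *L (q *L r)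
  *L-assoc p q r = mk≋ λ μ → begin
    coeffL ((p *L q) *L r) μ
      ≡⟨ coeffL-* (p *L q) r μ ⟩
    ∑ (λ w → ∑ (λ u → termCoeff μ (w ⊗ u)) r) (p *L q)
      ≡⟨ ∑-concatMap _ (λ t → map (t ⊗_) q) p ⟩
    ∑ (λ t → ∑ (λ w → ∑ (λ u → termCoeff μ (w ⊗ u)) r) (map (t ⊗_) q)) p
      ≡⟨ ∑-cong (λ t → ∑-map _ (t ⊗_) q) p ⟩
    ∑ (λ t → ∑ (λ s → ∑ (λ u → termCoeff μ ((t ⊗ s) ⊗ u)) r) q) p
      ≡⟨ ∑-cong (λ t → ∑-cong (λ s → ∑-cong (λ u → P.cong (termCoeff μ) (⊗-assoc t s u)) r) q) p ⟩
    ∑ (λ t → ∑ (λ s → ∑ (λ u → termCoeff μ (t ⊗ (s ⊗ u))) r) q) p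
      ≡⟨ P.sym (∑-cong (λ t → P.trans (∑-concatMap _ (λ s → map (s ⊗_) r) q) (∑-cong (λ s → ∑-map _ (s ⊗_) r) q)) p) ⟩
    ∑ (λ t → ∑ (λ w → termCoeff μ (t ⊗ w)) (q *L r)) p
      ≡⟨ P.sym (coeffL-* p (q *L r) μ) ⟩
    coeffL (p *L (q *L r)) μ ∎

  *L-distribˡ : ∀ p q r → p *L (q +L r) ≋ (p *L q) +L (p *L r)
  *L-distribˡ p q r = mk≋ λ μ → begin
    coeffL (p *L (q ++ r)) μ
      ≡⟨ coeffL-* p (q ++ r) μ ⟩
    ∑ (λ t → ∑ (λ s → termCoeff μ (t ⊗ s)) (q ++ r)) p
      ≡⟨ ∑-cong (λ t → ∑-++ _ q r) p ⟩
    ∑ (λ t → ∑ (λ s → termCoeff μ (t ⊗ s)) q ℤ.+ ∑ (λ s → termCoeff μ (t ⊗ s)) r) p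
      ≡⟨ ∑-+ _ _ p ⟩
    ∑ (λ t → ∑ (λ s → termCoeff μ (t ⊗ s)) q) p ℤ.+ ∑ (λ t → ∑ (λ s → termCoeff μ (t ⊗ s)) r) p
      ≡⟨ P.sym (P.cong₂ ℤ._+_ (coeffL-* p q μ) (coeffL-* p r μ)) ⟩
    coeffL (p *L q) μ ℤ.+ coeffL (p *L r) μ
      ≡⟨ P.sym (coeffL-++ (p *L q) (p *L r) μ) ⟩
    coeffL ((p *L q) ++ (p *L r)) μ ∎

  *L-distribʳ : ∀ r p q → (p +L q) *L r ≋ (p *L r) +L (q *L r)
  *L-distribʳ r p q = mk≋ λ μ → P.trans (get≋ (*L-comm (p +L q) r) μ)
    (P.trans (get≋ (*L-distribˡ r p q) μ) (get≋ (+L-cong (*L-comm r p) (*L-comm r q)) μ))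

  *L-identityˡ : ∀ p → oneL *L p ≋ p
  *L-identityˡ p = mk≋ λ μ →
    P.trans (coeffL-* oneL p μ) (P.trans (ℤP.+-identityʳ _) (P.trans (∑-cong (unit μ) p) (P.sym (coeffL-∑ p μ))))
    where
    unit : ∀ μ (s : Term) → termCoeff μ ((1ℤ , oneM) ⊗ s) ≡ termCoeff μ s
    unit μ (d , ν) = P.cong₂ (λ a b → termCoeff μ (a , b)) (ℤP.*-identityˡ d) (mulM-identityˡ ν)

  isCommutativeRing : IsCommutativeRing _≋_ _+L_ _*L_ -L_ zeroL oneL
  isCommutativeRing = record
    { isRing = record
      { +-isAbelianGroup = record
        { isGroup = record
          { isMonoid = record
            { isSemigroup = record
              { isMagma = record
                { isEquivalence = record
                  { refl = mk≋ λ μ → P.refl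
                  ; sym = λ e → mk≋ λ μ → P.sym (get≋ e μ)
                  ; trans = λ e f → mk≋ λ μ → P.trans (get≋ e μ) (get≋ f μ) }
                ; ∙-cong = +L-cong }
              ; assoc = +L-assoc }
            ; identity = (λ p → mk≋ λ μ → P.refl) , +L-identityʳ }
          ; inverse = -L-inverseˡ , -L-inverseʳ
          ; ⁻¹-cong = -L-cong }
        ; comm = +L-comm }
      ; *-cong = *L-cong
      ; *-assoc = *L-assoc
      ; *-identity = *L-identityˡ , (λ p → mk≋ λ μ → P.trans (get≋ (*L-comm p oneL) μ) (get≋ (*L-identityˡ p) μ))
      ; distrib = *L-distribˡ , *L-distribʳ }
    ; *-comm = *L-comm }

LP-ring : ℕ → CommutativeRing 0ℓ 0ℓ
LP-ring n = record { isCommutativeRing = LaurentRing.isCommutativeRing n }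

-- The ring of power series in x₁, …, xₙ over the Laurent polynomials

module SplitSums (R : CommutativeRing 0ℓ 0ℓ) where
  open CommutativeRing R
  open CommutativeSemigroupProperties +-commutativeSemigroup using (interchange)
  open ListSums R
  open SetoidReasoning setoid

  ∑< : (ℕ → Carrier) → ℕ → Carrier
  ∑< φ zero = 0#
  ∑< φ (suc k) = φ 0 + ∑< (φ ∘ suc) k

  ∑-applyUpTo : ∀ {A : Set} (f : A → Carrier) (g : ℕ → A) k → ∑ f (List.applyUpTo g k) ≈ ∑< (f ∘ g) k
  ∑-applyUpTo f g zero = refl
  ∑-applyUpTo f g (suc k) = +-congˡ (∑-applyUpTo f (g ∘ suc) k)

  ∑<-cong : ∀ {φ ψ : ℕ → Carrier} → (∀ x → φ x ≈ ψ x) → ∀ k → ∑< φ k ≈ ∑< ψ k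
  ∑<-cong e zero = refl
  ∑<-cong e (suc k) = +-cong (e 0) (∑<-cong (e ∘ suc) k)

  ∑<-+ : ∀ (φ ψ : ℕ → Carrier) k → ∑< (λ x → φ x + ψ x) k ≈ ∑< φ k + ∑< ψ k
  ∑<-+ φ ψ zero = sym (+-identityˡ 0#)
  ∑<-+ φ ψ (suc k) = trans (+-congˡ (∑<-+ (φ ∘ suc) (ψ ∘ suc) k)) (interchange (φ 0) (ψ 0) _ _)

  ∑<-∑ : ∀ {A : Set} (f : ℕ → A → Carrier) k xs → ∑< (λ j → ∑ (f j) xs) k ≈ ∑ (λ x → ∑< (λ j → f j x) k) xs
  ∑<-∑ f zero xs = sym (∑-0 xs)
  ∑<-∑ f (suc k) xs = trans (+-congˡ (∑<-∑ (f ∘ suc) k xs)) (sym (∑-+ (f 0) _ xs))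

  antidiagonal : (ℕ → ℕ → Carrier) → ℕ → Carrier
  antidiagonal ψ k = ∑< (λ j → ψ j (k ∸ j)) (suc k)

  antidiagonal-cong : ∀ {ψ ψ'} → (∀ i j → ψ i j ≈ ψ' i j) → ∀ k → antidiagonal ψ k ≈ antidiagonal ψ' k
  antidiagonal-cong e k = ∑<-cong (λ j → e j (k ∸ j)) (suc k)

  antidiagonal-+ : ∀ ψ ψ' k → antidiagonal (λ i j → ψ i j + ψ' i j) k ≈ antidiagonal ψ k + antidiagonal ψ' k
  antidiagonal-+ ψ ψ' k = ∑<-+ (λ j → ψ j (k ∸ j)) (λ j → ψ' j (k ∸ j)) (suc k)

  antidiagonal-zero : ∀ ψ → antidiagonal ψ 0 ≈ ψ 0 0
  antidiagonal-zero ψ = +-identityʳ _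

  antidiagonal-sucʳ : ∀ ψ k → antidiagonal ψ (suc k) ≈ antidiagonal (λ j l → ψ j (suc l)) k + ψ (suc k) 0
  antidiagonal-sucʳ ψ zero = trans (+-congˡ (+-identityʳ _)) (+-congʳ (sym (+-identityʳ _)))
  antidiagonal-sucʳ ψ (suc k) = begin
    antidiagonal ψ (suc (suc k))
      ≈⟨ +-congˡ (antidiagonal-sucʳ (λ j l → ψ (suc j) l) k) ⟩
    ψ 0 (suc (suc k)) + (antidiagonal (λ j l → ψ (suc j) (suc l)) k + ψ (suc (suc k)) 0)
      ≈⟨ sym (+-assoc (ψ 0 (suc (suc k))) _ _) ⟩
    antidiagonal (λ j l → ψ j (suc l)) (suc k) + ψ (suc (suc k)) 0 ∎

  antidiagonal-flip : ∀ ψ k → antidiagonal ψ k ≈ antidiagonal (λ i j → ψ j i) k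
  antidiagonal-flip ψ zero = refl
  antidiagonal-flip ψ (suc k) = begin
    ψ 0 (suc k) + antidiagonal (λ j l → ψ (suc j) l) k
      ≈⟨ +-congˡ (antidiagonal-flip (λ j l → ψ (suc j) l) k) ⟩
    ψ 0 (suc k) + antidiagonal (λ j l → ψ (suc l) j) k
      ≈⟨ +-comm (ψ 0 (suc k)) (antidiagonal (λ j l → ψ (suc l) j) k) ⟩
    antidiagonal (λ j l → ψ (suc l) j) k + ψ 0 (suc k)
      ≈⟨ sym (antidiagonal-sucʳ (λ i j → ψ j i) k) ⟩
    antidiagonal (λ i j → ψ j i) (suc k) ∎

  antidiagonal-assoc : ∀ (χ : ℕ → ℕ → ℕ → Carrier) k →
    antidiagonal (λ j m → antidiagonal (λ i l → χ i l m) j) k ≈ antidiagonal (λ i j → antidiagonal (λ l m → χ i l m) j) k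
  antidiagonal-assoc χ zero = refl
  antidiagonal-assoc χ (suc k) = begin
    antidiagonal (λ i l → χ i l (suc k)) 0 + antidiagonal (λ j m → antidiagonal (λ i l → χ i l m) (suc j)) k
      ≈⟨ +-cong (antidiagonal-zero (λ i l → χ i l (suc k)))
                (antidiagonal-+ (λ j m → χ 0 (suc j) m) (λ j m → antidiagonal (λ i l → χ (suc i) l m) j) k) ⟩
    χ 0 0 (suc k) + (antidiagonal (λ j m → χ 0 (suc j) m) k + antidiagonal (λ j m → antidiagonal (λ i l → χ (suc i) l m) j) k)
      ≈⟨ +-congˡ (+-congˡ (antidiagonal-assoc (λ i → χ (suc i)) k)) ⟩
    χ 0 0 (suc k) + (antidiagonal (λ j m → χ 0 (suc j) m) k + antidiagonal (λ i j → antidiagonal (λ l m → χ (suc i) l m) j) k)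
      ≈⟨ sym (+-assoc (χ 0 0 (suc k)) _ _) ⟩
    antidiagonal (λ l m → χ 0 l m) (suc k) + antidiagonal (λ i j → antidiagonal (λ l m → χ (suc i) l m) j) k ∎

  ∑-splits : ∀ {k} → (Vec ℕ k × Vec ℕ k → Carrier) → Vec ℕ k → Carrier
  ∑-splits φ a = ∑ φ (splits a)

  ∑-splits-cong : ∀ {k} {φ ψ : Vec ℕ k × Vec ℕ k → Carrier} → (∀ x → φ x ≈ ψ x) → ∀ a → ∑-splits φ a ≈ ∑-splits ψ a
  ∑-splits-cong e a = ∑-cong e (splits a)

  ∑-splits-∷ : ∀ {k} (φ : Vec ℕ (suc k) × Vec ℕ (suc k) → Carrier) x a →
    ∑-splits φ (x ∷ a) ≈ antidiagonal (λ j j' → ∑-splits (λ bc → φ (j ∷ proj₁ bc , j' ∷ proj₂ bc)) a) x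
  ∑-splits-∷ φ x a = begin
    ∑-splits φ (x ∷ a)
      ≈⟨ ∑-concatMap φ (λ j → map (λ bc → (j ∷ proj₁ bc , (x ∸ j) ∷ proj₂ bc)) (splits a)) (upTo (suc x)) ⟩
    ∑ (λ j → ∑ φ (map (λ bc → (j ∷ proj₁ bc , (x ∸ j) ∷ proj₂ bc)) (splits a))) (upTo (suc x))
      ≈⟨ ∑-cong (λ j → ∑-map φ _ (splits a)) (upTo (suc x)) ⟩
    ∑ (λ j → ∑-splits (λ bc → φ (j ∷ proj₁ bc , (x ∸ j) ∷ proj₂ bc)) a) (upTo (suc x))
      ≈⟨ ∑-applyUpTo _ id (suc x) ⟩
    antidiagonal (λ j j' → ∑-splits (λ bc → φ (j ∷ proj₁ bc , j' ∷ proj₂ bc)) a) x ∎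

  ∑-splits-swap : ∀ {k} (φ : Vec ℕ k × Vec ℕ k → Carrier) a → ∑-splits φ a ≈ ∑-splits (λ bc → φ (proj₂ bc , proj₁ bc)) a
  ∑-splits-swap φ [] = refl
  ∑-splits-swap φ (x ∷ a) = begin
    ∑-splits φ (x ∷ a)
      ≈⟨ ∑-splits-∷ φ x a ⟩
    antidiagonal (λ j j' → ∑-splits (λ bc → φ (j ∷ proj₁ bc , j' ∷ proj₂ bc)) a) x
      ≈⟨ antidiagonal-cong (λ j j' → ∑-splits-swap (λ bc → φ (j ∷ proj₁ bc , j' ∷ proj₂ bc)) a) x ⟩
    antidiagonal (λ j j' → ∑-splits (λ bc → φ (j ∷ proj₂ bc , j' ∷ proj₁ bc)) a) x
      ≈⟨ antidiagonal-flip (λ j j' → ∑-splits (λ bc → φ (j ∷ proj₂ bc , j' ∷ proj₁ bc)) a) x ⟩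
    antidiagonal (λ j j' → ∑-splits (λ bc → φ (j' ∷ proj₂ bc , j ∷ proj₁ bc)) a) x
      ≈⟨ sym (∑-splits-∷ (λ bc → φ (proj₂ bc , proj₁ bc)) x a) ⟩
    ∑-splits (λ bc → φ (proj₂ bc , proj₁ bc)) (x ∷ a) ∎

  ∑-splits-antidiagonal : ∀ {k} (f : Vec ℕ k × Vec ℕ k → ℕ → ℕ → Carrier) a x →
    ∑-splits (λ bc → antidiagonal (f bc) x) a ≈ antidiagonal (λ i l → ∑-splits (λ bc → f bc i l) a) x
  ∑-splits-antidiagonal f a x = sym (∑<-∑ (λ j bc → f bc j (x ∸ j)) (suc x) (splits a))

  ∑-splits-assoc : ∀ {k} (φ : Vec ℕ k → Vec ℕ k → Vec ℕ k → Carrier) a →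
    ∑-splits (λ bc → ∑-splits (λ de → φ (proj₁ de) (proj₂ de) (proj₂ bc)) (proj₁ bc)) a ≈
    ∑-splits (λ db → ∑-splits (λ ec → φ (proj₁ db) (proj₁ ec) (proj₂ ec)) (proj₂ db)) a
  ∑-splits-assoc φ [] = refl
  ∑-splits-assoc φ (x ∷ a) = begin
    ∑-splits (λ bc → ∑-splits (λ de → φ (proj₁ de) (proj₂ de) (proj₂ bc)) (proj₁ bc)) (x ∷ a)
      ≈⟨ ∑-splits-∷ (λ bc → ∑-splits (λ de → φ (proj₁ de) (proj₂ de) (proj₂ bc)) (proj₁ bc)) x a ⟩
    antidiagonal (λ j m → ∑-splits (λ bc → ∑-splits (λ de → φ (proj₁ de) (proj₂ de) (m ∷ proj₂ bc)) (j ∷ proj₁ bc)) a) x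
      ≈⟨ antidiagonal-cong (λ j m → ∑-splits-cong (λ bc → ∑-splits-∷ (λ de → φ (proj₁ de) (proj₂ de) (m ∷ proj₂ bc)) j (proj₁ bc)) a) x ⟩
    antidiagonal (λ j m → ∑-splits (λ bc → antidiagonal (λ i l → ∑-splits (λ de → φ (i ∷ proj₁ de) (l ∷ proj₂ de) (m ∷ proj₂ bc)) (proj₁ bc)) j) a) x
      ≈⟨ antidiagonal-cong (λ j m → ∑-splits-antidiagonal (λ bc i l → ∑-splits (λ de → φ (i ∷ proj₁ de) (l ∷ proj₂ de) (m ∷ proj₂ bc)) (proj₁ bc)) a j) x ⟩
    antidiagonal (λ j m → antidiagonal (λ i l → ∑-splits (λ bc → ∑-splits (λ de → φ (i ∷ proj₁ de) (l ∷ proj₂ de) (m ∷ proj₂ bc)) (proj₁ bc)) a) j) x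
      ≈⟨ antidiagonal-cong (λ j m → antidiagonal-cong (λ i l → ∑-splits-assoc (λ d e c → φ (i ∷ d) (l ∷ e) (m ∷ c)) a) j) x ⟩
    antidiagonal (λ j m → antidiagonal (λ i l → Y i l m) j) x
      ≈⟨ antidiagonal-assoc Y x ⟩
    antidiagonal (λ i j' → antidiagonal (λ l m → Y i l m) j') x
      ≈⟨ sym (antidiagonal-cong (λ i j' → ∑-splits-antidiagonal (λ db l m → ∑-splits (λ ec → φ (i ∷ proj₁ db) (l ∷ proj₁ ec) (m ∷ proj₂ ec)) (proj₂ db)) a j') x) ⟩
    antidiagonal (λ i j' → ∑-splits (λ db → antidiagonal (λ l m → ∑-splits (λ ec → φ (i ∷ proj₁ db) (l ∷ proj₁ ec) (m ∷ proj₂ ec)) (proj₂ db)) j') a) x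
      ≈⟨ sym (antidiagonal-cong (λ i j' → ∑-splits-cong (λ db → ∑-splits-∷ (λ ec → φ (i ∷ proj₁ db) (proj₁ ec) (proj₂ ec)) j' (proj₂ db)) a) x) ⟩
    antidiagonal (λ i j' → ∑-splits (λ db → ∑-splits (λ ec → φ (i ∷ proj₁ db) (proj₁ ec) (proj₂ ec)) (j' ∷ proj₂ db)) a) x
      ≈⟨ sym (∑-splits-∷ (λ db → ∑-splits (λ ec → φ (proj₁ db) (proj₁ ec) (proj₂ ec)) (proj₂ db)) x a) ⟩
    ∑-splits (λ db → ∑-splits (λ ec → φ (proj₁ db) (proj₁ ec) (proj₂ ec)) (proj₂ db)) (x ∷ a) ∎
    where
    Y : ℕ → ℕ → ℕ → Carrier
    Y i l m = ∑-splits (λ db → ∑-splits (λ ec → φ (i ∷ proj₁ db) (l ∷ proj₁ ec) (m ∷ proj₂ ec)) (proj₂ db)) a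

_≤ᵛ_ : ∀ {k} → Vec ℕ k → Vec ℕ k → Bool
[] ≤ᵛ [] = true
(x ∷ xs) ≤ᵛ (y ∷ ys) = (x ≤ᵇ y) ∧ (xs ≤ᵛ ys)

_∸ᵛ_ : ∀ {k} → Vec ℕ k → Vec ℕ k → Vec ℕ k
_∸ᵛ_ = zipWith _∸_

0≤ᵛ : ∀ {k} (a : Vec ℕ k) → replicate k 0 ≤ᵛ a ≡ true
0≤ᵛ [] = P.refl
0≤ᵛ (x ∷ a) = 0≤ᵛ a

∸ᵛ-identityʳ : ∀ {k} (a : Vec ℕ k) → a ∸ᵛ replicate k 0 ≡ a
∸ᵛ-identityʳ [] = P.refl
∸ᵛ-identityʳ (x ∷ a) = P.cong (x ∷_) (∸ᵛ-identityʳ a)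

module SeriesRing (n : ℕ) where
  open CommutativeRing (LP-ring n) hiding (zero)
  open ListSums (LP-ring n)
  open SplitSums (LP-ring n)
  open SetoidReasoning setoid

  when : Bool → LP n → LP n
  when true x = x
  when false x = zeroL

  when-∧ : ∀ b₁ b₂ x → when (b₁ ∧ b₂) x ≈ when b₁ (when b₂ x)
  when-∧ true b₂ x = refl
  when-∧ false b₂ x = refl

  when-cong : ∀ b {x y} → x ≈ y → when b x ≈ when b y
  when-cong true e = e
  when-cong false e = refl

  when-*ʳ : ∀ b x y → when b x * y ≈ when b (x * y)
  when-*ʳ true x y = refl
  when-*ʳ false x y = zeroˡ y

  when-*ˡ : ∀ b x y → x * when b y ≈ when b (x * y)
  when-*ˡ true x y = refl
  when-*ˡ false x y = zeroʳ x

  when-+ : ∀ b x y → when b (x + y) ≈ when b x + when b y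
  when-+ true x y = refl
  when-+ false x y = sym (+-identityˡ 0#)

  when-neg : ∀ b x → when b (- x) ≈ - when b x
  when-neg true x = refl
  when-neg false x = sym (-‿inverseʳ 0#)

  ∑-splits-when : ∀ {k} b (f : Vec ℕ k × Vec ℕ k → LP n) a → ∑-splits (λ bc → when b (f bc)) a ≈ when b (∑-splits f a)
  ∑-splits-when true f a = refl
  ∑-splits-when false f a = ∑-0 (splits a)

  antidiagonal-delta : ∀ e (g : ℕ → LP n) k → antidiagonal (λ j j' → when (does (e ℕ.≟ j)) (g j')) k ≈ when (e ≤ᵇ k) (g (k ∸ e))
  antidiagonal-delta zero g zero = +-identityʳ _
  antidiagonal-delta (suc e) g zero = +-identityʳ _
  antidiagonal-delta zero g (suc k) = trans (+-congˡ (zeros (suc k))) (+-identityʳ _)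
    where
    zeros : ∀ m → ∑< (λ _ → zeroL) m ≈ zeroL
    zeros zero = refl
    zeros (suc m) = trans (+-identityˡ _) (zeros m)
  antidiagonal-delta (suc zero) g (suc k) = trans (+-identityˡ _) (antidiagonal-delta zero g k)
  antidiagonal-delta (suc (suc e)) g (suc k) = trans (+-identityˡ _) (antidiagonal-delta (suc e) g k)

  ∑-splits-delta : ∀ {k} e (ψ : Vec ℕ k → LP n) (a : Vec ℕ k) →
    ∑-splits (λ bc → when (does (e ≟V proj₁ bc)) (ψ (proj₂ bc))) a ≈ when (e ≤ᵛ a) (ψ (a ∸ᵛ e))
  ∑-splits-delta [] ψ [] = +-identityʳ _
  ∑-splits-delta (e₀ ∷ e) ψ (x ∷ a) = begin
    ∑-splits (λ bc → when (does ((e₀ ∷ e) ≟V proj₁ bc)) (ψ (proj₂ bc))) (x ∷ a)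
      ≈⟨ ∑-splits-∷ (λ bc → when (does ((e₀ ∷ e) ≟V proj₁ bc)) (ψ (proj₂ bc))) x a ⟩
    antidiagonal (λ j j' → ∑-splits (λ bc → when (does (e₀ ℕ.≟ j) ∧ does (e ≟V proj₁ bc)) (ψ (j' ∷ proj₂ bc))) a) x
      ≈⟨ antidiagonal-cong (λ j j' → trans (∑-splits-cong (λ bc → when-∧ (does (e₀ ℕ.≟ j)) (does (e ≟V proj₁ bc)) (ψ (j' ∷ proj₂ bc))) a)
                                           (∑-splits-when (does (e₀ ℕ.≟ j)) (λ bc → when (does (e ≟V proj₁ bc)) (ψ (j' ∷ proj₂ bc))) a)) x ⟩
    antidiagonal (λ j j' → when (does (e₀ ℕ.≟ j)) (∑-splits (λ bc → when (does (e ≟V proj₁ bc)) (ψ (j' ∷ proj₂ bc))) a)) x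
      ≈⟨ antidiagonal-cong (λ j j' → when-cong (does (e₀ ℕ.≟ j)) (∑-splits-delta e (λ c → ψ (j' ∷ c)) a)) x ⟩
    antidiagonal (λ j j' → when (does (e₀ ℕ.≟ j)) (when (e ≤ᵛ a) (ψ (j' ∷ (a ∸ᵛ e))))) x
      ≈⟨ antidiagonal-delta e₀ (λ j' → when (e ≤ᵛ a) (ψ (j' ∷ (a ∸ᵛ e)))) x ⟩
    when (e₀ ≤ᵇ x) (when (e ≤ᵛ a) (ψ ((x ∸ e₀) ∷ (a ∸ᵛ e))))
      ≈⟨ sym (when-∧ (e₀ ≤ᵇ x) (e ≤ᵛ a) (ψ ((x ∸ e₀) ∷ (a ∸ᵛ e)))) ⟩
    when ((e₀ ∷ e) ≤ᵛ (x ∷ a)) (ψ ((x ∷ a) ∸ᵛ (e₀ ∷ e))) ∎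

  infix 4 _≈S_
  record _≈S_ (F G : PS n) : Set where
    constructor mk≈S
    field get≈S : ∀ a → F a ≈ G a
  open _≈S_ public

  _+S_ : PS n → PS n → PS n
  (F +S G) a = F a + G a

  -S_ : PS n → PS n
  (-S F) a = - F a

  0S : PS n
  0S a = zeroL

  poly-∷ : ∀ e c ts a → poly ((e , c) ∷ ts) a ≈ when (does (e ≟V a)) c + poly ts a
  poly-∷ e c ts a with does (e ≟V a)
  ... | true = refl
  ... | false = sym (+-identityˡ _)

  monomial : Vec ℕ n → LP n → PS n
  monomial e c = poly ((e , c) ∷ [])

  monomial-at : ∀ e c b → monomial e c b ≈ when (does (e ≟V b)) c
  monomial-at e c b = trans (poly-∷ e c [] b) (+-identityʳ _)

  monomial-*S : ∀ e c F a → (monomial e c *S F) a ≈ when (e ≤ᵛ a) (c * F (a ∸ᵛ e))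
  monomial-*S e c F a = begin
    ∑-splits (λ bc → monomial e c (proj₁ bc) * F (proj₂ bc)) a
      ≈⟨ ∑-splits-cong (λ bc → trans (*-congʳ (monomial-at e c (proj₁ bc))) (when-*ʳ (does (e ≟V proj₁ bc)) c (F (proj₂ bc)))) a ⟩
    ∑-splits (λ bc → when (does (e ≟V proj₁ bc)) (c * F (proj₂ bc))) a
      ≈⟨ ∑-splits-delta e (λ x → c * F x) a ⟩
    when (e ≤ᵛ a) (c * F (a ∸ᵛ e)) ∎

  const : LP n → PS n
  const = monomial (replicate n 0)

  const-*S : ∀ c F a → (const c *S F) a ≈ c * F a
  const-*S c F a = trans (monomial-*S (replicate n 0) c F a)
    (P.subst (λ z → when z (c * F (a ∸ᵛ replicate n 0)) ≈ c * F a) (P.sym (0≤ᵛ a))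
      (*-congˡ {c} (reflexive (P.cong F (∸ᵛ-identityʳ a)))))

  *S-cong : ∀ {F F' G G'} → F ≈S F' → G ≈S G' → (F *S G) ≈S (F' *S G')
  *S-cong (mk≈S e) (mk≈S f) = mk≈S λ a → ∑-splits-cong (λ bc → *-cong (e (proj₁ bc)) (f (proj₂ bc))) a

  *S-comm : ∀ F G → (F *S G) ≈S (G *S F)
  *S-comm F G = mk≈S λ a → trans (∑-splits-swap _ a) (∑-splits-cong (λ bc → *-comm (F (proj₂ bc)) (G (proj₁ bc))) a)

  *S-assoc : ∀ F G H → ((F *S G) *S H) ≈S (F *S (G *S H))
  *S-assoc F G H = mk≈S λ a → begin
    ∑-splits (λ bc → ∑-splits (λ de → F (proj₁ de) * G (proj₂ de)) (proj₁ bc) * H (proj₂ bc)) a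
      ≈⟨ ∑-splits-cong (λ bc → ∑-*ʳ (H (proj₂ bc)) (λ de → F (proj₁ de) * G (proj₂ de)) (splits (proj₁ bc))) a ⟩
    ∑-splits (λ bc → ∑-splits (λ de → F (proj₁ de) * G (proj₂ de) * H (proj₂ bc)) (proj₁ bc)) a
      ≈⟨ ∑-splits-assoc (λ d e c → F d * G e * H c) a ⟩
    ∑-splits (λ db → ∑-splits (λ ec → F (proj₁ db) * G (proj₁ ec) * H (proj₂ ec)) (proj₂ db)) a
      ≈⟨ ∑-splits-cong (λ db → ∑-splits-cong (λ ec → *-assoc (F (proj₁ db)) (G (proj₁ ec)) (H (proj₂ ec))) (proj₂ db)) a ⟩
    ∑-splits (λ db → ∑-splits (λ ec → F (proj₁ db) * (G (proj₁ ec) * H (proj₂ ec))) (proj₂ db)) a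
      ≈⟨ sym (∑-splits-cong (λ db → ∑-*ˡ (F (proj₁ db)) (λ ec → G (proj₁ ec) * H (proj₂ ec)) (splits (proj₂ db))) a) ⟩
    ∑-splits (λ db → F (proj₁ db) * ∑-splits (λ ec → G (proj₁ ec) * H (proj₂ ec)) (proj₂ db)) a ∎

  *S-distribˡ : ∀ F G H → (F *S (G +S H)) ≈S ((F *S G) +S (F *S H))
  *S-distribˡ F G H = mk≈S λ a → trans (∑-splits-cong (λ bc → distribˡ (F (proj₁ bc)) (G (proj₂ bc)) (H (proj₂ bc))) a) (∑-+ _ _ (splits a))

  *S-distribʳ : ∀ H F G → ((F +S G) *S H) ≈S ((F *S H) +S (G *S H))
  *S-distribʳ H F G = mk≈S λ a → trans (∑-splits-cong (λ bc → distribʳ (H (proj₂ bc)) (F (proj₁ bc)) (G (proj₁ bc))) a) (∑-+ _ _ (splits a))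

  *S-identityˡ : ∀ F → (oneS *S F) ≈S F
  *S-identityˡ F = mk≈S λ a → trans (const-*S oneL F a) (*-identityˡ (F a))

  -- Opaque so that unification never unfolds _*S_ (hopelessly slow); ⊕-at, ⊛-at and ⊝-at unfold them on demand.
  infixl 6 _⊕_
  infixl 7 _⊛_
  infix 8 ⊝_
  opaque
    _⊕_ : PS n → PS n → PS n
    _⊕_ = _+S_

    _⊛_ : PS n → PS n → PS n
    _⊛_ = _*S_

    ⊝_ : PS n → PS n
    ⊝_ = -S_

  opaque
    unfolding _⊕_ _⊛_ ⊝_

    ⊕-at : ∀ F G a → (F ⊕ G) a ≡ F a + G a
    ⊕-at F G a = P.refl

    ⊛-at : ∀ F G a → (F ⊛ G) a ≡ (F *S G) a
    ⊛-at F G a = P.refl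

    ⊝-at : ∀ F a → (⊝ F) a ≡ - F a
    ⊝-at F a = P.refl

    isCommutativeRingS : IsCommutativeRing _≈S_ _⊕_ _⊛_ ⊝_ 0S oneS
    isCommutativeRingS = record
      { isRing = record
        { +-isAbelianGroup = record
          { isGroup = record
            { isMonoid = record
              { isSemigroup = record
                { isMagma = record
                  { isEquivalence = record
                    { refl = mk≈S λ a → refl
                    ; sym = λ e → mk≈S λ a → sym (get≈S e a)
                    ; trans = λ e f → mk≈S λ a → trans (get≈S e a) (get≈S f a) }
                  ; ∙-cong = λ e f → mk≈S λ a → +-cong (get≈S e a) (get≈S f a) }
                ; assoc = λ F G H → mk≈S λ a → +-assoc (F a) (G a) (H a) }
              ; identity = (λ F → mk≈S λ a → +-identityˡ (F a)) , (λ F → mk≈S λ a → +-identityʳ (F a)) }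
            ; inverse = (λ F → mk≈S λ a → -‿inverseˡ (F a)) , (λ F → mk≈S λ a → -‿inverseʳ (F a))
            ; ⁻¹-cong = λ e → mk≈S λ a → -‿cong (get≈S e a) }
          ; comm = λ F G → mk≈S λ a → +-comm (F a) (G a) }
        ; *-cong = *S-cong
        ; *-assoc = *S-assoc
        ; *-identity = *S-identityˡ , (λ F → mk≈S λ a → trans (get≈S (*S-comm F oneS) a) (get≈S (*S-identityˡ F) a))
        ; distrib = *S-distribˡ , *S-distribʳ }
      ; *-comm = *S-comm }

PS-ring : ℕ → CommutativeRing 0ℓ 0ℓ
PS-ring n = record { isCommutativeRing = SeriesRing.isCommutativeRingS n }

-- A ring solver with integer coefficients for an arbitrary commutative ring

module IntegerSolver (R : CommutativeRing 0ℓ 0ℓ) where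
  open CommutativeRing R
  open CommutativeSemigroupProperties +-commutativeSemigroup using (interchange)
  open RingProperties ring using (-0#≈0#; ⁻¹-anti-homo‿-; -‿+-comm; x∙y⁻¹≈ε⇒x≈y; x[y-z]≈xy-xz; [y-z]x≈yx-zx)
  open MonoidMultiplication +-monoid using (×-homo-+) renaming (_×_ to _·_)
  open SemiringMultiplication semiring using (×1-homo-*)
  open SetoidReasoning setoid

  private
    pos neg : ℤ → ℕ
    pos (ℤ.+ k) = k
    pos ℤ.-[1+ k ] = 0
    neg (ℤ.+ k) = 0
    neg ℤ.-[1+ k ] = suc k

    ℕ↦ : ℕ → Carrier
    ℕ↦ k = k · 1#

    pos-neg : ∀ z → z ≡ ℤ.+ pos z ℤ.- ℤ.+ neg z
    pos-neg (ℤ.+ k) = P.sym (ℤP.+-identityʳ (ℤ.+ k))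
    pos-neg ℤ.-[1+ k ] = P.refl

    diff-cong : ∀ a b c d → a + d ≈ c + b → a - b ≈ c - d
    diff-cong a b c d e = x∙y⁻¹≈ε⇒x≈y (a - b) (c - d) (begin
      (a - b) - (c - d)     ≈⟨ +-congˡ (⁻¹-anti-homo‿- c d) ⟩
      (a - b) + (d - c)     ≈⟨ interchange a (- b) d (- c) ⟩
      (a + d) + (- b - c)   ≈⟨ +-cong e (-‿+-comm b c) ⟩
      (c + b) - (b + c)     ≈⟨ +-congˡ (-‿cong (+-comm b c)) ⟩
      (c + b) - (c + b)     ≈⟨ -‿inverseʳ (c + b) ⟩
      0#                    ∎)

    ℤ-diff-cong : ∀ {a b c d} → ℤ.+ a ℤ.- ℤ.+ b ≡ ℤ.+ c ℤ.- ℤ.+ d → a ℕ.+ d ≡ c ℕ.+ b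
    ℤ-diff-cong {a} {b} {c} {d} e = ℤP.+-injective
      (P.trans (ℤP.pos-+ a d)
      (P.trans (solve 3 (λ a b d → a :+ d := (a :- b) :+ (b :+ d)) P.refl (ℤ.+ a) (ℤ.+ b) (ℤ.+ d))
      (P.trans (P.cong (ℤ._+ (ℤ.+ b ℤ.+ ℤ.+ d)) e)
      (P.trans (solve 3 (λ b c d → (c :- d) :+ (b :+ d) := c :+ b) P.refl (ℤ.+ b) (ℤ.+ c) (ℤ.+ d))
               (P.sym (ℤP.pos-+ c b))))))
      where open +-*-Solver

  ι′ : ℤ → Carrier
  ι′ z = ℕ↦ (pos z) - ℕ↦ (neg z)

  -- The solver compares normal forms definitionally, so 0 and 1 must be sent to 0# and 1# on the nose.
  ι : ℤ → Carrier
  ι (ℤ.+ zero) = 0#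
  ι (ℤ.+ suc zero) = 1#
  ι z = ι′ z

  ι≈ι′ : ∀ z → ι z ≈ ι′ z
  ι≈ι′ (ℤ.+ zero) = sym (-‿inverseʳ 0#)
  ι≈ι′ (ℤ.+ suc zero) = sym (trans (+-cong (+-identityʳ 1#) -0#≈0#) (+-identityʳ 1#))
  ι≈ι′ (ℤ.+ suc (suc k)) = refl
  ι≈ι′ ℤ.-[1+ k ] = refl

  -- ι respects formal differences of naturals, which turns each homomorphism law into an identity in ℕ.
  ι-diff : ∀ z a b → z ≡ ℤ.+ a ℤ.- ℤ.+ b → ι z ≈ ℕ↦ a - ℕ↦ b
  ι-diff z a b e = trans (ι≈ι′ z) (diff-cong _ _ _ _ (begin
    ℕ↦ (pos z) + ℕ↦ b  ≈⟨ sym (×-homo-+ 1# (pos z) b) ⟩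
    ℕ↦ (pos z ℕ.+ b)   ≈⟨ reflexive (P.cong ℕ↦ (ℤ-diff-cong {pos z} {neg z} {a} {b} (P.trans (P.sym (pos-neg z)) e))) ⟩
    ℕ↦ (a ℕ.+ neg z)   ≈⟨ ×-homo-+ 1# a (neg z) ⟩
    ℕ↦ a + ℕ↦ (neg z)  ∎))

  ι-+ : ∀ z w → ι (z ℤ.+ w) ≈ ι z + ι w
  ι-+ z w = begin
    ι (z ℤ.+ w)
      ≈⟨ ι-diff (z ℤ.+ w) (pos z ℕ.+ pos w) (neg z ℕ.+ neg w) split ⟩
    ℕ↦ (pos z ℕ.+ pos w) - ℕ↦ (neg z ℕ.+ neg w)
      ≈⟨ +-cong (×-homo-+ 1# (pos z) (pos w)) (-‿cong (×-homo-+ 1# (neg z) (neg w))) ⟩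
    (ℕ↦ (pos z) + ℕ↦ (pos w)) - (ℕ↦ (neg z) + ℕ↦ (neg w))
      ≈⟨ +-congˡ (sym (-‿+-comm (ℕ↦ (neg z)) (ℕ↦ (neg w)))) ⟩
    (ℕ↦ (pos z) + ℕ↦ (pos w)) + (- ℕ↦ (neg z) - ℕ↦ (neg w))
      ≈⟨ interchange (ℕ↦ (pos z)) (ℕ↦ (pos w)) (- ℕ↦ (neg z)) (- ℕ↦ (neg w)) ⟩
    ι′ z + ι′ w
      ≈⟨ sym (+-cong (ι≈ι′ z) (ι≈ι′ w)) ⟩
    ι z + ι w ∎
    where
    open +-*-Solver
    split : z ℤ.+ w ≡ ℤ.+ (pos z ℕ.+ pos w) ℤ.- ℤ.+ (neg z ℕ.+ neg w)
    split = P.trans (P.cong₂ ℤ._+_ (pos-neg z) (pos-neg w))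
      (P.trans (solve 4 (λ a b c d → (a :- b) :+ (c :- d) := (a :+ c) :- (b :+ d)) P.refl (ℤ.+ pos z) (ℤ.+ neg z) (ℤ.+ pos w) (ℤ.+ neg w))
        (P.sym (P.cong₂ ℤ._-_ (ℤP.pos-+ (pos z) (pos w)) (ℤP.pos-+ (neg z) (neg w)))))

  ι-* : ∀ z w → ι (z ℤ.* w) ≈ ι z * ι w
  ι-* z w = begin
    ι (z ℤ.* w)
      ≈⟨ ι-diff (z ℤ.* w) (p ℕ.* p' ℕ.+ q ℕ.* q') (p ℕ.* q' ℕ.+ q ℕ.* p') split ⟩
    ℕ↦ (p ℕ.* p' ℕ.+ q ℕ.* q') - ℕ↦ (p ℕ.* q' ℕ.+ q ℕ.* p')
      ≈⟨ +-cong (trans (×-homo-+ 1# (p ℕ.* p') (q ℕ.* q')) (+-cong (×1-homo-* p p') (×1-homo-* q q')))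
                (-‿cong (trans (×-homo-+ 1# (p ℕ.* q') (q ℕ.* p')) (+-cong (×1-homo-* p q') (×1-homo-* q p')))) ⟩
    (ℕ↦ p * ℕ↦ p' + ℕ↦ q * ℕ↦ q') - (ℕ↦ p * ℕ↦ q' + ℕ↦ q * ℕ↦ p')
      ≈⟨ sym (expand (ℕ↦ p) (ℕ↦ q) (ℕ↦ p') (ℕ↦ q')) ⟩
    ι′ z * ι′ w
      ≈⟨ sym (*-cong (ι≈ι′ z) (ι≈ι′ w)) ⟩
    ι z * ι w ∎
    where
    p = pos z
    q = neg z
    p' = pos w
    q' = neg w
    split : z ℤ.* w ≡ ℤ.+ (p ℕ.* p' ℕ.+ q ℕ.* q') ℤ.- ℤ.+ (p ℕ.* q' ℕ.+ q ℕ.* p')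
    split = P.trans (P.cong₂ ℤ._*_ (pos-neg z) (pos-neg w))
      (P.trans (solve 4 (λ a b c d → (a :- b) :* (c :- d) := (a :* c :+ b :* d) :- (a :* d :+ b :* c)) P.refl (ℤ.+ p) (ℤ.+ q) (ℤ.+ p') (ℤ.+ q'))
        (P.sym (P.cong₂ ℤ._-_ (P.trans (ℤP.pos-+ (p ℕ.* p') (q ℕ.* q')) (P.cong₂ ℤ._+_ (ℤP.pos-* p p') (ℤP.pos-* q q')))
                               (P.trans (ℤP.pos-+ (p ℕ.* q') (q ℕ.* p')) (P.cong₂ ℤ._+_ (ℤP.pos-* p q') (ℤP.pos-* q p'))))))
      where open +-*-Solver
    expand : ∀ a b c d → (a - b) * (c - d) ≈ (a * c + b * d) - (a * d + b * c)
    expand a b c d = begin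
      (a - b) * (c - d)                  ≈⟨ x[y-z]≈xy-xz (a - b) c d ⟩
      (a - b) * c - (a - b) * d          ≈⟨ +-cong ([y-z]x≈yx-zx c a b) (-‿cong ([y-z]x≈yx-zx d a b)) ⟩
      (a * c - b * c) - (a * d - b * d)  ≈⟨ +-congˡ (⁻¹-anti-homo‿- (a * d) (b * d)) ⟩
      (a * c - b * c) + (b * d - a * d)  ≈⟨ interchange (a * c) (- (b * c)) (b * d) (- (a * d)) ⟩
      (a * c + b * d) + (- (b * c) - a * d) ≈⟨ +-congˡ (-‿+-comm (b * c) (a * d)) ⟩
      (a * c + b * d) - (b * c + a * d)  ≈⟨ +-congˡ (-‿cong (+-comm (b * c) (a * d))) ⟩
      (a * c + b * d) - (a * d + b * c)  ∎

  ι-neg : ∀ z → ι (ℤ.- z) ≈ - ι z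
  ι-neg z = trans (ι-diff (ℤ.- z) (neg z) (pos z) negated)
    (sym (trans (-‿cong (ι≈ι′ z)) (⁻¹-anti-homo‿- (ℕ↦ (pos z)) (ℕ↦ (neg z)))))
    where
    open +-*-Solver
    negated : ℤ.- z ≡ ℤ.+ neg z ℤ.- ℤ.+ pos z
    negated = P.trans (P.cong ℤ.-_ (pos-neg z)) (solve 2 (λ a b → :- (a :- b) := b :- a) P.refl (ℤ.+ pos z) (ℤ.+ neg z))

  ι-morphism : ℤ.+-*-rawRing -Raw-AlmostCommutative⟶ fromCommutativeRing R
  ι-morphism = record { ⟦_⟧ = ι ; +-homo = ι-+ ; *-homo = ι-* ; -‿homo = ι-neg ; 0-homo = refl ; 1-homo = refl }

  ι-≟ : ∀ z w → Maybe (ι z ≈ ι w)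
  ι-≟ z w with z ℤP.≟ w
  ... | yes P.refl = just refl
  ... | no _ = nothing

  open RingSolver ℤ.+-*-rawRing (fromCommutativeRing R) ι-morphism ι-≟ public

-- Substitutions y ↦ y^σ of the exponent vectors

lookup-extensionality : ∀ {A : Set} {k} {u v : Vec A k} → (∀ i → lookup u i ≡ lookup v i) → u ≡ v
lookup-extensionality {u = []} {[]} e = P.refl
lookup-extensionality {u = x ∷ u} {y ∷ v} e = P.cong₂ _∷_ (e zero) (lookup-extensionality (e ∘ suc))

lookup-≔ : ∀ {A : Set} {k} (u : Vec A k) i x j → j ≡ i → lookup (u [ i ]≔ x) j ≡ x
lookup-≔ u i x .i P.refl = VecP.lookup∘updateAt i u

lookup-≔-≢ : ∀ {A : Set} {k} (u : Vec A k) i x j → j ≢ i → lookup (u [ i ]≔ x) j ≡ lookup u j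
lookup-≔-≢ u i x j j≢i = VecP.lookup∘updateAt′ j i j≢i u

module _ {k : ℕ} (i j : Fin k) where
  private τ = PC.transpose i j

  transpose-matchˡ : τ i ≡ j
  transpose-matchˡ rewrite dec-true (i ≟ i) P.refl = P.refl

  transpose-matchʳ : τ j ≡ i
  transpose-matchʳ with j ≟ i
  ... | yes e = e
  ... | no _ rewrite dec-true (j ≟ j) P.refl = P.refl

  transpose-other : ∀ l → l ≢ i → l ≢ j → τ l ≡ l
  transpose-other l l≢i l≢j rewrite dec-false (l ≟ i) l≢i | dec-false (l ≟ j) l≢j = P.refl

  transpose-involutive : ∀ l → τ (τ l) ≡ l
  transpose-involutive l = by-cases (l ≟ i) (l ≟ j)
    where
    by-cases : Dec (l ≡ i) → Dec (l ≡ j) → τ (τ l) ≡ l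
    by-cases (yes l≡i) _ = P.trans (P.cong τ (P.trans (P.cong τ l≡i) transpose-matchˡ)) (P.trans transpose-matchʳ (P.sym l≡i))
    by-cases (no _) (yes l≡j) = P.trans (P.cong τ (P.trans (P.cong τ l≡j) transpose-matchʳ)) (P.trans transpose-matchˡ (P.sym l≡j))
    by-cases (no l≢i) (no l≢j) = P.trans (P.cong τ (transpose-other l l≢i l≢j)) (transpose-other l l≢i l≢j)

  lookup-swapExp : ∀ (u : Vec ℤ k) l → lookup (swapExp i j u) l ≡ lookup u (τ l)
  lookup-swapExp u l = by-cases (l ≟ i) (l ≟ j)
    where
    v = u [ i ]≔ lookup u j
    by-cases : Dec (l ≡ i) → Dec (l ≡ j) → lookup (swapExp i j u) l ≡ lookup u (τ l)
    by-cases _ (yes l≡j) =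
      P.trans (lookup-≔ v j (lookup u i) l l≡j) (P.cong (lookup u) (P.sym (P.trans (P.cong τ l≡j) transpose-matchʳ)))
    by-cases (yes l≡i) (no l≢j) = P.trans (lookup-≔-≢ v j (lookup u i) l l≢j)
      (P.trans (lookup-≔ u i (lookup u j) l l≡i) (P.cong (lookup u) (P.sym (P.trans (P.cong τ l≡i) transpose-matchˡ))))
    by-cases (no l≢i) (no l≢j) = P.trans (lookup-≔-≢ v j (lookup u i) l l≢j)
      (P.trans (lookup-≔-≢ u i (lookup u j) l l≢i) (P.cong (lookup u) (P.sym (transpose-other l l≢i l≢j))))

lookup-invExp : ∀ {k} (j : Fin k) (u : Vec ℤ k) → lookup (invExp j u) j ≡ ℤ.- lookup u j
lookup-invExp j u = VecP.lookup∘updateAt j u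

lookup-invExp-≢ : ∀ {k} (j : Fin k) (u : Vec ℤ k) l → l ≢ j → lookup (invExp j u) l ≡ lookup u l
lookup-invExp-≢ j u l l≢j = lookup-≔-≢ u j _ l l≢j

record IsExponentInvolution (n : ℕ) (σ : Vec ℤ n → Vec ℤ n) : Set where
  field
    σ-+ : ∀ u v → σ (zipWith ℤ._+_ u v) ≡ zipWith ℤ._+_ (σ u) (σ v)
    σ-involutive : ∀ u → σ (σ u) ≡ u
    σ-0 : σ (replicate n 0ℤ) ≡ replicate n 0ℤ

swapExp-isExponentInvolution : ∀ {n} (i j : Fin n) → IsExponentInvolution n (swapExp i j)
swapExp-isExponentInvolution i j = record
  { σ-+ = λ u v → lookup-extensionality λ l → begin
      lookup (swapExp i j (zipWith ℤ._+_ u v)) l          ≡⟨ lookup-swapExp i j (zipWith ℤ._+_ u v) l ⟩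
      lookup (zipWith ℤ._+_ u v) (τ l)                    ≡⟨ VecP.lookup-zipWith ℤ._+_ (τ l) u v ⟩
      lookup u (τ l) ℤ.+ lookup v (τ l)                   ≡⟨ P.sym (P.cong₂ ℤ._+_ (lookup-swapExp i j u l) (lookup-swapExp i j v l)) ⟩
      lookup (swapExp i j u) l ℤ.+ lookup (swapExp i j v) l ≡⟨ P.sym (VecP.lookup-zipWith ℤ._+_ l (swapExp i j u) (swapExp i j v)) ⟩
      lookup (zipWith ℤ._+_ (swapExp i j u) (swapExp i j v)) l ∎
  ; σ-involutive = λ u → lookup-extensionality λ l →
      P.trans (lookup-swapExp i j (swapExp i j u) l) (P.trans (lookup-swapExp i j u (τ l)) (P.cong (lookup u) (transpose-involutive i j l)))
  ; σ-0 = lookup-extensionality λ l →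
      P.trans (lookup-swapExp i j (replicate _ 0ℤ) l) (P.trans (VecP.lookup-replicate (τ l) 0ℤ) (P.sym (VecP.lookup-replicate l 0ℤ)))
  }
  where
  open P.≡-Reasoning
  τ = PC.transpose i j

invExp-isExponentInvolution : ∀ {n} (j : Fin n) → IsExponentInvolution n (invExp j)
invExp-isExponentInvolution j = record
  { σ-+ = λ u v → lookup-extensionality (additive u v)
  ; σ-involutive = λ u → lookup-extensionality (involutive u)
  ; σ-0 = lookup-extensionality zero-fixed
  }
  where
  additive : ∀ u v l → lookup (invExp j (zipWith ℤ._+_ u v)) l ≡ lookup (zipWith ℤ._+_ (invExp j u) (invExp j v)) l
  additive u v l with l ≟ j
  ... | yes P.refl = P.trans (lookup-invExp l (zipWith ℤ._+_ u v)) (P.trans (P.cong ℤ.-_ (VecP.lookup-zipWith ℤ._+_ l u v))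
      (P.trans (ℤP.neg-distrib-+ (lookup u l) (lookup v l)) (P.sym (P.trans (VecP.lookup-zipWith ℤ._+_ l (invExp l u) (invExp l v)) (P.cong₂ ℤ._+_ (lookup-invExp l u) (lookup-invExp l v))))))
  ... | no l≢j = P.trans (lookup-invExp-≢ j (zipWith ℤ._+_ u v) l l≢j) (P.trans (VecP.lookup-zipWith ℤ._+_ l u v)
      (P.sym (P.trans (VecP.lookup-zipWith ℤ._+_ l (invExp j u) (invExp j v)) (P.cong₂ ℤ._+_ (lookup-invExp-≢ j u l l≢j) (lookup-invExp-≢ j v l l≢j)))))
  involutive : ∀ u l → lookup (invExp j (invExp j u)) l ≡ lookup u l
  involutive u l with l ≟ j
  ... | yes P.refl = P.trans (lookup-invExp l (invExp l u)) (P.trans (P.cong ℤ.-_ (lookup-invExp l u)) (ℤP.neg-involutive _))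
  ... | no l≢j = P.trans (lookup-invExp-≢ j (invExp j u) l l≢j) (lookup-invExp-≢ j u l l≢j)
  zero-fixed : ∀ l → lookup (invExp j (replicate _ 0ℤ)) l ≡ lookup (replicate _ 0ℤ) l
  zero-fixed l with l ≟ j
  ... | yes P.refl = P.trans (lookup-invExp l (replicate _ 0ℤ)) (P.trans (P.cong ℤ.-_ (VecP.lookup-replicate l 0ℤ)) (P.sym (VecP.lookup-replicate l 0ℤ)))
  ... | no l≢j = lookup-invExp-≢ j (replicate _ 0ℤ) l l≢j

lookup-single : ∀ {A : Set} {k} (z x : A) (i l : Fin k) → lookup (replicate k z [ i ]≔ x) l ≡ (if does (l ≟ i) then x else z)
lookup-single z x i l with l ≟ i
... | yes l≡i = lookup-≔ (replicate _ z) i x l l≡i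
... | no l≢i = P.trans (lookup-≔-≢ (replicate _ z) i x l l≢i) (VecP.lookup-replicate l z)

unitExp : ∀ {n} → Fin n → ℤ → Vec ℤ n
unitExp {n} j c = replicate n 0ℤ [ j ]≔ c

swapExp-unitExp : ∀ {n} (i j k : Fin n) c → swapExp i j (unitExp k c) ≡ unitExp (PC.transpose i j k) c
swapExp-unitExp i j k c = lookup-extensionality λ l →
  P.trans (lookup-swapExp i j (unitExp k c) l) (P.trans (lookup-single 0ℤ c k (τ l))
    (P.trans (same-test (τ l ≟ k) (l ≟ τ k)) (P.sym (lookup-single 0ℤ c (τ k) l))))
  where
  τ = PC.transpose i j
  same-test : ∀ {l} (d₁ : Dec (τ l ≡ k)) (d₂ : Dec (l ≡ τ k)) → (if does d₁ then c else 0ℤ) ≡ (if does d₂ then c else 0ℤ)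
  same-test (yes _) (yes _) = P.refl
  same-test (no _) (no _) = P.refl
  same-test {l} (yes e) (no ne) = ⊥-elim (ne (P.trans (P.sym (transpose-involutive i j l)) (P.cong τ e)))
  same-test (no ne) (yes e) = ⊥-elim (ne (P.trans (P.cong τ e) (transpose-involutive i j k)))

invExp-unitExp : ∀ {n} (j : Fin n) c → invExp j (unitExp j c) ≡ unitExp j (ℤ.- c)
invExp-unitExp j c = lookup-extensionality λ l → P.trans (lookup-invExp-at l) (P.sym (lookup-single 0ℤ (ℤ.- c) j l))
  where
  lookup-invExp-at : ∀ l → lookup (invExp j (unitExp j c)) l ≡ (if does (l ≟ j) then ℤ.- c else 0ℤ)
  lookup-invExp-at l with l ≟ j
  ... | yes P.refl = P.trans (lookup-invExp l (unitExp l c)) (P.cong ℤ.-_ (VecP.lookup∘updateAt l (replicate _ 0ℤ)))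
  ... | no l≢j = P.trans (lookup-invExp-≢ j (unitExp j c) l l≢j) (P.trans (lookup-single 0ℤ c j l) (if-no (l ≟ j) l≢j))
    where
    if-no : (d : Dec (l ≡ j)) → l ≢ j → (if does d then c else 0ℤ) ≡ 0ℤ
    if-no (yes e) ne = ⊥-elim (ne e)
    if-no (no _) _ = P.refl

invExp-unitExp-≢ : ∀ {n} (j k : Fin n) c → k ≢ j → invExp j (unitExp k c) ≡ unitExp k c
invExp-unitExp-≢ j k c k≢j = lookup-extensionality fixed
  where
  fixed : ∀ l → lookup (invExp j (unitExp k c)) l ≡ lookup (unitExp k c) l
  fixed l with l ≟ j
  ... | yes P.refl = P.trans (lookup-invExp l (unitExp k c)) (P.trans (P.cong ℤ.-_ vanishes) (P.sym vanishes))
    where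
    vanishes : lookup (unitExp k c) l ≡ 0ℤ
    vanishes = P.trans (lookup-≔-≢ (replicate _ 0ℤ) k c l (λ e → k≢j (P.sym e))) (VecP.lookup-replicate l 0ℤ)
  ... | no l≢j = lookup-invExp-≢ j (unitExp k c) l l≢j

unitExp-cancel : ∀ {n} (j : Fin n) → zipWith ℤ._+_ (unitExp j 1ℤ) (unitExp j ℤ.-1ℤ) ≡ replicate n 0ℤ
unitExp-cancel j = lookup-extensionality λ l →
  P.trans (VecP.lookup-zipWith ℤ._+_ l (unitExp j 1ℤ) (unitExp j ℤ.-1ℤ))
    (P.trans (P.cong₂ ℤ._+_ (lookup-single 0ℤ 1ℤ j l) (lookup-single 0ℤ ℤ.-1ℤ j l)) (P.trans (cancels (l ≟ j)) (P.sym (VecP.lookup-replicate l 0ℤ))))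
  where
  cancels : ∀ {l} (d : Dec (l ≡ j)) → (if does d then 1ℤ else 0ℤ) ℤ.+ (if does d then ℤ.-1ℤ else 0ℤ) ≡ 0ℤ
  cancels (yes _) = P.refl
  cancels (no _) = P.refl

module ExponentSubstitution {n : ℕ} (σ : Vec ℤ n → Vec ℤ n) (isInvolution : IsExponentInvolution n σ) where
  open IsExponentInvolution isInvolution
  open LaurentRing n using (_⊗_)

  private
    substT : ℤ × Mon n → ℤ × Mon n
    substT (c , (b , u)) = (c , (b , σ u))

    substT-⊗ : ∀ s t → substT (s ⊗ t) ≡ substT s ⊗ substT t
    substT-⊗ (c , (b , u)) (d , (b' , v)) = P.cong (λ w → (c ℤ.* d , (b ℕ.+ b' , w))) (σ-+ u v)

    substL-map-⊗ : ∀ t q → substL σ (map (t ⊗_) q) ≡ map (substT t ⊗_) (substL σ q)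
    substL-map-⊗ t [] = P.refl
    substL-map-⊗ t (s ∷ q) = P.cong₂ _∷_ (substT-⊗ t s) (substL-map-⊗ t q)

  substL-++ : ∀ p q → substL σ (p ++ q) ≡ substL σ p ++ substL σ q
  substL-++ p q = ListP.map-++ substT p q

  substL-neg : ∀ p → substL σ (-L p) ≡ -L (substL σ p)
  substL-neg [] = P.refl
  substL-neg (t ∷ p) = P.cong (substT (ℤ.- proj₁ t , proj₂ t) ∷_) (substL-neg p)

  substL-* : ∀ p q → substL σ (p *L q) ≡ substL σ p *L substL σ q
  substL-* [] q = P.refl
  substL-* (t ∷ p) q = P.trans (substL-++ (map (t ⊗_) q) (p *L q)) (P.cong₂ _++_ (substL-map-⊗ t q) (substL-* p q))

  substL-oneL : substL σ oneL ≡ oneL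
  substL-oneL = P.cong (λ w → (1ℤ , (0 , w)) ∷ []) σ-0

  substL-βL : substL σ βL ≡ βL
  substL-βL = P.cong (λ w → (1ℤ , (1 , w)) ∷ []) σ-0

  substL-powL : ∀ c k → substL σ (powL c k) ≡ powL (substL σ c) k
  substL-powL c zero = substL-oneL
  substL-powL c (suc k) = P.trans (substL-* c (powL c k)) (P.cong (substL σ c *L_) (substL-powL c k))

  coeffL-substL : ∀ p b w → coeffL (substL σ p) (b , w) ≡ coeffL p (b , σ w)
  coeffL-substL [] b w = P.refl
  coeffL-substL ((c , (b' , u)) ∷ p) b w = same-test ((b' , σ u) ≟M (b , w)) ((b' , u) ≟M (b , σ w))
    where
    same-test : (d₁ : Dec ((b' , σ u) ≡ (b , w))) (d₂ : Dec ((b' , u) ≡ (b , σ w))) →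
      (if does d₁ then c ℤ.+ coeffL (substL σ p) (b , w) else coeffL (substL σ p) (b , w)) ≡
      (if does d₂ then c ℤ.+ coeffL p (b , σ w) else coeffL p (b , σ w))
    same-test (yes _) (yes _) = P.cong (ℤ._+_ c) (coeffL-substL p b w)
    same-test (no _) (no _) = coeffL-substL p b w
    same-test (yes e) (no ne) = ⊥-elim (ne (P.cong₂ _,_ (P.cong proj₁ e) (P.trans (P.sym (σ-involutive u)) (P.cong σ (P.cong proj₂ e)))))
    same-test (no ne) (yes e) = ⊥-elim (ne (P.cong₂ _,_ (P.cong proj₁ e) (P.trans (P.cong σ (P.cong proj₂ e)) (σ-involutive w))))

  substL-cong : ∀ {p q} → p ≈L q → substL σ p ≈L substL σ q
  substL-cong {p} {q} e (b , w) = P.trans (coeffL-substL p b w) (P.trans (e (b , σ w)) (P.sym (coeffL-substL q b w)))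

  substS : PS n → PS n
  substS F a = substL σ (F a)

  substS-*S : ∀ F G a → substS (F *S G) a ≡ (substS F *S substS G) a
  substS-*S F G a = P.trans (substL-∑ (λ bc → F (proj₁ bc) *L G (proj₂ bc)) (splits a))
    (P.cong (foldr _+L_ zeroL) (ListP.map-cong (λ bc → substL-* (F (proj₁ bc)) (G (proj₂ bc))) (splits a)))
    where
    substL-∑ : ∀ {A : Set} (f : A → LP n) xs → substL σ (foldr _+L_ zeroL (map f xs)) ≡ foldr _+L_ zeroL (map (substL σ ∘ f) xs)
    substL-∑ f [] = P.refl
    substL-∑ f (x ∷ xs) = P.trans (substL-++ (f x) _) (P.cong (substL σ (f x) ++_) (substL-∑ f xs))

  substS-poly : ∀ ts a → substS (poly ts) a ≡ poly (map (λ { (e , c) → (e , substL σ c) }) ts) a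
  substS-poly [] a = P.refl
  substS-poly ((e , c) ∷ ts) a with does (e ≟V a)
  ... | true = P.trans (substL-++ c (poly ts a)) (P.cong (substL σ c ++_) (substS-poly ts a))
  ... | false = substS-poly ts a

  substS-geom : ∀ i c a → substS (geom i c) a ≡ geom i (substL σ c) a
  substS-geom i c a with does (a ≟V (replicate n 0 [ i ]≔ lookup a i))
  ... | true = substL-powL c (lookup a i)
  ... | false = P.refl

module FinProducts (R : CommutativeRing 0ℓ 0ℓ) where
  open CommutativeRing R hiding (zero)
  open MonoidSum *-commutativeMonoid using () renaming (sum to ∏) public
  open MonoidSum *-commutativeMonoid using (sum-cong-≋; sum-replicate-zero; sum-permute; ∑-distrib-+)
  open SetoidReasoning setoid

  ∏-cong : ∀ {k} {f g : Fin k → Carrier} → (∀ i → f i ≈ g i) → ∏ f ≈ ∏ g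
  ∏-cong = sum-cong-≋

  ∏-1# : ∀ {k} (f : Fin k → Carrier) → (∀ i → f i ≈ 1#) → ∏ f ≈ 1#
  ∏-1# {k} f e = trans (∏-cong e) (sum-replicate-zero k)

  ∏-* : ∀ {k} (f g : Fin k → Carrier) → ∏ (λ i → f i * g i) ≈ ∏ f * ∏ g
  ∏-* = ∑-distrib-+

  ∏-transpose : ∀ {k} (f : Fin k → Carrier) (p q : Fin k) → ∏ (f ∘ PC.transpose p q) ≈ ∏ f
  ∏-transpose f p q = sym (sum-permute f (Perm.transpose p q))

  ∏-point : ∀ {k} (f f' : Fin k → Carrier) (i₀ : Fin k) c → f' i₀ ≈ c * f i₀ → (∀ i → i ≢ i₀ → f' i ≈ f i) → ∏ f' ≈ c * ∏ f
  ∏-point {suc k} f f' zero c at₀ elsewhere = begin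
    f' zero * ∏ (f' ∘ suc)     ≈⟨ *-cong at₀ (∏-cong (λ i → elsewhere (suc i) λ ())) ⟩
    (c * f zero) * ∏ (f ∘ suc) ≈⟨ *-assoc c (f zero) _ ⟩
    c * (f zero * ∏ (f ∘ suc)) ∎
  ∏-point {suc k} f f' (suc i₀) c at₀ elsewhere = begin
    f' zero * ∏ (f' ∘ suc)
      ≈⟨ *-cong (elsewhere zero λ ()) (∏-point (f ∘ suc) (f' ∘ suc) i₀ c at₀ (λ i i≢i₀ → elsewhere (suc i) (i≢i₀ ∘ FinP.suc-injective))) ⟩
    f zero * (c * ∏ (f ∘ suc)) ≈⟨ x∙yz≈y∙xz (f zero) c _ ⟩
    c * (f zero * ∏ (f ∘ suc)) ∎
    where open CommutativeSemigroupProperties *-commutativeSemigroup using (x∙yz≈y∙xz)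

  ∏-homomorphic : ∀ (h : Carrier → Carrier) → (∀ x y → h (x * y) ≈ h x * h y) → h 1# ≈ 1# →
    ∀ {k} (f : Fin k → Carrier) → h (∏ f) ≈ ∏ (h ∘ f)
  ∏-homomorphic h h-* h-1 {zero} f = h-1
  ∏-homomorphic h h-* h-1 {suc k} f = trans (h-* (f zero) (∏ (f ∘ suc))) (*-congˡ (∏-homomorphic h h-* h-1 (f ∘ suc)))

  ∏∏ : ∀ {k} → (Fin k → Fin k → Carrier) → Carrier
  ∏∏ f = ∏ (λ i → ∏ (f i))

  ∏∏-cong : ∀ {k} {f g : Fin k → Fin k → Carrier} → (∀ i j → f i j ≈ g i j) → ∏∏ f ≈ ∏∏ g
  ∏∏-cong e = ∏-cong (λ i → ∏-cong (e i))

  ∏∏-point : ∀ {k} (f f' : Fin k → Fin k → Carrier) (i₀ j₀ : Fin k) c → f' i₀ j₀ ≈ c * f i₀ j₀ →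
    (∀ i j → ¬ (i ≡ i₀ × j ≡ j₀) → f' i j ≈ f i j) → ∏∏ f' ≈ c * ∏∏ f
  ∏∏-point f f' i₀ j₀ c at₀ elsewhere = ∏-point (λ i → ∏ (f i)) (λ i → ∏ (f' i)) i₀ c
    (∏-point (f i₀) (f' i₀) j₀ c at₀ (λ j j≢j₀ → elsewhere i₀ j (j≢j₀ ∘ proj₂)))
    (λ i i≢i₀ → ∏-cong (λ j → elsewhere i j (i≢i₀ ∘ proj₁)))

  ∏ᴸ : List Carrier → Carrier
  ∏ᴸ = foldr _*_ 1#

  ∏ᴸ-++ : ∀ xs ys → ∏ᴸ (xs ++ ys) ≈ ∏ᴸ xs * ∏ᴸ ys
  ∏ᴸ-++ [] ys = sym (*-identityˡ _)
  ∏ᴸ-++ (x ∷ xs) ys = trans (*-congˡ (∏ᴸ-++ xs ys)) (sym (*-assoc x _ _))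

  ∏ᴸ-concatMap : ∀ {A : Set} (f : A → List Carrier) xs → ∏ᴸ (concatMap f xs) ≈ ∏ᴸ (map (∏ᴸ ∘ f) xs)
  ∏ᴸ-concatMap f [] = refl
  ∏ᴸ-concatMap f (x ∷ xs) = trans (∏ᴸ-++ (f x) (concatMap f xs)) (*-congˡ (∏ᴸ-concatMap f xs))

  ∏ᴸ-filter : ∀ {A : Set} {Q : A → Set} (Q? : Decidable Q) (g : A → Carrier) xs →
    ∏ᴸ (map g (filter Q? xs)) ≈ ∏ᴸ (map (λ x → if does (Q? x) then g x else 1#) xs)
  ∏ᴸ-filter Q? g [] = refl
  ∏ᴸ-filter Q? g (x ∷ xs) with does (Q? x)
  ... | true = *-congˡ (∏ᴸ-filter Q? g xs)
  ... | false = trans (∏ᴸ-filter Q? g xs) (sym (*-identityˡ _))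

  ∏ᴸ-allFin : ∀ {k} (g : Fin k → Carrier) → ∏ᴸ (map g (allFin k)) ≈ ∏ g
  ∏ᴸ-allFin {k} g = trans (reflexive (P.cong ∏ᴸ (ListP.map-tabulate id g))) (tabulated g)
    where
    tabulated : ∀ {k} (g : Fin k → Carrier) → ∏ᴸ (List.tabulate g) ≈ ∏ g
    tabulated {zero} g = refl
    tabulated {suc k} g = *-congˡ (tabulated (g ∘ suc))

module StepIdentities (R : CommutativeRing 0ℓ 0ℓ) where
  open CommutativeRing R
  open IntegerSolver R using (solve; _:=_; _:+_; _:*_; _:-_; con)
  open SetoidReasoning setoid

  private
    absorb : ∀ x g d → g * d ≈ 1# → x * (g * d) ≈ x
    absorb x g d e = trans (*-congˡ e) (*-identityʳ x)

  geometric-inverse : ∀ g a → g ≈ 1# + a * g → g * (1# - a) ≈ 1#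
  geometric-inverse g a g≈1+ag = begin
    g * (1# - a)          ≈⟨ solve 2 (λ g a → g :* (con 1ℤ :- a) := g :- a :* g) refl g a ⟩
    g - a * g             ≈⟨ +-congʳ g≈1+ag ⟩
    (1# + a * g) - a * g  ≈⟨ solve 1 (λ z → (con 1ℤ :+ z) :- z := con 1ℤ) refl (a * g) ⟩
    1#                    ∎

  -- (y - ȳ)(1 + βx) = (y + β)(1 - xȳ) - (ȳ + β)(1 - xy) holds identically; dividing by (1 - xy)(1 - xȳ) gives the
  -- π^BC step, while G and W stand for the factors that are carried along.
  bc-identity : ∀ y ȳ β x g h G W → g * (1# - x * y) ≈ 1# → h * (1# - x * ȳ) ≈ 1# →
    (y - ȳ) * ((h * (g * G)) * ((1# + β * x) * W)) ≈ (y + β) * ((g * G) * W) - (ȳ + β) * ((h * G) * W)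
  bc-identity y ȳ β x g h G W eg eh = begin
    (y - ȳ) * ((h * (g * G)) * ((1# + β * x) * W))
      ≈⟨ solve 8 (λ y ȳ β x g h G W → (y :- ȳ) :* ((h :* (g :* G)) :* ((con 1ℤ :+ β :* x) :* W))
                   := ((y :+ β) :* (con 1ℤ :- x :* ȳ) :- (ȳ :+ β) :* (con 1ℤ :- x :* y)) :* (g :* h :* G :* W)) refl y ȳ β x g h G W ⟩
    ((y + β) * (1# - x * ȳ) - (ȳ + β) * (1# - x * y)) * (g * h * G * W)
      ≈⟨ solve 8 (λ y ȳ β x g h G W → ((y :+ β) :* (con 1ℤ :- x :* ȳ) :- (ȳ :+ β) :* (con 1ℤ :- x :* y)) :* (g :* h :* G :* W)
                   := (y :+ β) :* ((g :* G) :* W) :* (h :* (con 1ℤ :- x :* ȳ)) :- (ȳ :+ β) :* ((h :* G) :* W) :* (g :* (con 1ℤ :- x :* y))) refl y ȳ β x g h G W ⟩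
    (y + β) * ((g * G) * W) * (h * (1# - x * ȳ)) - (ȳ + β) * ((h * G) * W) * (g * (1# - x * y))
      ≈⟨ +-cong (absorb _ h _ eh) (-‿cong (absorb _ g _ eg)) ⟩
    (y + β) * ((g * G) * W) - (ȳ + β) * ((h * G) * W) ∎

  -- With gᵤ = 1/(1 - x u), gᵥ = 1/(1 - x v), hᵤ = 1/(1 - x'/u), hᵥ = 1/(1 - x'/v), the identity
  -- (u - v)(1 - x x') gᵤ gᵥ hᵤ hᵥ = u gᵤ hᵥ - v gᵥ hᵤ holds because u ū = v v̄ = 1.
  a-identity : ∀ u ū v v̄ x x' gu gv hu hv G W →
    gu * (1# - x * u) ≈ 1# → gv * (1# - x * v) ≈ 1# → hu * (1# - x' * ū) ≈ 1# → hv * (1# - x' * v̄) ≈ 1# →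
    u * ū ≈ 1# → v * v̄ ≈ 1# →
    (u - v) * ((gv * (hu * (gu * (hv * G)))) * ((1# - x' * x) * W)) ≈ u * ((gu * (hv * G)) * W) - v * ((gv * (hu * G)) * W)
  a-identity u ū v v̄ x x' gu gv hu hv G W egu egv ehu ehv eu ev = begin
    (u - v) * ((gv * (hu * (gu * (hv * G)))) * ((1# - x' * x) * W))
      ≈⟨ solve 10 (λ u v x x' gu gv hu hv G W → (u :- v) :* ((gv :* (hu :* (gu :* (hv :* G)))) :* ((con 1ℤ :- x' :* x) :* W))
                    := ((u :- v) :* (con 1ℤ :- x' :* x)) :* (gu :* gv :* hu :* hv :* G :* W)) refl u v x x' gu gv hu hv G W ⟩
    ((u - v) * (1# - x' * x)) * (gu * gv * hu * hv * G * W)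
      ≈⟨ *-congʳ (sym numerators) ⟩
    (u * (1# - x * v) * (1# - x' * ū) - v * (1# - x * u) * (1# - x' * v̄)) * (gu * gv * hu * hv * G * W)
      ≈⟨ solve 12 (λ u ū v v̄ x x' gu gv hu hv G W →
           (u :* (con 1ℤ :- x :* v) :* (con 1ℤ :- x' :* ū) :- v :* (con 1ℤ :- x :* u) :* (con 1ℤ :- x' :* v̄)) :* (gu :* gv :* hu :* hv :* G :* W)
           := u :* ((gu :* (hv :* G)) :* W) :* ((gv :* (con 1ℤ :- x :* v)) :* (hu :* (con 1ℤ :- x' :* ū)))
              :- v :* ((gv :* (hu :* G)) :* W) :* ((gu :* (con 1ℤ :- x :* u)) :* (hv :* (con 1ℤ :- x' :* v̄)))) refl u ū v v̄ x x' gu gv hu hv G W ⟩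
    u * ((gu * (hv * G)) * W) * ((gv * (1# - x * v)) * (hu * (1# - x' * ū)))
      - v * ((gv * (hu * G)) * W) * ((gu * (1# - x * u)) * (hv * (1# - x' * v̄)))
      ≈⟨ +-cong (absorb _ _ _ (trans (*-congʳ egv) (trans (*-identityˡ _) ehu)))
                (-‿cong (absorb _ _ _ (trans (*-congʳ egu) (trans (*-identityˡ _) ehv)))) ⟩
    u * ((gu * (hv * G)) * W) - v * ((gv * (hu * G)) * W) ∎
    where
    numerators : u * (1# - x * v) * (1# - x' * ū) - v * (1# - x * u) * (1# - x' * v̄) ≈ (u - v) * (1# - x' * x)
    numerators = begin
      u * (1# - x * v) * (1# - x' * ū) - v * (1# - x * u) * (1# - x' * v̄)
        ≈⟨ solve 6 (λ u ū v v̄ x x' → u :* (con 1ℤ :- x :* v) :* (con 1ℤ :- x' :* ū) :- v :* (con 1ℤ :- x :* u) :* (con 1ℤ :- x' :* v̄)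
             := (u :- v) :* (con 1ℤ :- x' :* x) :+ (u :* ū :- con 1ℤ) :* (x :* x' :* v :- x') :+ (v :* v̄ :- con 1ℤ) :* (x' :- x :* x' :* u)) refl u ū v v̄ x x' ⟩
      (u - v) * (1# - x' * x) + (u * ū - 1#) * (x * x' * v - x') + (v * v̄ - 1#) * (x' - x * x' * u)
        ≈⟨ +-cong (+-congˡ (*-congʳ (+-congʳ eu))) (*-congʳ (+-congʳ ev)) ⟩
      (u - v) * (1# - x' * x) + (1# - 1#) * (x * x' * v - x') + (1# - 1#) * (x' - x * x' * u)
        ≈⟨ solve 6 (λ u v x x' p q → (u :- v) :* (con 1ℤ :- x' :* x) :+ (con 1ℤ :- con 1ℤ) :* p :+ (con 1ℤ :- con 1ℤ) :* q
             := (u :- v) :* (con 1ℤ :- x' :* x)) refl u v x x' (x * x' * v - x') (x' - x * x' * u) ⟩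
      (u - v) * (1# - x' * x) ∎

private
  T-∧⁻ : ∀ {b c} → T (b ∧ c) → T b × T c
  T-∧⁻ = Equivalence.to BoolP.T-∧

+ᵛ∸ᵛ : ∀ {k} (e a : Vec ℕ k) → T (e ≤ᵛ a) → zipWith ℕ._+_ e (a ∸ᵛ e) ≡ a
+ᵛ∸ᵛ [] [] _ = P.refl
+ᵛ∸ᵛ (x ∷ e) (y ∷ a) h = P.cong₂ _∷_ (ℕP.m+[n∸m]≡n (ℕP.≤ᵇ⇒≤ x y (proj₁ (T-∧⁻ h)))) (+ᵛ∸ᵛ e a (proj₂ (T-∧⁻ h)))

+ᵛ⇒≤ᵛ : ∀ {k} (e d a : Vec ℕ k) → zipWith ℕ._+_ e d ≡ a → T (e ≤ᵛ a)
+ᵛ⇒≤ᵛ [] [] [] _ = tt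
+ᵛ⇒≤ᵛ (x ∷ e) (z ∷ d) (y ∷ a) h with x ≤ᵇ y in x≤ᵇy
... | true = +ᵛ⇒≤ᵛ e d a (P.cong Vec.tail h)
... | false = P.subst T x≤ᵇy (ℕP.≤⇒≤ᵇ (P.subst (x ℕ.≤_) (P.cong Vec.head h) (ℕP.m≤m+n x z)))

+ᵛ⇒∸ᵛ : ∀ {k} (e d a : Vec ℕ k) → zipWith ℕ._+_ e d ≡ a → d ≡ a ∸ᵛ e
+ᵛ⇒∸ᵛ [] [] [] _ = P.refl
+ᵛ⇒∸ᵛ (x ∷ e) (z ∷ d) (y ∷ a) h =
  P.cong₂ _∷_ (P.trans (P.sym (ℕP.m+n∸m≡n x z)) (P.cong (_∸ x) (P.cong Vec.head h))) (+ᵛ⇒∸ᵛ e d a (P.cong Vec.tail h))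

pureV : ∀ {n} → Fin n → ℕ → Vec ℕ n
pureV {n} i k = replicate n 0 [ i ]≔ k

pureV-zero : ∀ {n} (i : Fin n) → pureV i 0 ≡ replicate n 0
pureV-zero {n} i = P.trans (P.cong (replicate n 0 [ i ]≔_) (P.sym (VecP.lookup-replicate i 0))) (VecP.[]≔-lookup (replicate n 0) i)

unitV-≤ᵛ : ∀ {n} (i : Fin n) (a : Vec ℕ n) → unitV i ≤ᵛ a ≡ (1 ≤ᵇ lookup a i)
unitV-≤ᵛ zero (x ∷ a) = P.trans (P.cong ((1 ≤ᵇ x) ∧_) (0≤ᵛ a)) (BoolP.∧-identityʳ (1 ≤ᵇ x))
unitV-≤ᵛ (suc i) (x ∷ a) = unitV-≤ᵛ i a

pureV-∸ᵛ-unitV : ∀ {n} (i : Fin n) (a : Vec ℕ n) k → lookup a i ≡ suc k → (a ≡ pureV i (suc k)) ⇔ (a ∸ᵛ unitV i ≡ pureV i k)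
pureV-∸ᵛ-unitV i a k aᵢ = mk⇔ lower raise
  where
  lookup-∸ᵛ : ∀ l → lookup (a ∸ᵛ unitV i) l ≡ lookup a l ∸ (if does (l ≟ i) then 1 else 0)
  lookup-∸ᵛ l = P.trans (VecP.lookup-zipWith _∸_ l a (unitV i)) (P.cong (lookup a l ∸_) (lookup-single 0 1 i l))
  lower : a ≡ pureV i (suc k) → a ∸ᵛ unitV i ≡ pureV i k
  lower P.refl = lookup-extensionality pointwise
    where
    by-cases : ∀ {l} (d : Dec (l ≡ i)) → (if does d then suc k else 0) ∸ (if does d then 1 else 0) ≡ (if does d then k else 0)
    by-cases (yes _) = P.refl
    by-cases (no _) = P.refl
    pointwise : ∀ l → lookup (pureV i (suc k) ∸ᵛ unitV i) l ≡ lookup (pureV i k) l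
    pointwise l = P.trans (lookup-∸ᵛ l)
      (P.trans (P.cong (_∸ (if does (l ≟ i) then 1 else 0)) (lookup-single 0 (suc k) i l)) (P.trans (by-cases (l ≟ i)) (P.sym (lookup-single 0 k i l))))
  raise : a ∸ᵛ unitV i ≡ pureV i k → a ≡ pureV i (suc k)
  raise e = lookup-extensionality λ l → by-cases l (l ≟ i)
    where
    by-cases : ∀ l → Dec (l ≡ i) → lookup a l ≡ lookup (pureV i (suc k)) l
    by-cases l (yes P.refl) = P.trans aᵢ (P.sym (VecP.lookup∘updateAt l (replicate _ 0)))
    by-cases l (no l≢i) = P.trans (P.sym (P.trans (lookup-∸ᵛ l) (P.cong (lookup a l ∸_) (if-no (l ≟ i)))))
      (P.trans (P.cong (λ v → lookup v l) e) (P.trans (lookup-≔-≢ (replicate _ 0) i k l l≢i)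
        (P.sym (lookup-≔-≢ (replicate _ 0) i (suc k) l l≢i))))
      where
      if-no : ∀ {x : ℕ} (d : Dec (l ≡ i)) → (if does d then x else 0) ≡ 0
      if-no (yes e) = ⊥-elim (l≢i e)
      if-no (no _) = P.refl

module SeriesIdentities (n : ℕ) where
  open SeriesRing n using (when; when-cong; when-*ˡ; when-+; when-neg; monomial; monomial-at; monomial-*S; const; const-*S; poly-∷; ⊕-at; ⊛-at; ⊝-at; *S-cong; get≈S)
    renaming (mk≈S to coefficientwise)
  private module L = CommutativeRing (LP-ring n)
  open CommutativeRing (PS-ring n) hiding (zero)

  X : Vec ℕ n → PS n
  X e = monomial e oneL

  const-at : ∀ c a → const c a L.≈ when (does (replicate n 0 ≟V a)) c
  const-at c a = monomial-at (replicate n 0) c a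

  const-cong : ∀ {c d} → c L.≈ d → const c ≈ const d
  const-cong {c} {d} e = coefficientwise λ a → L.trans (const-at c a) (L.trans (when-cong _ e) (L.sym (const-at d a)))

  const-+ : ∀ c d → const (c +L d) ≈ const c + const d
  const-+ c d = coefficientwise λ a → L.trans (const-at (c +L d) a)
    (L.trans (when-+ _ c d) (L.sym (L.trans (L.reflexive (⊕-at (const c) (const d) a)) (L.+-cong (const-at c a) (const-at d a)))))

  const-neg : ∀ c → const (-L c) ≈ - const c
  const-neg c = coefficientwise λ a → L.trans (const-at (-L c) a)
    (L.trans (when-neg _ c) (L.sym (L.trans (L.reflexive (⊝-at (const c) a)) (L.-‿cong (const-at c a)))))

  const-* : ∀ c d → const (c *L d) ≈ const c * const d
  const-* c d = coefficientwise λ a → L.trans (const-at (c *L d) a)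
    (L.sym (L.trans (L.reflexive (⊛-at (const c) (const d) a)) (L.trans (const-*S c (const d) a) (L.trans (L.*-congˡ {c} (const-at d a)) (when-*ˡ _ c d)))))

  monomial≈X*const : ∀ e c → monomial e c ≈ X e * const c
  monomial≈X*const e c = trans (coefficientwise λ a → L.sym (L.trans (L.reflexive (⊛-at (const c) (X e) a)) (L.trans (const-*S c (X e) a)
      (L.trans (L.*-congˡ {c} (monomial-at e L.1# a)) (L.trans (when-*ˡ _ c L.1#) (L.trans (when-cong _ (L.*-identityʳ c)) (L.sym (monomial-at e c a))))))))
    (*-comm (const c) (X e))

  X-+ : ∀ e e' → X e * X e' ≈ X (zipWith ℕ._+_ e e')
  X-+ e e' = coefficientwise λ a → L.trans (L.reflexive (⊛-at (X e) (X e') a)) (L.trans (monomial-*S e L.1# (X e') a)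
    (L.trans (when-cong (e ≤ᵛ a) (L.trans (L.*-identityˡ _) (monomial-at e' L.1# (a ∸ᵛ e))))
    (L.trans (same-test a (e ≤ᵛ a) P.refl (e' ≟V (a ∸ᵛ e)) (zipWith ℕ._+_ e e' ≟V a)) (L.sym (monomial-at (zipWith ℕ._+_ e e') L.1# a)))))
    where
    same-test : ∀ a b → e ≤ᵛ a ≡ b → (d₁ : Dec (e' ≡ a ∸ᵛ e)) (d₂ : Dec (zipWith ℕ._+_ e e' ≡ a)) →
      when b (when (does d₁) L.1#) L.≈ when (does d₂) L.1#
    same-test a false e≤a d₁ (no _) = L.refl
    same-test a false e≤a d₁ (yes e+e'≡a) = ⊥-elim (P.subst T e≤a (+ᵛ⇒≤ᵛ e e' a e+e'≡a))
    same-test a true e≤a (yes _) (yes _) = L.refl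
    same-test a true e≤a (no _) (no _) = L.refl
    same-test a true e≤a (yes e'≡a-e) (no ne) = ⊥-elim (ne (P.trans (P.cong (zipWith ℕ._+_ e) e'≡a-e) (+ᵛ∸ᵛ e a (P.subst T (P.sym e≤a) tt))))
    same-test a true e≤a (no ne) (yes e+e'≡a) = ⊥-elim (ne (+ᵛ⇒∸ᵛ e e' a e+e'≡a))

  binomial : ∀ e₁ c₁ e₂ c₂ → poly ((e₁ , c₁) ∷ (e₂ , c₂) ∷ []) ≈ monomial e₁ c₁ + monomial e₂ c₂
  binomial e₁ c₁ e₂ c₂ = coefficientwise λ a → L.trans (poly-∷ e₁ c₁ ((e₂ , c₂) ∷ []) a)
    (L.sym (L.trans (L.reflexive (⊕-at (monomial e₁ c₁) (monomial e₂ c₂) a)) (L.+-congʳ {monomial e₂ c₂ a} (monomial-at e₁ c₁ a))))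

  geom-at : ∀ (i : Fin n) (c : LP n) (a : Vec ℕ n) {k} → lookup a i ≡ k → geom i c a ≡ (if does (a ≟V pureV i k) then powL c k else zeroL)
  geom-at i c a P.refl = P.refl

  geom-unfold : ∀ (i : Fin n) c → geom i c ≈ 1# + monomial (unitV i) c * geom i c
  geom-unfold i c = coefficientwise λ a → L.trans (at a (lookup a i) P.refl)
    (L.sym (L.trans (L.reflexive (P.trans (⊕-at 1# _ a) (P.cong (oneS a +L_) (⊛-at (monomial (unitV i) c) (geom i c) a))))
                    (L.+-congˡ (monomial-*S (unitV i) c (geom i c) a))))
    where
    open SetoidReasoning L.setoid
    unitV≤ᵛ : ∀ a {k} x → lookup a i ≡ k → when (unitV i ≤ᵛ a) x ≡ when (1 ≤ᵇ k) x
    unitV≤ᵛ a x aᵢ = P.cong (λ b → when b x) (P.trans (unitV-≤ᵛ i a) (P.cong (1 ≤ᵇ_) aᵢ))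
    at : ∀ a k → lookup a i ≡ k → geom i c a L.≈ oneS a L.+ when (unitV i ≤ᵛ a) (c L.* geom i c (a ∸ᵛ unitV i))
    at a zero aᵢ = begin
      geom i c a                                            ≡⟨ geom-at i c a aᵢ ⟩
      (if does (a ≟V pureV i 0) then oneL else zeroL)       ≈⟨ same-test (a ≟V pureV i 0) (replicate n 0 ≟V a) ⟩
      when (does (replicate n 0 ≟V a)) oneL                 ≈⟨ L.sym (L.trans (L.+-congˡ (L.reflexive (unitV≤ᵛ a _ aᵢ))) (L.trans (L.+-identityʳ _) (monomial-at (replicate n 0) oneL a))) ⟩
      oneS a L.+ when (unitV i ≤ᵛ a) (c L.* geom i c (a ∸ᵛ unitV i)) ∎
      where
      same-test : (d₁ : Dec (a ≡ pureV i 0)) (d₂ : Dec (replicate n 0 ≡ a)) → (if does d₁ then oneL else zeroL) L.≈ when (does d₂) oneL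
      same-test (yes _) (yes _) = L.refl
      same-test (no _) (no _) = L.refl
      same-test (yes e) (no ne) = ⊥-elim (ne (P.sym (P.trans e (pureV-zero i))))
      same-test (no ne) (yes e) = ⊥-elim (ne (P.trans (P.sym e) (P.sym (pureV-zero i))))
    at a (suc k) aᵢ = begin
      geom i c a                                                ≡⟨ geom-at i c a aᵢ ⟩
      (if does (a ≟V pureV i (suc k)) then c L.* powL c k else zeroL) ≈⟨ same-test (a ≟V pureV i (suc k)) (a′ ≟V pureV i k) ⟩
      c L.* (if does (a′ ≟V pureV i k) then powL c k else zeroL) ≡⟨ P.cong (c L.*_) (P.sym (geom-at i c a′ a′ᵢ)) ⟩
      c L.* geom i c a′                                         ≈⟨ L.sym (L.+-identityˡ _) ⟩
      zeroL L.+ c L.* geom i c a′                               ≈⟨ L.sym (L.+-cong (L.trans (monomial-at (replicate n 0) oneL a) (not-constant (replicate n 0 ≟V a))) (L.reflexive (unitV≤ᵛ a _ aᵢ))) ⟩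
      oneS a L.+ when (unitV i ≤ᵛ a) (c L.* geom i c a′)        ∎
      where
      a′ = a ∸ᵛ unitV i
      a′ᵢ : lookup a′ i ≡ k
      a′ᵢ = P.trans (VecP.lookup-zipWith _∸_ i a (unitV i)) (P.cong₂ _∸_ aᵢ (VecP.lookup∘updateAt i (replicate n 0)))
      same-test : (d₁ : Dec (a ≡ pureV i (suc k))) (d₂ : Dec (a′ ≡ pureV i k)) →
        (if does d₁ then c L.* powL c k else zeroL) L.≈ c L.* (if does d₂ then powL c k else zeroL)
      same-test (yes _) (yes _) = L.refl
      same-test (no _) (no _) = L.sym (L.zeroʳ c)
      same-test (yes e) (no ne) = ⊥-elim (ne (Equivalence.to (pureV-∸ᵛ-unitV i a k aᵢ) e))
      same-test (no ne) (yes e) = ⊥-elim (ne (Equivalence.from (pureV-∸ᵛ-unitV i a k aᵢ) e))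
      not-constant : (d : Dec (replicate n 0 ≡ a)) → when (does d) oneL L.≈ zeroL
      not-constant (no _) = L.refl
      not-constant (yes e) with () ← P.trans (P.sym (VecP.lookup-replicate i 0)) (P.trans (P.cong (λ v → lookup v i) e) aᵢ)

  geom-inverse : ∀ (i : Fin n) c → geom i c * (1# - X (unitV i) * const c) ≈ 1#
  geom-inverse i c = geometric-inverse (geom i c) (X (unitV i) * const c)
    (trans (geom-unfold i c) (+-congˡ (*-congʳ (monomial≈X*const (unitV i) c))))
    where open StepIdentities (PS-ring n) using (geometric-inverse)

  one-minus-XX : ∀ (i j : Fin n) →
    poly ((replicate n 0 , oneL) ∷ (zipWith ℕ._+_ (unitV i) (unitV j) , -L oneL) ∷ []) ≈ 1# - X (unitV i) * X (unitV j)
  one-minus-XX i j = trans (binomial (replicate n 0) oneL e (-L oneL)) (+-congˡ (begin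
    monomial e (-L oneL)       ≈⟨ monomial≈X*const e (-L oneL) ⟩
    X e * const (-L oneL)      ≈⟨ *-congˡ (const-neg oneL) ⟩
    X e * - 1#                 ≈⟨ sym (-‿distribʳ-* (X e) 1#) ⟩
    - (X e * 1#)               ≈⟨ -‿cong (trans (*-identityʳ (X e)) (sym (X-+ (unitV i) (unitV j)))) ⟩
    - (X (unitV i) * X (unitV j)) ∎))
    where
    open SetoidReasoning setoid
    open RingProperties ring using (-‿distribʳ-*)
    e = zipWith ℕ._+_ (unitV i) (unitV j)

  one-plus-βX : ∀ (i : Fin n) → poly ((replicate n 0 , oneL) ∷ (unitV i , βL) ∷ []) ≈ 1# + const βL * X (unitV i)
  one-plus-βX i = trans (binomial (replicate n 0) oneL (unitV i) βL) (+-congˡ (trans (monomial≈X*const (unitV i) βL) (*-comm (X (unitV i)) (const βL))))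

  y*y⁻¹ : ∀ (j : Fin n) → const (yL j) * const (yinvL j) ≈ 1#
  y*y⁻¹ j = trans (sym (const-* (yL j) (yinvL j)))
    (const-cong (L.trans (L.+-identityʳ _) (L.reflexive (P.cong (λ w → (1ℤ , (0 , w)) ∷ []) (unitExp-cancel j)))))

  prodS≈∏ᴸ : ∀ Fs → prodS Fs ≈ FinProducts.∏ᴸ (PS-ring n) Fs
  prodS≈∏ᴸ [] = refl
  prodS≈∏ᴸ (F ∷ Fs) = coefficientwise λ a →
    L.trans (get≈S (*S-cong {F} {F} (coefficientwise λ _ → L.refl) (prodS≈∏ᴸ Fs)) a) (L.reflexive (P.sym (⊛-at F _ a)))

  coefficients-of-difference : ∀ {F G H} c d e → const c * F ≈ const d * G - const e * H →
    ∀ a → (c *L F a) ≈L ((d *L G a) -L (e *L H a))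
  coefficients-of-difference {F} {G} {H} c d e eq a = get≋ (begin
    c *L F a                                            ≈⟨ L.sym (const-*S c F a) ⟩
    (const c *S F) a                                    ≡⟨ P.sym (⊛-at (const c) F a) ⟩
    (const c * F) a                                     ≈⟨ get≈S eq a ⟩
    (const d * G - const e * H) a                       ≡⟨ P.trans (⊕-at _ _ a) (P.cong₂ _+L_ (⊛-at (const d) G a) (P.trans (⊝-at _ a) (P.cong -L_ (⊛-at (const e) H a)))) ⟩
    (const d *S G) a +L (-L (const e *S H) a)           ≈⟨ L.+-cong (const-*S d G a) (L.-‿cong (const-*S e H a)) ⟩
    (d *L G a) -L (e *L H a)                            ∎)
    where
    open LaurentRing n using (get≋)
    open SetoidReasoning L.setoid

module SeriesSubstitution {n : ℕ} (σ : Vec ℤ n → Vec ℤ n) (isInvolution : IsExponentInvolution n σ) where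
  open ExponentSubstitution σ isInvolution public
  open SeriesRing n using (mk≈S; const; ⊛-at)
  open CommutativeRing (PS-ring n) hiding (zero)
  private module L = CommutativeRing (LP-ring n)
  open LaurentRing n using (mk≋; get≋)

  substS-* : ∀ F G → substS (F * G) ≈ substS F * substS G
  substS-* F G = mk≈S λ a → L.reflexive
    (P.trans (P.cong (substL σ) (⊛-at F G a)) (P.trans (substS-*S F G a) (P.sym (⊛-at (substS F) (substS G) a))))

  substS-poly-fixed : ∀ ts → (∀ {e c} → (e , c) ∈ ts → substL σ c ≡ c) → substS (poly ts) ≈ poly ts
  substS-poly-fixed ts fixed = mk≈S λ a → L.reflexive (P.trans (substS-poly ts a) (P.cong (λ ts → poly ts a) (map-fixed ts fixed)))
    where
    map-fixed : ∀ ts → (∀ {e c} → (e , c) ∈ ts → substL σ c ≡ c) → map (λ { (e , c) → (e , substL σ c) }) ts ≡ ts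
    map-fixed [] _ = P.refl
    map-fixed ((e , c) ∷ ts) fixed = P.cong₂ _∷_ (P.cong (e ,_) (fixed (here P.refl))) (map-fixed ts (fixed ∘ there))

  substS-1# : substS 1# ≈ 1#
  substS-1# = substS-poly-fixed ((replicate n 0 , oneL) ∷ []) λ { (here P.refl) → substL-oneL }

  substS-cong : ∀ {F G} → F ≈ G → substS F ≈ substS G
  substS-cong {F} {G} (mk≈S e) = mk≈S λ a → mk≋ (substL-cong {F a} {G a} (get≋ (e a)))

  substS-geom≈ : ∀ i c → substS (geom i c) ≈ geom i (substL σ c)
  substS-geom≈ i c = mk≈S λ a → L.reflexive (substS-geom i c a)

-- Intermediate kernels

module Kernels (n : ℕ) where
  open SeriesRing n using (const)
  open SeriesIdentities n
  open CommutativeRing (PS-ring n) hiding (zero)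
  open FinProducts (PS-ring n)
  open SetoidReasoning setoid

  gY gȲ nXX : Fin n → Fin n → PS n
  gY i j = geom i (yL j)
  gȲ i j = geom i (yinvL j)
  nXX i j = poly ((replicate n 0 , oneL) ∷ (zipWith ℕ._+_ (unitV i) (unitV j) , -L oneL) ∷ [])

  nβX : Fin n → PS n
  nβX i = poly ((replicate n 0 , oneL) ∷ (unitV i , βL) ∷ [])

  Pattern : Set
  Pattern = Fin n → Fin n → Bool

  opt : Bool → PS n → PS n
  opt true g = g
  opt false g = 1#

  cell : Pattern → Pattern → Fin n → Fin n → PS n
  cell Y I i j = opt (Y i j) (gY i j) * opt (I i j) (gȲ i j)

  denominator : Pattern → Pattern → PS n
  denominator Y I = ∏∏ (cell Y I)

  numerator : Pattern → (Fin n → Bool) → PS n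
  numerator N B = ∏∏ (λ i j → opt (N i j) (nXX i j)) * ∏ (λ i → opt (B i) (nβX i))

  kernel : Pattern → Pattern → Pattern → (Fin n → Bool) → PS n
  kernel Y I N B = denominator Y I * numerator N B

  opt-cong : ∀ b {g h} → g ≈ h → opt b g ≈ opt b h
  opt-cong true e = e
  opt-cong false e = refl

  opt-≡ : ∀ {b b'} g → b' ≡ b → opt b' g ≈ opt b g
  opt-≡ g P.refl = refl

  opt-add : ∀ {b b'} g → b ≡ false → b' ≡ true → opt b' g ≈ g * opt b g
  opt-add g P.refl P.refl = sym (*-identityʳ g)

  denominator-addY : ∀ Y Y' I i₀ j₀ → Y i₀ j₀ ≡ false → Y' i₀ j₀ ≡ true → (∀ i j → ¬ (i ≡ i₀ × j ≡ j₀) → Y' i j ≡ Y i j) →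
    denominator Y' I ≈ gY i₀ j₀ * denominator Y I
  denominator-addY Y Y' I i₀ j₀ absent present rest = ∏∏-point (cell Y I) (cell Y' I) i₀ j₀ (gY i₀ j₀)
    (trans (*-congʳ (opt-add (gY i₀ j₀) absent present)) (*-assoc _ _ _))
    (λ i j ne → *-congʳ (opt-≡ (gY i j) (rest i j ne)))

  denominator-addȲ : ∀ Y I I' i₀ j₀ → I i₀ j₀ ≡ false → I' i₀ j₀ ≡ true → (∀ i j → ¬ (i ≡ i₀ × j ≡ j₀) → I' i j ≡ I i j) →
    denominator Y I' ≈ gȲ i₀ j₀ * denominator Y I
  denominator-addȲ Y I I' i₀ j₀ absent present rest = ∏∏-point (cell Y I) (cell Y I') i₀ j₀ (gȲ i₀ j₀)
    (trans (*-congˡ (opt-add (gȲ i₀ j₀) absent present)) (x∙yz≈y∙xz _ _ _))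
    (λ i j ne → *-congˡ (opt-≡ (gȲ i j) (rest i j ne)))
    where open CommutativeSemigroupProperties *-commutativeSemigroup using (x∙yz≈y∙xz)

  denominator-≡ : ∀ Y Y' I I' → (∀ i j → Y' i j ≡ Y i j) → (∀ i j → I' i j ≡ I i j) → denominator Y' I' ≈ denominator Y I
  denominator-≡ Y Y' I I' eY eI = ∏∏-cong (λ i j → *-cong (opt-≡ (gY i j) (eY i j)) (opt-≡ (gȲ i j) (eI i j)))

  numerator-addXX : ∀ N N' B i₀ j₀ → N i₀ j₀ ≡ false → N' i₀ j₀ ≡ true → (∀ i j → ¬ (i ≡ i₀ × j ≡ j₀) → N' i j ≡ N i j) →
    numerator N' B ≈ nXX i₀ j₀ * numerator N B
  numerator-addXX N N' B i₀ j₀ absent present rest = trans (*-congʳ (∏∏-point (λ i j → opt (N i j) (nXX i j)) (λ i j → opt (N' i j) (nXX i j)) i₀ j₀ (nXX i₀ j₀)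
    (opt-add (nXX i₀ j₀) absent present) (λ i j ne → opt-≡ (nXX i j) (rest i j ne)))) (*-assoc _ _ _)

  numerator-addβX : ∀ N B B' i₀ → B i₀ ≡ false → B' i₀ ≡ true → (∀ i → i ≢ i₀ → B' i ≡ B i) → numerator N B' ≈ nβX i₀ * numerator N B
  numerator-addβX N B B' i₀ absent present rest = trans (*-congˡ (∏-point (λ i → opt (B i) (nβX i)) (λ i → opt (B' i) (nβX i)) i₀ (nβX i₀)
    (opt-add (nβX i₀) absent present) (λ i ne → opt-≡ (nβX i) (rest i ne)))) (x∙yz≈y∙xz _ _ _)
    where open CommutativeSemigroupProperties *-commutativeSemigroup using (x∙yz≈y∙xz)

  numerator-≡ : ∀ N N' B B' → (∀ i j → N' i j ≡ N i j) → (∀ i → B' i ≡ B i) → numerator N' B' ≈ numerator N B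
  numerator-≡ N N' B B' eN eB = *-cong (∏∏-cong (λ i j → opt-≡ (nXX i j) (eN i j))) (∏-cong (λ i → opt-≡ (nβX i) (eB i)))

  erase : Pattern → Fin n → Fin n → Pattern
  erase Y a p i j = if does (i ≟ a) ∧ does (j ≟ p) then false else Y i j

  erase-at : ∀ Y a p → erase Y a p a p ≡ false
  erase-at Y a p with a ≟ a | p ≟ p
  ... | yes _ | yes _ = P.refl
  ... | no a≢a | _ = ⊥-elim (a≢a P.refl)
  ... | yes _ | no p≢p = ⊥-elim (p≢p P.refl)

  erase-elsewhere : ∀ Y a p i j → ¬ (i ≡ a × j ≡ p) → erase Y a p i j ≡ Y i j
  erase-elsewhere Y a p i j ne with i ≟ a | j ≟ p
  ... | yes i≡a | yes j≡p = ⊥-elim (ne (i≡a , j≡p))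
  ... | yes _ | no _ = P.refl
  ... | no _ | _ = P.refl

  denominator-eraseY : ∀ Y I a p → Y a p ≡ true → denominator Y I ≈ gY a p * denominator (erase Y a p) I
  denominator-eraseY Y I a p present =
    denominator-addY (erase Y a p) Y I a p (erase-at Y a p) present (λ i j ne → P.sym (erase-elsewhere Y a p i j ne))

  denominator-eraseȲ : ∀ Y I a p → I a p ≡ true → denominator Y I ≈ gȲ a p * denominator Y (erase I a p)
  denominator-eraseȲ Y I a p present =
    denominator-addȲ Y (erase I a p) I a p (erase-at I a p) present (λ i j ne → P.sym (erase-elsewhere I a p i j ne))

  module KernelSubstitution (σ : Vec ℤ n → Vec ℤ n) (isInvolution : IsExponentInvolution n σ) where
    open SeriesSubstitution σ isInvolution

    substS-opt : ∀ b g → substS (opt b g) ≈ opt b (substS g)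
    substS-opt true g = refl
    substS-opt false g = substS-1#

    substS-∏ : ∀ {k} (f : Fin k → PS n) → substS (∏ f) ≈ ∏ (substS ∘ f)
    substS-∏ = ∏-homomorphic substS substS-* substS-1#

    substS-∏∏ : ∀ (f : Fin n → Fin n → PS n) → substS (∏∏ f) ≈ ∏∏ (λ i j → substS (f i j))
    substS-∏∏ f = trans (substS-∏ (λ i → ∏ (f i))) (∏-cong (λ i → substS-∏ (f i)))

    substS-numerator : ∀ N B → substS (numerator N B) ≈ numerator N B
    substS-numerator N B = begin
      substS (numerator N B)
        ≈⟨ substS-* (∏∏ (λ i j → opt (N i j) (nXX i j))) (∏ (λ i → opt (B i) (nβX i))) ⟩
      substS (∏∏ (λ i j → opt (N i j) (nXX i j))) * substS (∏ (λ i → opt (B i) (nβX i)))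
        ≈⟨ *-cong (substS-∏∏ (λ i j → opt (N i j) (nXX i j))) (substS-∏ (λ i → opt (B i) (nβX i))) ⟩
      ∏∏ (λ i j → substS (opt (N i j) (nXX i j))) * ∏ (λ i → substS (opt (B i) (nβX i)))
        ≈⟨ *-cong (∏∏-cong (λ i j → trans (substS-opt (N i j) (nXX i j)) (opt-cong (N i j) (substS-nXX i j))))
                  (∏-cong (λ i → trans (substS-opt (B i) (nβX i)) (opt-cong (B i) (substS-nβX i)))) ⟩
      numerator N B ∎
      where
      substS-nXX : ∀ i j → substS (nXX i j) ≈ nXX i j
      substS-nXX i j = substS-poly-fixed ((replicate n 0 , oneL) ∷ (zipWith ℕ._+_ (unitV i) (unitV j) , -L oneL) ∷ []) λ where
        (here P.refl) → substL-oneL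
        (there (here P.refl)) → P.trans (substL-neg oneL) (P.cong -L_ substL-oneL)
      substS-nβX : ∀ i → substS (nβX i) ≈ nβX i
      substS-nβX i = substS-poly-fixed ((replicate n 0 , oneL) ∷ (unitV i , βL) ∷ []) λ where
        (here P.refl) → substL-oneL
        (there (here P.refl)) → substL-βL

    substS-cell : ∀ Y I i j → substS (cell Y I i j) ≈ opt (Y i j) (substS (gY i j)) * opt (I i j) (substS (gȲ i j))
    substS-cell Y I i j = trans (substS-* (opt (Y i j) (gY i j)) (opt (I i j) (gȲ i j))) (*-cong (substS-opt (Y i j) (gY i j)) (substS-opt (I i j) (gȲ i j)))

  -- Swapping yₚ and y_q permutes the columns of the denominator.
  denominator-swap : ∀ p q Y I → (∀ i → Y i p ≡ Y i q) → (∀ i → I i p ≡ I i q) →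
    SeriesSubstitution.substS (swapExp p q) (swapExp-isExponentInvolution p q) (denominator Y I) ≈ denominator Y I
  denominator-swap p q Y I symY symI = begin
    substS (denominator Y I)               ≈⟨ substS-∏∏ (cell Y I) ⟩
    ∏∏ (λ i j → substS (cell Y I i j))     ≈⟨ ∏∏-cong (λ i j → trans (substS-cell Y I i j) (*-cong (permuted (Y i) (symY i) (gY i) j (moved i j 1ℤ)) (permuted (I i) (symI i) (gȲ i) j (moved i j ℤ.-1ℤ)))) ⟩
    ∏ (λ i → ∏ (cell Y I i ∘ τ))           ≈⟨ ∏-cong (λ i → ∏-transpose (cell Y I i) p q) ⟩
    denominator Y I                        ∎
    where
    open KernelSubstitution (swapExp p q) (swapExp-isExponentInvolution p q)
    open SeriesSubstitution (swapExp p q) (swapExp-isExponentInvolution p q) using (substS; substS-geom≈)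
    τ = PC.transpose p q
    moved : ∀ i j c → substS (geom i ((1ℤ , (0 , unitExp j c)) ∷ [])) ≈ geom i ((1ℤ , (0 , unitExp (τ j) c)) ∷ [])
    moved i j c = trans (substS-geom≈ i _) (reflexive (P.cong (λ w → geom i ((1ℤ , (0 , w)) ∷ [])) (swapExp-unitExp p q j c)))
    τ-invariant : ∀ (f : Fin n → Bool) → f p ≡ f q → ∀ j → f (τ j) ≡ f j
    τ-invariant f fp≡fq j = by-cases (j ≟ p) (j ≟ q)
      where
      by-cases : Dec (j ≡ p) → Dec (j ≡ q) → f (τ j) ≡ f j
      by-cases (yes P.refl) _ = P.trans (P.cong f (transpose-matchˡ j q)) (P.sym fp≡fq)
      by-cases (no _) (yes P.refl) = P.trans (P.cong f (transpose-matchʳ p j)) fp≡fq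
      by-cases (no j≢p) (no j≢q) = P.cong f (transpose-other p q j j≢p j≢q)
    permuted : ∀ (f : Fin n → Bool) → f p ≡ f q → ∀ (g : Fin n → PS n) j → substS (g j) ≈ g (τ j) → opt (f j) (substS (g j)) ≈ opt (f (τ j)) (g (τ j))
    permuted f fp≡fq g j e = trans (opt-cong (f j) e) (opt-≡ (g (τ j)) (P.sym (τ-invariant f fp≡fq j)))

  -- Inverting y_r exchanges the two factors of each cell in column r.
  denominator-invert : ∀ r Y I → (∀ i → Y i r ≡ I i r) →
    SeriesSubstitution.substS (invExp r) (invExp-isExponentInvolution r) (denominator Y I) ≈ denominator Y I
  denominator-invert r Y I Y≡I = trans (substS-∏∏ (cell Y I)) (∏∏-cong λ i j → trans (substS-cell Y I i j) (by-column i j (j ≟ r)))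
    where
    open KernelSubstitution (invExp r) (invExp-isExponentInvolution r)
    open SeriesSubstitution (invExp r) (invExp-isExponentInvolution r) using (substS; substS-geom≈)
    moved : ∀ i j c → substS (geom i ((1ℤ , (0 , unitExp j c)) ∷ [])) ≈ geom i ((1ℤ , (0 , invExp r (unitExp j c))) ∷ [])
    moved i j c = substS-geom≈ i _
    by-column : ∀ i j → Dec (j ≡ r) → opt (Y i j) (substS (gY i j)) * opt (I i j) (substS (gȲ i j)) ≈ cell Y I i j
    by-column i j (yes P.refl) = trans
      (*-cong (opt-cong (Y i j) (trans (moved i j 1ℤ) (reflexive (P.cong (λ w → geom i ((1ℤ , (0 , w)) ∷ [])) (invExp-unitExp j 1ℤ)))))
              (opt-cong (I i j) (trans (moved i j ℤ.-1ℤ) (reflexive (P.cong (λ w → geom i ((1ℤ , (0 , w)) ∷ [])) (invExp-unitExp j ℤ.-1ℤ))))))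
      (trans (*-comm _ _) (*-cong (opt-≡ (gY i j) (P.sym (Y≡I i))) (opt-≡ (gȲ i j) (Y≡I i))))
    by-column i j (no j≢r) =
      *-cong (opt-cong (Y i j) (trans (moved i j 1ℤ) (reflexive (P.cong (λ w → geom i ((1ℤ , (0 , w)) ∷ [])) (invExp-unitExp-≢ r j 1ℤ j≢r)))))
             (opt-cong (I i j) (trans (moved i j ℤ.-1ℤ) (reflexive (P.cong (λ w → geom i ((1ℤ , (0 , w)) ∷ [])) (invExp-unitExp-≢ r j ℤ.-1ℤ j≢r)))))

  record SwapMove (p q a s : Fin n) (Y I N : Pattern) (B : Fin n → Bool) (Y' I' N' : Pattern) (B' : Fin n → Bool) : Set where
    field
      Y-ap : Y a p ≡ true
      Y-aq : Y a q ≡ false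
      Y'-aq : Y' a q ≡ true
      Y'-rest : ∀ i j → ¬ (i ≡ a × j ≡ q) → Y' i j ≡ Y i j
      I-sq : I s q ≡ true
      I-sp : I s p ≡ false
      I'-sp : I' s p ≡ true
      I'-rest : ∀ i j → ¬ (i ≡ s × j ≡ p) → I' i j ≡ I i j
      N-sa : N s a ≡ false
      N'-sa : N' s a ≡ true
      N'-rest : ∀ i j → ¬ (i ≡ s × j ≡ a) → N' i j ≡ N i j
      B'-same : ∀ i → B' i ≡ B i
      Y-symmetric : ∀ i → i ≢ a → Y i p ≡ Y i q
      I-symmetric : ∀ i → i ≢ s → I i p ≡ I i q

  module _ {p q a s : Fin n} {Y I N : Pattern} {B : Fin n → Bool} {Y' I' N' : Pattern} {B' : Fin n → Bool}
           (p≢q : p ≢ q) (move : SwapMove p q a s Y I N B Y' I' N' B') where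
    open SwapMove move
    open KernelSubstitution (swapExp p q) (swapExp-isExponentInvolution p q)
    open SeriesSubstitution (swapExp p q) (swapExp-isExponentInvolution p q) using (substS; substS-*; substS-cong; substS-geom≈)

    private
      Y⁻ = erase Y a p
      I⁻ = erase I s q
      G = denominator Y⁻ I⁻
      W = numerator N B

      denominator-before : denominator Y I ≈ gY a p * (gȲ s q * G)
      denominator-before = trans (denominator-eraseY Y I a p Y-ap) (*-congˡ (denominator-eraseȲ Y⁻ I s q I-sq))

      denominator-after : denominator Y' I' ≈ gY a q * (gȲ s p * (gY a p * (gȲ s q * G)))
      denominator-after = trans (denominator-addY Y Y' I' a q Y-aq Y'-aq Y'-rest)
        (*-congˡ (trans (denominator-addȲ Y I I' s p I-sp I'-sp I'-rest) (*-congˡ denominator-before)))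

      numerator-after : numerator N' B' ≈ (1# - X (unitV s) * X (unitV a)) * W
      numerator-after = trans (numerator-≡ N' N' B B' (λ _ _ → P.refl) B'-same)
        (trans (numerator-addXX N N' B s a N-sa N'-sa N'-rest) (*-congʳ (one-minus-XX s a)))

      Y⁻-symmetric : ∀ i → Y⁻ i p ≡ Y⁻ i q
      Y⁻-symmetric i = by-row (i ≟ a)
        where
        by-row : Dec (i ≡ a) → Y⁻ i p ≡ Y⁻ i q
        by-row (yes P.refl) = P.trans (erase-at Y i p) (P.sym (P.trans (erase-elsewhere Y i p i q (λ pr → p≢q (P.sym (proj₂ pr)))) Y-aq))
        by-row (no i≢a) = P.trans (erase-elsewhere Y a p i p (i≢a ∘ proj₁)) (P.trans (Y-symmetric i i≢a) (P.sym (erase-elsewhere Y a p i q (i≢a ∘ proj₁))))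

      I⁻-symmetric : ∀ i → I⁻ i p ≡ I⁻ i q
      I⁻-symmetric i = by-row (i ≟ s)
        where
        by-row : Dec (i ≡ s) → I⁻ i p ≡ I⁻ i q
        by-row (yes P.refl) = P.trans (erase-elsewhere I i q i p (p≢q ∘ proj₂)) (P.trans I-sp (P.sym (erase-at I i q)))
        by-row (no i≢s) = P.trans (erase-elsewhere I s q i p (i≢s ∘ proj₁)) (P.trans (I-symmetric i i≢s) (P.sym (erase-elsewhere I s q i q (i≢s ∘ proj₁))))

      moved : ∀ i j c → substS (geom i ((1ℤ , (0 , unitExp j c)) ∷ [])) ≈ geom i ((1ℤ , (0 , unitExp (PC.transpose p q j) c)) ∷ [])
      moved i j c = trans (substS-geom≈ i _) (reflexive (P.cong (λ w → geom i ((1ℤ , (0 , w)) ∷ [])) (swapExp-unitExp p q j c)))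

      swapped : substS (denominator Y I * W) ≈ (gY a q * (gȲ s p * G)) * W
      swapped = begin
        substS (denominator Y I * W)                              ≈⟨ substS-cong (*-congʳ denominator-before) ⟩
        substS ((gY a p * (gȲ s q * G)) * W)                      ≈⟨ trans (substS-* _ _) (*-cong (trans (substS-* _ _) (*-congˡ (substS-* _ _))) (substS-numerator N B)) ⟩
        (substS (gY a p) * (substS (gȲ s q) * substS G)) * W
          ≈⟨ *-congʳ (*-cong (trans (moved a p 1ℤ) (reflexive (P.cong (gY a) (transpose-matchˡ p q))))
                             (*-cong (trans (moved s q ℤ.-1ℤ) (reflexive (P.cong (gȲ s) (transpose-matchʳ p q))))
                                     (denominator-swap p q Y⁻ I⁻ Y⁻-symmetric I⁻-symmetric))) ⟩
        (gY a q * (gȲ s p * G)) * W                               ∎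

    -- The swap operator adds 1/(1 - xₐ y_q), 1/(1 - xₛ/yₚ) and 1 - xₛxₐ to the kernel; everything else is symmetric in yₚ, y_q.
    swap-step : const (yL p -L yL q) * kernel Y' I' N' B' ≈ const (yL p) * kernel Y I N B - const (yL q) * substS (kernel Y I N B)
    swap-step = begin
      const (yL p -L yL q) * (denominator Y' I' * numerator N' B')
        ≈⟨ *-cong (trans (const-+ (yL p) (-L yL q)) (+-congˡ (const-neg (yL q)))) (*-cong denominator-after numerator-after) ⟩
      (u - v) * ((gY a q * (gȲ s p * (gY a p * (gȲ s q * G)))) * ((1# - X (unitV s) * X (unitV a)) * W))
        ≈⟨ a-identity u (const (yinvL p)) v (const (yinvL q)) (X (unitV a)) (X (unitV s)) (gY a p) (gY a q) (gȲ s p) (gȲ s q) G W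
             (geom-inverse a (yL p)) (geom-inverse a (yL q)) (geom-inverse s (yinvL p)) (geom-inverse s (yinvL q)) (y*y⁻¹ p) (y*y⁻¹ q) ⟩
      u * ((gY a p * (gȲ s q * G)) * W) - v * ((gY a q * (gȲ s p * G)) * W)
        ≈⟨ +-cong (*-congˡ (*-congʳ (sym denominator-before))) (-‿cong (*-congˡ (sym swapped))) ⟩
      u * (denominator Y I * W) - v * substS (denominator Y I * W) ∎
      where
      open StepIdentities (PS-ring n) using (a-identity)
      u = const (yL p)
      v = const (yL q)

  record InversionMove (r s : Fin n) (Y I N : Pattern) (B : Fin n → Bool) (Y' I' N' : Pattern) (B' : Fin n → Bool) : Set where
    field
      Y'-same : ∀ i j → Y' i j ≡ Y i j
      Y-sr : Y s r ≡ true
      I-sr : I s r ≡ false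
      I'-sr : I' s r ≡ true
      I'-rest : ∀ i j → ¬ (i ≡ s × j ≡ r) → I' i j ≡ I i j
      N'-same : ∀ i j → N' i j ≡ N i j
      B-s : B s ≡ false
      B'-s : B' s ≡ true
      B'-rest : ∀ i → i ≢ s → B' i ≡ B i
      Y≡I-off-row : ∀ i → i ≢ s → Y i r ≡ I i r

  module _ {r s : Fin n} {Y I N : Pattern} {B : Fin n → Bool} {Y' I' N' : Pattern} {B' : Fin n → Bool}
           (move : InversionMove r s Y I N B Y' I' N' B') where
    open InversionMove move
    open KernelSubstitution (invExp r) (invExp-isExponentInvolution r)
    open SeriesSubstitution (invExp r) (invExp-isExponentInvolution r) using (substS; substS-*; substS-cong; substS-geom≈)

    private
      Y⁻ = erase Y s r
      G = denominator Y⁻ I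
      W = numerator N B

      denominator-before : denominator Y I ≈ gY s r * G
      denominator-before = denominator-eraseY Y I s r Y-sr

      denominator-after : denominator Y' I' ≈ gȲ s r * (gY s r * G)
      denominator-after = trans (denominator-≡ Y Y' I' I' Y'-same (λ _ _ → P.refl))
        (trans (denominator-addȲ Y I I' s r I-sr I'-sr I'-rest) (*-congˡ denominator-before))

      numerator-after : numerator N' B' ≈ (1# + const βL * X (unitV s)) * W
      numerator-after = trans (numerator-≡ N N' B' B' N'-same (λ _ → P.refl))
        (trans (numerator-addβX N B B' s B-s B'-s B'-rest) (*-congʳ (one-plus-βX s)))

      Y⁻≡I : ∀ i → Y⁻ i r ≡ I i r
      Y⁻≡I i = by-row (i ≟ s)
        where
        by-row : Dec (i ≡ s) → Y⁻ i r ≡ I i r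
        by-row (yes P.refl) = P.trans (erase-at Y i r) (P.sym I-sr)
        by-row (no i≢s) = P.trans (erase-elsewhere Y s r i r (i≢s ∘ proj₁)) (Y≡I-off-row i i≢s)

      inverted : substS (denominator Y I * W) ≈ (gȲ s r * G) * W
      inverted = begin
        substS (denominator Y I * W)          ≈⟨ substS-cong (*-congʳ denominator-before) ⟩
        substS ((gY s r * G) * W)             ≈⟨ trans (substS-* _ _) (*-cong (substS-* _ _) (substS-numerator N B)) ⟩
        (substS (gY s r) * substS G) * W
          ≈⟨ *-congʳ (*-cong (trans (substS-geom≈ s (yL r)) (reflexive (P.cong (λ w → geom s ((1ℤ , (0 , w)) ∷ [])) (invExp-unitExp r 1ℤ))))
                             (denominator-invert r Y⁻ I Y⁻≡I)) ⟩
        (gȲ s r * G) * W                      ∎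

    -- The operator π^BC adds 1/(1 - xₛ/yᵣ) and 1 + βxₛ to the kernel; everything else is invariant under yᵣ ↦ yᵣ⁻¹.
    inversion-step : const (yL r -L yinvL r) * kernel Y' I' N' B' ≈
      const (yL r +L βL) * kernel Y I N B - const (yinvL r +L βL) * substS (kernel Y I N B)
    inversion-step = begin
      const (yL r -L yinvL r) * (denominator Y' I' * numerator N' B')
        ≈⟨ *-cong (trans (const-+ (yL r) (-L yinvL r)) (+-congˡ (const-neg (yinvL r)))) (*-cong denominator-after numerator-after) ⟩
      (y - ȳ) * ((gȲ s r * (gY s r * G)) * ((1# + β * X (unitV s)) * W))
        ≈⟨ bc-identity y ȳ β (X (unitV s)) (gY s r) (gȲ s r) G W (geom-inverse s (yL r)) (geom-inverse s (yinvL r)) ⟩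
      (y + β) * ((gY s r * G) * W) - (ȳ + β) * ((gȲ s r * G) * W)
        ≈⟨ +-cong (*-cong (sym (const-+ (yL r) βL)) (*-congʳ (sym denominator-before)))
                  (-‿cong (*-cong (sym (const-+ (yinvL r) βL)) (sym inverted))) ⟩
      const (yL r +L βL) * (denominator Y I * W) - const (yinvL r +L βL) * substS (denominator Y I * W) ∎
      where
      open StepIdentities (PS-ring n) using (bc-identity)
      y = const (yL r)
      ȳ = const (yinvL r)
      β = const βL

-- Index arithmetic of the intermediate kernels

module BooleanComparisons where
  open import Data.Nat
  open import Data.Nat.Properties
  open import Relation.Binary.PropositionalEquality

  ≤ᵇ≡true : ∀ {x y} → x ≤ y → (x ≤ᵇ y) ≡ true
  ≤ᵇ≡true {x} {y} le with x ≤ᵇ y | ≤⇒≤ᵇ le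
  ... | true | _ = refl

  ≤ᵇ≡false : ∀ {x y} → y < x → (x ≤ᵇ y) ≡ false
  ≤ᵇ≡false {x} {y} lt with x ≤ᵇ y in eq
  ... | true = ⊥-elim (<⇒≱ lt (≤ᵇ⇒≤ x y (subst T (sym eq) tt)))
  ... | false = refl

  ≤ᵇ≡true⇒≤ : ∀ {x y} → (x ≤ᵇ y) ≡ true → x ≤ y
  ≤ᵇ≡true⇒≤ {x} {y} e = ≤ᵇ⇒≤ x y (subst T (sym e) tt)

  ≤ᵇ≡false⇒> : ∀ {x y} → (x ≤ᵇ y) ≡ false → y < x
  ≤ᵇ≡false⇒> {x} {y} e = ≰⇒> (λ le → subst T e (≤⇒≤ᵇ le))

  ≡ᵇ≡true : ∀ {x y} → x ≡ y → (x ≡ᵇ y) ≡ true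
  ≡ᵇ≡true {x} {y} e with x ≡ᵇ y | ≡⇒≡ᵇ x y e
  ... | true | _ = refl

  ≡ᵇ≡false : ∀ {x y} → x ≢ y → (x ≡ᵇ y) ≡ false
  ≡ᵇ≡false {x} {y} ne with x ≡ᵇ y in eq
  ... | true = ⊥-elim (ne (≡ᵇ⇒≡ x y (subst T (sym eq) tt)))
  ... | false = refl

  ≡ᵇ≡true⇒≡ : ∀ {x y} → (x ≡ᵇ y) ≡ true → x ≡ y
  ≡ᵇ≡true⇒≡ {x} {y} e = ≡ᵇ⇒≡ x y (subst T (sym e) tt)

-- The kernel in state (s, t), 0-based with n = m + 1: the first s blocks of Φ have been applied, and of
-- block s the operators π^BC π_{n-1} ⋯ π_{t+1} (none when t = m + 1).
module KernelPatterns (m : ℕ) where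
  open import Data.Nat
  open import Data.Nat.Properties
  open import Relation.Binary.PropositionalEquality
  open import Relation.Binary.Definitions using (tri<; tri≈; tri>)
  open import Data.Sum using (inj₁; inj₂)
  open BooleanComparisons
  open BoolP using (∧-zeroʳ; ∧-identityʳ; ∨-identityʳ)
  Yℕ : ℕ → ℕ → ℕ → ℕ → Bool
  Yℕ s t i j = (i + j ≤ᵇ m + s) ∨ ((suc s ≤ᵇ i) ∧ ((i + t ≤ᵇ m + s) ∧ (i + j ≤ᵇ suc (m + s))))

  Iℕ : ℕ → ℕ → ℕ → ℕ → Bool
  Iℕ s t i j = ((suc i ≤ᵇ s) ∧ (i ≤ᵇ j)) ∨ ((i ≡ᵇ s) ∧ (t ≤ᵇ j))

  Nℕ : ℕ → ℕ → ℕ → ℕ → Bool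
  Nℕ s t i j = (suc i ≤ᵇ j) ∧ ((suc i ≤ᵇ s) ∨ ((i ≡ᵇ s) ∧ (j + t ≤ᵇ m + s)))

  Bℕ : ℕ → ℕ → ℕ → Bool
  Bℕ s t i = (suc i ≤ᵇ s) ∨ ((i ≡ᵇ s) ∧ (t ≤ᵇ m))

  private
    +-<-shift : ∀ {s i} k → s < i → k + s < i + k
    +-<-shift {s} {i} k lt = subst (k + s <_) (+-comm k i) (+-monoʳ-< k lt)

  module InversionFacts (s : ℕ) where
    Y'-same : ∀ i j → Yℕ s m i j ≡ Yℕ s (suc m) i j
    Y'-same i j with suc s ≤ᵇ i in e
    ... | false = refl
    ... | true
        rewrite ≤ᵇ≡false {i + m} {m + s} (+-<-shift m (≤ᵇ≡true⇒≤ e))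
              | ≤ᵇ≡false {i + suc m} {m + s} (<-≤-trans (+-<-shift m (≤ᵇ≡true⇒≤ e)) (+-monoʳ-≤ i (n≤1+n m))) = refl

    Y-sr : Yℕ s (suc m) s m ≡ true
    Y-sr rewrite ≤ᵇ≡true {s + m} {m + s} (≤-reflexive (+-comm s m)) = refl

    I-sr : Iℕ s (suc m) s m ≡ false
    I-sr rewrite ≤ᵇ≡false {suc s} {s} (n<1+n s) | ≡ᵇ≡true {s} {s} refl | ≤ᵇ≡false {suc m} {m} (n<1+n m) = refl

    I'-rest : ∀ i j → j ≤ m → ¬ (i ≡ s × j ≡ m) → Iℕ s m i j ≡ Iℕ s (suc m) i j
    I'-rest i j jm ne with i ≡ᵇ s in e
    ... | false = refl
    ... | true
        rewrite ≤ᵇ≡false {m} {j} (≤∧≢⇒< jm (λ q → ne (≡ᵇ≡true⇒≡ e , q)))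
              | ≤ᵇ≡false {suc m} {j} (<-trans (≤∧≢⇒< jm (λ q → ne (≡ᵇ≡true⇒≡ e , q))) (n<1+n m)) = refl

    I'-sr : Iℕ s m s m ≡ true
    I'-sr rewrite ≤ᵇ≡false {suc s} {s} (n<1+n s) | ≡ᵇ≡true {s} {s} refl | ≤ᵇ≡true {m} {m} ≤-refl = refl

    N'-same : ∀ i j → Nℕ s m i j ≡ Nℕ s (suc m) i j
    N'-same i j with suc i ≤ᵇ j in eL | i ≡ᵇ s in eE
    ... | false | _ = refl
    ... | true | false = refl
    ... | true | true
        rewrite ≤ᵇ≡false {j + m} {m + s} (+-<-shift m (subst (_< j) (≡ᵇ≡true⇒≡ eE) (≤ᵇ≡true⇒≤ eL)))
              | ≤ᵇ≡false {j + suc m} {m + s} (<-≤-trans (+-<-shift m (subst (_< j) (≡ᵇ≡true⇒≡ eE) (≤ᵇ≡true⇒≤ eL))) (+-monoʳ-≤ j (n≤1+n m))) = refl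

    B-s : Bℕ s (suc m) s ≡ false
    B-s rewrite ≤ᵇ≡false {suc s} {s} (n<1+n s) | ≡ᵇ≡true {s} {s} refl | ≤ᵇ≡false {suc m} {m} (n<1+n m) = refl

    B'-rest : ∀ i → i ≢ s → Bℕ s m i ≡ Bℕ s (suc m) i
    B'-rest i ne rewrite ≡ᵇ≡false ne = refl

    B'-s : Bℕ s m s ≡ true
    B'-s rewrite ≤ᵇ≡false {suc s} {s} (n<1+n s) | ≡ᵇ≡true {s} {s} refl | ≤ᵇ≡true {m} {m} ≤-refl = refl

    Y≡I-off-row : ∀ i → i ≤ m → i ≢ s → Yℕ s (suc m) i m ≡ Iℕ s (suc m) i m
    Y≡I-off-row i im ne with <-cmp i s
    ... | tri< lt _ _
        rewrite ≤ᵇ≡true {i + m} {m + s} (subst (_≤ m + s) (+-comm m i) (+-monoʳ-≤ m (<⇒≤ lt)))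
              | ≤ᵇ≡true {suc i} {s} lt
              | ≤ᵇ≡true {i} {m} im = refl
    ... | tri≈ _ eq _ = ⊥-elim (ne eq)
    ... | tri> _ _ gt
        rewrite ≤ᵇ≡false {i + m} {m + s} (+-<-shift m gt)
              | ≤ᵇ≡true {suc s} {i} gt
              | ≤ᵇ≡false {i + suc m} {m + s} (<-≤-trans (+-<-shift m gt) (+-monoʳ-≤ i (n≤1+n m)))
              | ≤ᵇ≡false {suc i} {s} (<-trans gt (n<1+n i))
              | ≡ᵇ≡false ne = refl

  module SwapFacts (s t a : ℕ) (a+t≡m+s : a + t ≡ m + s) (s≤t : s ≤ t) (t<m : suc t ≤ m) where
    s<a : s < a
    s<a = ≰⇒> (λ a≤s → <-irrefl (trans a+t≡m+s (+-comm m s)) (+-mono-≤-< a≤s t<m))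

    a+1+t≡1+m+s : a + suc t ≡ suc (m + s)
    a+1+t≡1+m+s = trans (+-suc a t) (cong suc a+t≡m+s)

    below-a : ∀ {i} → i < a → i + suc t ≤ m + s
    below-a {i} lt = subst (i + suc t ≤_) a+t≡m+s (subst (_≤ a + t) (sym (+-suc i t)) (+-monoˡ-< t lt))

    above-a : ∀ {i} → a < i → m + s < i + t
    above-a {i} gt = subst (_< i + t) a+t≡m+s (+-monoˡ-< t gt)

    Y-ap : Yℕ s (suc t) a t ≡ true
    Y-ap rewrite ≤ᵇ≡true {a + t} {m + s} (≤-reflexive a+t≡m+s) = refl

    Y-aq : Yℕ s (suc t) a (suc t) ≡ false
    Y-aq rewrite ≤ᵇ≡false {a + suc t} {m + s} (≤-reflexive (sym a+1+t≡1+m+s)) = ∧-zeroʳ (suc s ≤ᵇ a)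

    Y'-rest : ∀ i j → ¬ (i ≡ a × j ≡ suc t) → Yℕ s t i j ≡ Yℕ s (suc t) i j
    Y'-rest i j ne with <-cmp i a
    ... | tri< lt _ _
        rewrite ≤ᵇ≡true {i + t} {m + s} (≤-trans (+-monoʳ-≤ i (n≤1+n t)) (below-a lt))
              | ≤ᵇ≡true {i + suc t} {m + s} (below-a lt) = refl
    ... | tri> _ _ gt
        rewrite ≤ᵇ≡false {i + t} {m + s} (above-a gt)
              | ≤ᵇ≡false {i + suc t} {m + s} (<-≤-trans (above-a gt) (+-monoʳ-≤ i (n≤1+n t))) = refl
    ... | tri≈ _ refl _ with i + j ≤ᵇ m + s in e1
    ...   | true = refl
    ...   | false
        rewrite ≤ᵇ≡true {i + t} {m + s} (≤-reflexive a+t≡m+s)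
              | ≤ᵇ≡false {i + suc t} {m + s} (≤-reflexive (sym a+1+t≡1+m+s))
              | ∧-zeroʳ (suc s ≤ᵇ i) = not-on-diagonal
      where
      not-on-diagonal : ((suc s ≤ᵇ i) ∧ (i + j ≤ᵇ suc (m + s))) ≡ false
      not-on-diagonal with i + j ≤ᵇ suc (m + s) in e4
      ... | false = ∧-zeroʳ (suc s ≤ᵇ i)
      ... | true = ⊥-elim (ne (refl , +-cancelˡ-≡ i j (suc t) (trans (≤-antisym (≤ᵇ≡true⇒≤ e4) (≤ᵇ≡false⇒> e1)) (sym a+1+t≡1+m+s))))

    Y'-aq : Yℕ s t a (suc t) ≡ true
    Y'-aq
        rewrite ≤ᵇ≡false {a + suc t} {m + s} (≤-reflexive (sym a+1+t≡1+m+s))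
              | ≤ᵇ≡true {suc s} {a} s<a
              | ≤ᵇ≡true {a + t} {m + s} (≤-reflexive a+t≡m+s)
              | ≤ᵇ≡true {a + suc t} {suc (m + s)} (≤-reflexive a+1+t≡1+m+s) = refl

    I-sq : Iℕ s (suc t) s (suc t) ≡ true
    I-sq rewrite ≤ᵇ≡false {suc s} {s} (n<1+n s) | ≡ᵇ≡true {s} {s} refl | ≤ᵇ≡true {suc t} {suc t} ≤-refl = refl

    I-sp : Iℕ s (suc t) s t ≡ false
    I-sp rewrite ≤ᵇ≡false {suc s} {s} (n<1+n s) | ≡ᵇ≡true {s} {s} refl | ≤ᵇ≡false {suc t} {t} (n<1+n t) = refl

    I'-rest : ∀ i j → ¬ (i ≡ s × j ≡ t) → Iℕ s t i j ≡ Iℕ s (suc t) i j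
    I'-rest i j ne with i ≡ᵇ s in e
    ... | false = refl
    ... | true with <-cmp j t
    ...   | tri< lt _ _ rewrite ≤ᵇ≡false {t} {j} lt | ≤ᵇ≡false {suc t} {j} (<-trans lt (n<1+n t)) = refl
    ...   | tri≈ _ eq _ = ⊥-elim (ne (≡ᵇ≡true⇒≡ e , eq))
    ...   | tri> _ _ gt rewrite ≤ᵇ≡true {t} {j} (<⇒≤ gt) | ≤ᵇ≡true {suc t} {j} gt = refl

    I'-sp : Iℕ s t s t ≡ true
    I'-sp rewrite ≤ᵇ≡false {suc s} {s} (n<1+n s) | ≡ᵇ≡true {s} {s} refl | ≤ᵇ≡true {t} {t} ≤-refl = refl

    N-sa : Nℕ s (suc t) s a ≡ false
    N-sa
        rewrite ≤ᵇ≡true {suc s} {a} s<a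
              | ≤ᵇ≡false {suc s} {s} (n<1+n s)
              | ≡ᵇ≡true {s} {s} refl
              | ≤ᵇ≡false {a + suc t} {m + s} (≤-reflexive (sym a+1+t≡1+m+s)) = refl

    N'-rest : ∀ i j → ¬ (i ≡ s × j ≡ a) → Nℕ s t i j ≡ Nℕ s (suc t) i j
    N'-rest i j ne with i ≡ᵇ s in e
    ... | false = refl
    ... | true with <-cmp j a
    ...   | tri< lt _ _
        rewrite ≤ᵇ≡true {j + t} {m + s} (≤-trans (+-monoʳ-≤ j (n≤1+n t)) (below-a lt))
              | ≤ᵇ≡true {j + suc t} {m + s} (below-a lt) = refl
    ...   | tri≈ _ eq _ = ⊥-elim (ne (≡ᵇ≡true⇒≡ e , eq))
    ...   | tri> _ _ gt
        rewrite ≤ᵇ≡false {j + t} {m + s} (above-a gt)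
              | ≤ᵇ≡false {j + suc t} {m + s} (<-≤-trans (above-a gt) (+-monoʳ-≤ j (n≤1+n t))) = refl

    N'-sa : Nℕ s t s a ≡ true
    N'-sa
        rewrite ≤ᵇ≡true {suc s} {a} s<a
              | ≤ᵇ≡false {suc s} {s} (n<1+n s)
              | ≡ᵇ≡true {s} {s} refl
              | ≤ᵇ≡true {a + t} {m + s} (≤-reflexive a+t≡m+s) = refl

    B'-same : ∀ i → Bℕ s t i ≡ Bℕ s (suc t) i
    B'-same i rewrite ≤ᵇ≡true {t} {m} (<⇒≤ t<m) | ≤ᵇ≡true {suc t} {m} t<m = refl

    Y-symmetric : ∀ i → i ≢ a → Yℕ s (suc t) i t ≡ Yℕ s (suc t) i (suc t)
    Y-symmetric i ne with <-cmp i a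
    ... | tri< lt _ _
        rewrite ≤ᵇ≡true {i + t} {m + s} (≤-trans (+-monoʳ-≤ i (n≤1+n t)) (below-a lt))
              | ≤ᵇ≡true {i + suc t} {m + s} (below-a lt) = refl
    ... | tri≈ _ eq _ = ⊥-elim (ne eq)
    ... | tri> _ _ gt
        rewrite ≤ᵇ≡false {i + t} {m + s} (above-a gt)
              | ≤ᵇ≡false {i + suc t} {m + s} (<-≤-trans (above-a gt) (+-monoʳ-≤ i (n≤1+n t))) = refl

    I-symmetric : ∀ i → i ≢ s → Iℕ s (suc t) i t ≡ Iℕ s (suc t) i (suc t)
    I-symmetric i ne rewrite ≡ᵇ≡false ne with <-cmp i s
    ... | tri< lt _ _
        rewrite ≤ᵇ≡true {suc i} {s} lt
              | ≤ᵇ≡true {i} {t} (≤-trans (<⇒≤ lt) s≤t)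
              | ≤ᵇ≡true {i} {suc t} (≤-trans (<⇒≤ lt) (≤-trans s≤t (n≤1+n t))) = refl
    ... | tri≈ _ eq _ = ⊥-elim (ne eq)
    ... | tri> _ _ gt rewrite ≤ᵇ≡false {suc i} {s} (<-trans gt (n<1+n i)) = refl

  Y-next : ∀ s i j → i ≤ m → j ≤ m → Yℕ s s i j ≡ Yℕ (suc s) (suc m) i j
  Y-next s i j im jm with ≤-total i s
  ... | inj₁ i≤s
      rewrite ≤ᵇ≡true {i + j} {m + s} (subst (i + j ≤_) (+-comm s m) (+-mono-≤ i≤s jm))
            | ≤ᵇ≡true {i + j} {m + suc s} (≤-trans (subst (i + j ≤_) (+-comm s m) (+-mono-≤ i≤s jm)) (+-monoʳ-≤ m (n≤1+n s))) = refl
  ... | inj₂ s≤i with <-cmp s i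
  ...   | tri≈ _ refl _
      rewrite ≤ᵇ≡true {s + j} {m + s} (subst (s + j ≤_) (+-comm s m) (+-monoʳ-≤ s jm))
            | ≤ᵇ≡true {s + j} {m + suc s} (≤-trans (subst (s + j ≤_) (+-comm s m) (+-monoʳ-≤ s jm)) (+-monoʳ-≤ m (n≤1+n s))) = refl
  ...   | tri> _ _ gt = ⊥-elim (<⇒≱ gt s≤i)
  ...   | tri< lt _ _
      rewrite ≤ᵇ≡true {suc s} {i} lt
            | ≤ᵇ≡true {i + s} {m + s} (+-monoˡ-≤ s im)
            | ≤ᵇ≡false {i + suc m} {m + suc s} (subst (_< i + suc m) (+-comm (suc s) m) (+-mono-≤-< lt (n<1+n m)))
            | +-suc m s
            | ∧-zeroʳ (suc (suc s) ≤ᵇ i)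
            | ∨-identityʳ (i + j ≤ᵇ suc (m + s)) with i + j ≤ᵇ m + s in e
  ...     | false = refl
  ...     | true rewrite ≤ᵇ≡true {i + j} {suc (m + s)} (≤-trans (≤ᵇ≡true⇒≤ e) (n≤1+n (m + s))) = refl

  I-next : ∀ s i j → j ≤ m → Iℕ s s i j ≡ Iℕ (suc s) (suc m) i j
  I-next s i j jm with <-cmp i s
  ... | tri< lt _ _
      rewrite ≤ᵇ≡true {suc i} {s} lt
            | ≤ᵇ≡true {suc i} {suc s} (<⇒≤ (s≤s lt))
            | ≡ᵇ≡false {i} {s} (<⇒≢ lt)
            | ≡ᵇ≡false {i} {suc s} (<⇒≢ (<-trans lt (n<1+n s)))
            | ∨-identityʳ (i ≤ᵇ j) = refl
  ... | tri≈ _ refl _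
      rewrite ≤ᵇ≡false {suc i} {i} (n<1+n i)
            | ≡ᵇ≡true {i} {i} refl
            | ≤ᵇ≡true {suc i} {suc i} ≤-refl
            | ≡ᵇ≡false {i} {suc i} (<⇒≢ (n<1+n i))
            | ∨-identityʳ (i ≤ᵇ j) = refl
  ... | tri> _ _ gt
      rewrite ≤ᵇ≡false {suc i} {s} (<-trans gt (n<1+n i))
            | ≡ᵇ≡false {i} {s} (λ e → <⇒≢ gt (sym e))
            | ≤ᵇ≡false {suc i} {suc s} (s≤s gt)
            | ≤ᵇ≡false {suc m} {j} (s≤s jm)
            | ∧-zeroʳ (i ≡ᵇ suc s) = refl

  N-next : ∀ s i j → j ≤ m → Nℕ s s i j ≡ Nℕ (suc s) (suc m) i j
  N-next s i j jm with suc i ≤ᵇ j in eL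
  ... | false = refl
  ... | true with <-cmp i s
  ...   | tri< lt _ _ rewrite ≤ᵇ≡true {suc i} {s} lt | ≤ᵇ≡true {suc i} {suc s} (<⇒≤ (s≤s lt)) = refl
  ...   | tri≈ _ refl _
      rewrite ≤ᵇ≡false {suc i} {i} (n<1+n i)
            | ≡ᵇ≡true {i} {i} refl
            | ≤ᵇ≡true {j + i} {m + i} (+-monoˡ-≤ i jm)
            | ≤ᵇ≡true {suc i} {suc i} ≤-refl = refl
  ...   | tri> _ _ gt
      rewrite ≤ᵇ≡false {suc i} {s} (<-trans gt (n<1+n i))
            | ≡ᵇ≡false {i} {s} (λ e → <⇒≢ gt (sym e))
            | ≤ᵇ≡false {suc i} {suc s} (s≤s gt) with i ≡ᵇ suc s in eE
  ...     | false = refl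
  ...     | true
      rewrite ≤ᵇ≡false {j + suc m} {m + suc s} (subst (_< j + suc m) (+-comm (suc s) m) (+-mono-<-≤ (subst (_< j) (≡ᵇ≡true⇒≡ eE) (≤ᵇ≡true⇒≤ eL)) (n≤1+n m))) = refl

  B-next : ∀ s i → s < m → Bℕ s s i ≡ Bℕ (suc s) (suc m) i
  B-next s i sm with <-cmp i s
  ... | tri< lt _ _ rewrite ≤ᵇ≡true {suc i} {s} lt | ≤ᵇ≡true {suc i} {suc s} (<⇒≤ (s≤s lt)) = refl
  ... | tri≈ _ refl _
      rewrite ≤ᵇ≡false {suc i} {i} (n<1+n i)
            | ≡ᵇ≡true {i} {i} refl
            | ≤ᵇ≡true {i} {m} (<⇒≤ sm)
            | ≤ᵇ≡true {suc i} {suc i} ≤-refl = refl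
  ... | tri> _ _ gt
      rewrite ≤ᵇ≡false {suc i} {s} (<-trans gt (n<1+n i))
            | ≡ᵇ≡false {i} {s} (λ e → <⇒≢ gt (sym e))
            | ≤ᵇ≡false {suc i} {suc s} (s≤s gt)
            | ≤ᵇ≡false {suc m} {m} (n<1+n m)
            | ∧-zeroʳ (i ≡ᵇ suc s) = refl

  Y-start : ∀ i j → Yℕ 0 (suc m) i j ≡ (suc (i + j) ≤ᵇ suc m)
  Y-start i j
      rewrite +-identityʳ m
            | ≤ᵇ≡false {i + suc m} {m} (<-≤-trans (n<1+n m) (m≤n+m (suc m) i))
            | ∧-zeroʳ (1 ≤ᵇ i)
            | ∨-identityʳ (i + j ≤ᵇ m) with i + j ≤ᵇ m in e
  ... | true rewrite ≤ᵇ≡true {suc (i + j)} {suc m} (s≤s (≤ᵇ≡true⇒≤ e)) = refl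
  ... | false rewrite ≤ᵇ≡false {suc (i + j)} {suc m} (s≤s (≤ᵇ≡false⇒> e)) = refl

  I-start : ∀ i j → j ≤ m → Iℕ 0 (suc m) i j ≡ false
  I-start i j jm rewrite ≤ᵇ≡false {suc m} {j} (s≤s jm) = ∧-zeroʳ (i ≡ᵇ 0)

  N-start : ∀ i j → Nℕ 0 (suc m) i j ≡ false
  N-start i j
      rewrite +-identityʳ m
            | ≤ᵇ≡false {j + suc m} {m} (<-≤-trans (n<1+n m) (m≤n+m (suc m) j))
            | ∧-zeroʳ (i ≡ᵇ 0) = ∧-zeroʳ (suc i ≤ᵇ j)

  B-start : ∀ i → Bℕ 0 (suc m) i ≡ false
  B-start i rewrite ≤ᵇ≡false {suc m} {m} (n<1+n m) = ∧-zeroʳ (i ≡ᵇ 0)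

  Y-end : ∀ i j → i ≤ m → j ≤ m → Yℕ m m i j ≡ true
  Y-end i j im jm rewrite ≤ᵇ≡true {i + j} {m + m} (+-mono-≤ im jm) = refl

  I-end : ∀ i j → i ≤ m → Iℕ m m i j ≡ (i ≤ᵇ j)
  I-end i j im with <-cmp i m
  ... | tri< lt _ _ rewrite ≤ᵇ≡true {suc i} {m} lt | ≡ᵇ≡false {i} {m} (<⇒≢ lt) = ∨-identityʳ (i ≤ᵇ j)
  ... | tri≈ _ refl _ rewrite ≤ᵇ≡false {suc i} {i} (n<1+n i) | ≡ᵇ≡true {i} {i} refl = refl
  ... | tri> _ _ gt = ⊥-elim (<⇒≱ gt im)

  N-end : ∀ i j → i ≤ m → j ≤ m → Nℕ m m i j ≡ (suc i ≤ᵇ j)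
  N-end i j im jm with <-cmp i m
  ... | tri< lt _ _ rewrite ≤ᵇ≡true {suc i} {m} lt = ∧-identityʳ (suc i ≤ᵇ j)
  ... | tri≈ _ refl _
      rewrite ≤ᵇ≡false {suc i} {i} (n<1+n i)
            | ≡ᵇ≡true {i} {i} refl
            | ≤ᵇ≡true {j + i} {i + i} (+-monoˡ-≤ i jm) = ∧-identityʳ (suc i ≤ᵇ j)
  ... | tri> _ _ gt = ⊥-elim (<⇒≱ gt im)

  B-end : ∀ i → i ≤ m → Bℕ m m i ≡ true
  B-end i im with <-cmp i m
  ... | tri< lt _ _ rewrite ≤ᵇ≡true {suc i} {m} lt = refl
  ... | tri≈ _ refl _ rewrite ≤ᵇ≡false {suc i} {i} (n<1+n i) | ≡ᵇ≡true {i} {i} refl | ≤ᵇ≡true {i} {i} ≤-refl = refl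
  ... | tri> _ _ gt = ⊥-elim (<⇒≱ gt im)


-- The kernels along Φ^BC

module KernelStates (m : ℕ) where
  open KernelPatterns m
  open Kernels (suc m)
  open SeriesRing (suc m) using (const)
  open SeriesIdentities (suc m) using (prodS≈∏ᴸ; coefficients-of-difference)
  open CommutativeRing (PS-ring (suc m)) hiding (zero)
  open FinProducts (PS-ring (suc m))
  open SetoidReasoning setoid

  Yˢ Iˢ Nˢ : ℕ → ℕ → Pattern
  Yˢ s t i j = Yℕ s t (toℕ i) (toℕ j)
  Iˢ s t i j = Iℕ s t (toℕ i) (toℕ j)
  Nˢ s t i j = Nℕ s t (toℕ i) (toℕ j)

  Bˢ : ℕ → ℕ → Fin (suc m) → Bool
  Bˢ s t i = Bℕ s t (toℕ i)

  state : ℕ → ℕ → PS (suc m)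
  state s t = kernel (Yˢ s t) (Iˢ s t) (Nˢ s t) (Bˢ s t)

  private
    toℕ≤m : (i : Fin (suc m)) → toℕ i ℕ.≤ m
    toℕ≤m i = ℕP.≤-pred (FinP.toℕ<n i)

    opt≈if : ∀ b g → opt b g ≈ (if b then g else 1#)
    opt≈if true g = refl
    opt≈if false g = refl

    ∏ᴸ-selected : ∀ {Q : Fin (suc m) → Fin (suc m) → Set} (Q? : ∀ i j → Dec (Q i j)) (g : Fin (suc m) → Fin (suc m) → PS (suc m)) →
      ∏ᴸ (concatMap (λ i → map (g i) (filter (Q? i) (allFin (suc m)))) (allFin (suc m))) ≈ ∏∏ (λ i j → opt (does (Q? i j)) (g i j))
    ∏ᴸ-selected Q? g = trans (∏ᴸ-concatMap (λ i → map (g i) (filter (Q? i) (allFin (suc m)))) (allFin (suc m)))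
      (trans (∏ᴸ-allFin (λ i → ∏ᴸ (map (g i) (filter (Q? i) (allFin (suc m))))))
      (∏-cong λ i → trans (∏ᴸ-filter (Q? i) (g i) (allFin (suc m)))
        (trans (∏ᴸ-allFin (λ j → if does (Q? i j) then g i j else 1#)) (∏-cong λ j → sym (opt≈if (does (Q? i j)) (g i j))))))

    denominator-split : ∀ Y I → denominator Y I ≈ ∏∏ (λ i j → opt (Y i j) (gY i j)) * ∏∏ (λ i j → opt (I i j) (gȲ i j))
    denominator-split Y I = trans (∏-cong λ i → ∏-* (λ j → opt (Y i j) (gY i j)) (λ j → opt (I i j) (gȲ i j)))
      (∏-* (λ i → ∏ (λ j → opt (Y i j) (gY i j))) (λ i → ∏ (λ j → opt (I i j) (gȲ i j))))

  ΩA≈start : ΩA (suc m) ≈ state 0 (suc m)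
  ΩA≈start = begin
    ΩA (suc m)
      ≈⟨ prodS≈∏ᴸ (concatMap (λ i → map (gY i) (filter (λ j → toℕ i ℕ.+ toℕ j ℕ.<? suc m) (allFin (suc m)))) (allFin (suc m))) ⟩
    ∏ᴸ (concatMap (λ i → map (gY i) (filter (λ j → toℕ i ℕ.+ toℕ j ℕ.<? suc m) (allFin (suc m)))) (allFin (suc m)))
      ≈⟨ ∏ᴸ-selected (λ i j → toℕ i ℕ.+ toℕ j ℕ.<? suc m) gY ⟩
    ∏∏ (λ i j → opt (does (toℕ i ℕ.+ toℕ j ℕ.<? suc m)) (gY i j))
      ≈⟨ ∏∏-cong (λ i j → opt-≡ (gY i j) (P.sym (Y-start (toℕ i) (toℕ j)))) ⟩
    ∏∏ (λ i j → opt (Yˢ 0 (suc m) i j) (gY i j))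
      ≈⟨ sym (*-identityʳ (∏∏ (λ i j → opt (Yˢ 0 (suc m) i j) (gY i j)))) ⟩
    ∏∏ (λ i j → opt (Yˢ 0 (suc m) i j) (gY i j)) * 1#
      ≈⟨ *-cong (sym (∏∏-cong λ i j → trans (*-congˡ (opt-≡ (gȲ i j) (I-start (toℕ i) (toℕ j) (toℕ≤m j)))) (*-identityʳ (opt (Yˢ 0 (suc m) i j) (gY i j)))))
                (sym (trans (*-cong (∏-1# (λ i → ∏ (λ j → opt (Nˢ 0 (suc m) i j) (nXX i j)))
                                      λ i → ∏-1# (λ j → opt (Nˢ 0 (suc m) i j) (nXX i j)) λ j → opt-≡ (nXX i j) (N-start (toℕ i) (toℕ j)))
                                    (∏-1# (λ i → opt (Bˢ 0 (suc m) i) (nβX i)) λ i → opt-≡ (nβX i) (B-start (toℕ i))))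
                            (*-identityʳ 1#))) ⟩
    state 0 (suc m) ∎

  end≈ΩBC : state m m ≈ ΩBC (suc m)
  end≈ΩBC = begin
    state m m
      ≈⟨ *-congʳ (denominator-split (Yˢ m m) (Iˢ m m)) ⟩
    (∏∏ (λ i j → opt (Yˢ m m i j) (gY i j)) * ∏∏ (λ i j → opt (Iˢ m m i j) (gȲ i j))) * numerator (Nˢ m m) (Bˢ m m)
      ≈⟨ *-cong (*-cong (∏∏-cong λ i j → opt-≡ (gY i j) (Y-end (toℕ i) (toℕ j) (toℕ≤m i) (toℕ≤m j)))
                        (∏∏-cong λ i j → opt-≡ (gȲ i j) (I-end (toℕ i) (toℕ j) (toℕ≤m i))))
                (*-cong (∏∏-cong λ i j → opt-≡ (nXX i j) (N-end (toℕ i) (toℕ j) (toℕ≤m i) (toℕ≤m j)))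
                        (∏-cong λ i → opt-≡ (nβX i) (B-end (toℕ i) (toℕ≤m i)))) ⟩
    (∏∏ gY * ∏∏ (λ i j → opt (does (toℕ i ℕ.≤? toℕ j)) (gȲ i j))) * (∏∏ (λ i j → opt (does (toℕ i ℕ.<? toℕ j)) (nXX i j)) * ∏ nβX)
      ≈⟨ *-comm (∏∏ gY * ∏∏ (λ i j → opt (does (toℕ i ℕ.≤? toℕ j)) (gȲ i j))) (∏∏ (λ i j → opt (does (toℕ i ℕ.<? toℕ j)) (nXX i j)) * ∏ nβX) ⟩
    (∏∏ (λ i j → opt (does (toℕ i ℕ.<? toℕ j)) (nXX i j)) * ∏ nβX) * (∏∏ gY * ∏∏ (λ i j → opt (does (toℕ i ℕ.≤? toℕ j)) (gȲ i j)))
      ≈⟨ sym (*-cong (*-cong (∏ᴸ-selected (λ i j → toℕ i ℕ.<? toℕ j) nXX) (∏ᴸ-allFin nβX))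
                     (*-cong all-gY (∏ᴸ-selected (λ i j → toℕ i ℕ.≤? toℕ j) gȲ))) ⟩
    (∏ᴸ numer1 * ∏ᴸ numer2) * (∏ᴸ denA * ∏ᴸ denB)
      ≈⟨ sym (trans (∏ᴸ-++ (numer1 ++ numer2) (denA ++ denB)) (*-cong (∏ᴸ-++ numer1 numer2) (∏ᴸ-++ denA denB))) ⟩
    ∏ᴸ ((numer1 ++ numer2) ++ (denA ++ denB))
      ≈⟨ sym (prodS≈∏ᴸ ((numer1 ++ numer2) ++ (denA ++ denB))) ⟩
    ΩBC (suc m) ∎
    where
    numer1 numer2 denA denB : List (PS (suc m))
    numer1 = concatMap (λ i → map (nXX i) (filter (λ j → toℕ i ℕ.<? toℕ j) (allFin (suc m)))) (allFin (suc m))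
    numer2 = map nβX (allFin (suc m))
    denA = concatMap (λ i → map (gY i) (allFin (suc m))) (allFin (suc m))
    denB = concatMap (λ i → map (gȲ i) (filter (λ j → toℕ i ℕ.≤? toℕ j) (allFin (suc m)))) (allFin (suc m))
    all-gY : ∏ᴸ denA ≈ ∏∏ gY
    all-gY = trans (∏ᴸ-concatMap (λ i → map (gY i) (allFin (suc m))) (allFin (suc m)))
      (trans (∏ᴸ-allFin (λ i → ∏ᴸ (map (gY i) (allFin (suc m))))) (∏-cong λ i → ∏ᴸ-allFin (gY i)))

  next-block : ∀ s → s ℕ.< m → state s s ≈ state (suc s) (suc m)
  next-block s s<m = *-cong
    (denominator-≡ (Yˢ (suc s) (suc m)) (Yˢ s s) (Iˢ (suc s) (suc m)) (Iˢ s s)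
      (λ i j → Y-next s (toℕ i) (toℕ j) (toℕ≤m i) (toℕ≤m j)) (λ i j → I-next s (toℕ i) (toℕ j) (toℕ≤m j)))
    (numerator-≡ (Nˢ (suc s) (suc m)) (Nˢ s s) (Bˢ (suc s) (suc m)) (Bˢ s s)
      (λ i j → N-next s (toℕ i) (toℕ j) (toℕ≤m j)) (λ i → B-next s (toℕ i) s<m))

  private
    toℕ-≢ : ∀ {x : Fin (suc m)} {v} → toℕ x ≡ v → ∀ {i} → i ≢ x → toℕ i ≢ v
    toℕ-≢ toℕx≡v i≢x toℕi≡v = i≢x (FinP.toℕ-injective (P.trans toℕi≡v (P.sym toℕx≡v)))

    toℕ-≢² : ∀ {x y : Fin (suc m)} {v w} → toℕ x ≡ v → toℕ y ≡ w → ∀ {i j} → ¬ (i ≡ x × j ≡ y) → ¬ (toℕ i ≡ v × toℕ j ≡ w)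
    toℕ-≢² toℕx≡v toℕy≡w ne (toℕi≡v , toℕj≡w) =
      ne (FinP.toℕ-injective (P.trans toℕi≡v (P.sym toℕx≡v)) , FinP.toℕ-injective (P.trans toℕj≡w (P.sym toℕy≡w)))

  inversion-Step : ∀ s → s ℕ.≤ m → ∀ a → Step {m} BC (state s (suc m) a) (state s m a)
  inversion-Step s s≤m = coefficients-of-difference (yL r -L yinvL r) (yL r +L βL) (yinvL r +L βL) (inversion-step move)
    where
    open InversionFacts s
    r sF : Fin (suc m)
    r = fromℕ m
    sF = fromℕ< (ℕ.s≤s s≤m)
    toℕ-sF : toℕ sF ≡ s
    toℕ-sF = FinP.toℕ-fromℕ< (ℕ.s≤s s≤m)
    toℕ-r : toℕ r ≡ m
    toℕ-r = FinP.toℕ-fromℕ m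
    move : InversionMove r sF (Yˢ s (suc m)) (Iˢ s (suc m)) (Nˢ s (suc m)) (Bˢ s (suc m)) (Yˢ s m) (Iˢ s m) (Nˢ s m) (Bˢ s m)
    move = record
      { Y'-same = λ i j → Y'-same (toℕ i) (toℕ j)
      ; Y-sr = P.subst₂ (λ x y → Yℕ s (suc m) x y ≡ true) (P.sym toℕ-sF) (P.sym toℕ-r) Y-sr
      ; I-sr = P.subst₂ (λ x y → Iℕ s (suc m) x y ≡ false) (P.sym toℕ-sF) (P.sym toℕ-r) I-sr
      ; I'-sr = P.subst₂ (λ x y → Iℕ s m x y ≡ true) (P.sym toℕ-sF) (P.sym toℕ-r) I'-sr
      ; I'-rest = λ i j ne → I'-rest (toℕ i) (toℕ j) (toℕ≤m j) (toℕ-≢² toℕ-sF toℕ-r ne)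
      ; N'-same = λ i j → N'-same (toℕ i) (toℕ j)
      ; B-s = P.subst (λ x → Bℕ s (suc m) x ≡ false) (P.sym toℕ-sF) B-s
      ; B'-s = P.subst (λ x → Bℕ s m x ≡ true) (P.sym toℕ-sF) B'-s
      ; B'-rest = λ i ne → B'-rest (toℕ i) (toℕ-≢ toℕ-sF ne)
      ; Y≡I-off-row = λ i ne → P.subst (λ y → Yℕ s (suc m) (toℕ i) y ≡ Iℕ s (suc m) (toℕ i) y) (P.sym toℕ-r)
                                 (Y≡I-off-row (toℕ i) (toℕ≤m i) (toℕ-≢ toℕ-sF ne))
      }

  swap-Step : ∀ s (t : Fin m) → s ℕ.≤ toℕ t → ∀ a → Step (A t) (state s (suc (toℕ t)) a) (state s (toℕ t) a)
  swap-Step s t s≤t = coefficients-of-difference (yL p -L yL q) (yL p) (yL q) (swap-step p≢q move)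
    where
    t′ = toℕ t
    p q : Fin (suc m)
    p = inject₁ t
    q = suc t
    toℕ-p : toℕ p ≡ t′
    toℕ-p = FinP.toℕ-inject₁ t
    p≢q : p ≢ q
    p≢q p≡q = ℕP.<⇒≢ (ℕP.n<1+n t′) (P.trans (P.sym toℕ-p) (P.cong toℕ p≡q))
    t<m : suc t′ ℕ.≤ m
    t<m = FinP.toℕ<n t
    a = m ℕ.+ s ∸ t′
    a+t≡m+s : a ℕ.+ t′ ≡ m ℕ.+ s
    a+t≡m+s = ℕP.m∸n+n≡m (ℕP.≤-trans (ℕP.<⇒≤ t<m) (ℕP.m≤m+n m s))
    a≤m : a ℕ.≤ m
    a≤m = ℕP.≤-trans (ℕP.∸-monoʳ-≤ (m ℕ.+ s) s≤t) (ℕP.≤-reflexive (ℕP.m+n∸n≡m m s))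
    aF sF : Fin (suc m)
    aF = fromℕ< (ℕ.s≤s a≤m)
    sF = fromℕ< (ℕ.s≤s (ℕP.≤-trans s≤t (ℕP.<⇒≤ t<m)))
    toℕ-aF : toℕ aF ≡ a
    toℕ-aF = FinP.toℕ-fromℕ< (ℕ.s≤s a≤m)
    toℕ-sF : toℕ sF ≡ s
    toℕ-sF = FinP.toℕ-fromℕ< (ℕ.s≤s (ℕP.≤-trans s≤t (ℕP.<⇒≤ t<m)))
    open SwapFacts s t′ a a+t≡m+s s≤t t<m
    move : SwapMove p q aF sF (Yˢ s (suc t′)) (Iˢ s (suc t′)) (Nˢ s (suc t′)) (Bˢ s (suc t′)) (Yˢ s t′) (Iˢ s t′) (Nˢ s t′) (Bˢ s t′)
    move = record
      { Y-ap = P.subst₂ (λ x y → Yℕ s (suc t′) x y ≡ true) (P.sym toℕ-aF) (P.sym toℕ-p) Y-ap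
      ; Y-aq = P.subst (λ x → Yℕ s (suc t′) x (suc t′) ≡ false) (P.sym toℕ-aF) Y-aq
      ; Y'-aq = P.subst (λ x → Yℕ s t′ x (suc t′) ≡ true) (P.sym toℕ-aF) Y'-aq
      ; Y'-rest = λ i j ne → Y'-rest (toℕ i) (toℕ j) (toℕ-≢² toℕ-aF P.refl ne)
      ; I-sq = P.subst (λ x → Iℕ s (suc t′) x (suc t′) ≡ true) (P.sym toℕ-sF) I-sq
      ; I-sp = P.subst₂ (λ x y → Iℕ s (suc t′) x y ≡ false) (P.sym toℕ-sF) (P.sym toℕ-p) I-sp
      ; I'-sp = P.subst₂ (λ x y → Iℕ s t′ x y ≡ true) (P.sym toℕ-sF) (P.sym toℕ-p) I'-sp
      ; I'-rest = λ i j ne → I'-rest (toℕ i) (toℕ j) (toℕ-≢² toℕ-sF toℕ-p ne)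
      ; N-sa = P.subst₂ (λ x y → Nℕ s (suc t′) x y ≡ false) (P.sym toℕ-sF) (P.sym toℕ-aF) N-sa
      ; N'-sa = P.subst₂ (λ x y → Nℕ s t′ x y ≡ true) (P.sym toℕ-sF) (P.sym toℕ-aF) N'-sa
      ; N'-rest = λ i j ne → N'-rest (toℕ i) (toℕ j) (toℕ-≢² toℕ-sF toℕ-aF ne)
      ; B'-same = λ i → B'-same (toℕ i)
      ; Y-symmetric = λ i ne → P.subst (λ y → Yℕ s (suc t′) (toℕ i) y ≡ Yℕ s (suc t′) (toℕ i) (suc t′)) (P.sym toℕ-p)
                                 (Y-symmetric (toℕ i) (toℕ-≢ toℕ-aF ne))
      ; I-symmetric = λ i ne → P.subst (λ y → Iℕ s (suc t′) (toℕ i) y ≡ Iℕ s (suc t′) (toℕ i) (suc t′)) (P.sym toℕ-p)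
                                 (I-symmetric (toℕ i) (toℕ-≢ toℕ-sF ne))
      }

module Chains (m : ℕ) where
  open LaurentRing (suc m) using (_≋_; mk≋; get≋; +L-cong; -L-cong; *L-congˡ)

  private
    difference-cong : ∀ a b {f f' g g'} → f ≋ f' → g ≋ g' → (a *L f) -L (b *L g) ≋ (a *L f') -L (b *L g')
    difference-cong a b e e' = +L-cong (*L-congˡ a e) (-L-cong (*L-congˡ b e'))

  Step-congˡ : ∀ (o : Op m) {f f' g} → f' ≈L f → Step o f g → Step o f' g
  Step-congˡ (A i) {f} {f'} f'≈f step μ = P.trans (step μ)
    (get≋ (difference-cong (yL p) (yL q) {f} {f'} {substL σ f} {substL σ f'} (mk≋ f≈f') (mk≋ (substL-cong {f} {f'} f≈f'))) μ)
    where
    f≈f' = λ μ → P.sym (f'≈f μ)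
    p = inject₁ i
    q = suc i
    σ = swapExp p q
    open ExponentSubstitution σ (swapExp-isExponentInvolution p q) using (substL-cong)
  Step-congˡ BC {f} {f'} f'≈f step μ = P.trans (step μ)
    (get≋ (difference-cong (yL r +L βL) (yinvL r +L βL) {f} {f'} {substL σ f} {substL σ f'} (mk≋ f≈f') (mk≋ (substL-cong {f} {f'} f≈f'))) μ)
    where
    f≈f' = λ μ → P.sym (f'≈f μ)
    r = fromℕ m
    σ = invExp r
    open ExponentSubstitution σ (invExp-isExponentInvolution r) using (substL-cong)

  Chain-congˡ : ∀ os {f f' g} → f' ≈L f → Chain {m} os f g → Chain os f' g
  Chain-congˡ [] f'≈f f≈g μ = P.trans (f'≈f μ) (f≈g μ)
  Chain-congˡ (o ∷ os) f'≈f (h , step , chain) = h , Step-congˡ o f'≈f step , chain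

  Chain-congʳ : ∀ os {f g g'} → Chain {m} os f g → g ≈L g' → Chain os f g'
  Chain-congʳ [] f≈g g≈g' μ = P.trans (f≈g μ) (g≈g' μ)
  Chain-congʳ (o ∷ os) (h , step , chain) g≈g' = h , step , Chain-congʳ os chain g≈g'

  Chain-++ : ∀ os os' {f h g} → Chain {m} os f h → Chain os' h g → Chain (os ++ os') f g
  Chain-++ [] os' f≈h chain = Chain-congˡ os' f≈h chain
  Chain-++ (o ∷ os) os' (h' , step , chain) chain' = h' , step , Chain-++ os os' chain chain'

upFrom : ℕ → ℕ → List ℕ
upFrom k zero = []
upFrom k (suc c) = k ∷ upFrom (suc k) c

upTo≡upFrom : ∀ c → upTo c ≡ upFrom 0 c
upTo≡upFrom c = shifted id 0 c (λ x → P.refl)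
  where
  shifted : ∀ (f : ℕ → ℕ) k c → (∀ x → f x ≡ k ℕ.+ x) → List.applyUpTo f c ≡ upFrom k c
  shifted f k zero e = P.refl
  shifted f k (suc c) e = P.cong₂ _∷_ (P.trans (e 0) (ℕP.+-identityʳ k)) (shifted (f ∘ suc) (suc k) c (λ x → P.trans (e (suc x)) (ℕP.+-suc k x)))

toℕ-filter-allFin : ∀ m s → s ℕ.≤ m → map toℕ (filter (λ t → s ℕ.≤? toℕ t) (allFin m)) ≡ upFrom s (m ∸ s)
toℕ-filter-allFin m s s≤m = P.trans (map-filter toℕ (s ℕ.≤?_) (allFin m))
  (P.trans (P.cong (filter (s ℕ.≤?_)) (P.trans (ListP.map-tabulate {n = m} id toℕ) (tabulated {m} toℕ 0 λ i → P.refl)))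
  (P.trans (P.cong (λ c → filter (s ℕ.≤?_) (upFrom 0 c)) (P.sym (ℕP.m+[n∸m]≡n s≤m))) (drop-below s 0 (m ∸ s) P.refl)))
  where
  map-filter : ∀ {A B : Set} (f : A → B) {Q : B → Set} (Q? : Decidable Q) xs → map f (filter (Q? ∘ f) xs) ≡ filter Q? (map f xs)
  map-filter f Q? [] = P.refl
  map-filter f Q? (x ∷ xs) with does (Q? (f x))
  ... | true = P.cong (f x ∷_) (map-filter f Q? xs)
  ... | false = map-filter f Q? xs
  tabulated : ∀ {k} (f : Fin k → ℕ) b → (∀ i → f i ≡ b ℕ.+ toℕ i) → List.tabulate f ≡ upFrom b k
  tabulated {zero} f b e = P.refl
  tabulated {suc k} f b e = P.cong₂ _∷_ (P.trans (e zero) (ℕP.+-identityʳ b)) (tabulated (f ∘ suc) (suc b) (λ i → P.trans (e (suc i)) (ℕP.+-suc b (toℕ i))))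
  keep-all : ∀ k c → s ℕ.≤ k → filter (s ℕ.≤?_) (upFrom k c) ≡ upFrom k c
  keep-all k zero s≤k = P.refl
  keep-all k (suc c) s≤k = P.trans (ListP.filter-accept (s ℕ.≤?_) s≤k) (P.cong (k ∷_) (keep-all (suc k) c (ℕP.m≤n⇒m≤1+n s≤k)))
  drop-below : ∀ j k c → k ℕ.+ j ≡ s → filter (s ℕ.≤?_) (upFrom k (j ℕ.+ c)) ≡ upFrom s c
  drop-below zero k c k≡s = P.subst (λ z → filter (s ℕ.≤?_) (upFrom z c) ≡ upFrom s c) (P.trans (P.sym k≡s) (ℕP.+-identityʳ k)) (keep-all s c ℕP.≤-refl)
  drop-below (suc j) k c k+1+j≡s = P.trans (ListP.filter-reject (s ℕ.≤?_) (ℕP.<⇒≱ k<s)) (drop-below j (suc k) c (P.trans (P.sym (ℕP.+-suc k j)) k+1+j≡s))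
    where
    k<s : k ℕ.< s
    k<s = P.subst (k ℕ.<_) k+1+j≡s (ℕP.m<m+n k (ℕ.s≤s ℕ.z≤n))

module PhiChain (m : ℕ) (a : Vec ℕ (suc m)) where
  open KernelStates m
  open Chains m
  open CommutativeRing (PS-ring (suc m)) using (_≈_)
  open SeriesRing (suc m) using (get≈S)
  open LaurentRing (suc m) using (get≋)

  ≈-at-a : ∀ {F G} → F ≈ G → F a ≈L G a
  ≈-at-a F≈G = get≋ (get≈S F≈G a)

  swaps-chain : ∀ s (ts : List (Fin m)) k c → k ℕ.+ c ≡ m → map toℕ ts ≡ upFrom k c → s ℕ.≤ k →
    Chain (map A (reverse ts)) (state s m a) (state s k a)
  swaps-chain s [] k zero k+0≡m _ _ = P.subst (λ z → state s m a ≈L state s z a) (P.trans (P.sym k+0≡m) (ℕP.+-identityʳ k)) (λ μ → P.refl)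
  swaps-chain s (t ∷ ts) k (suc c) k+c≡m toℕs s≤k =
    P.subst (λ os → Chain os (state s m a) (state s k a)) (P.sym (P.trans (P.cong (map A) (ListP.unfold-reverse t ts)) (ListP.map-++ A (reverse ts) (t ∷ []))))
      (Chain-++ (map A (reverse ts)) (A t ∷ []) {state s m a} {state s (suc k) a} {state s k a}
        (swaps-chain s ts (suc k) c (P.trans (P.sym (ℕP.+-suc k c)) k+c≡m) (ListP.∷-injectiveʳ toℕs) (ℕP.m≤n⇒m≤1+n s≤k))
        (state s k a , last-step , λ μ → P.refl))
    where
    toℕt≡k : toℕ t ≡ k
    toℕt≡k = ListP.∷-injectiveˡ toℕs
    last-step : Step (A t) (state s (suc k) a) (state s k a)
    last-step = P.subst (λ z → Step (A t) (state s (suc z) a) (state s z a)) toℕt≡k (swap-Step s t (P.subst (s ℕ.≤_) (P.sym toℕt≡k) s≤k) a)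

  block-chain : ∀ s → s ℕ.≤ m → Chain (block m s) (state s (suc m) a) (state s s a)
  block-chain s s≤m = state s m a , inversion-Step s s≤m a ,
    swaps-chain s (filter (λ t → s ℕ.≤? toℕ t) (allFin m)) s (m ∸ s) (ℕP.m+[n∸m]≡n s≤m) (toℕ-filter-allFin m s s≤m) ℕP.≤-refl

  blocks-chain : ∀ c k → k ℕ.+ c ≡ m → Chain (concatMap (block m) (upFrom k (suc c))) (state k (suc m) a) (state m m a)
  blocks-chain zero k k+0≡m = P.subst (λ z → Chain (block m z ++ []) (state z (suc m) a) (state m m a)) (P.sym k≡m)
    (Chain-++ (block m m) [] {state m (suc m) a} {state m m a} {state m m a} (block-chain m ℕP.≤-refl) (λ μ → P.refl))
    where
    k≡m : k ≡ m
    k≡m = P.trans (P.sym (ℕP.+-identityʳ k)) k+0≡m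
  blocks-chain (suc c) k k+1+c≡m = Chain-++ (block m k) (concatMap (block m) (upFrom (suc k) (suc c))) {state k (suc m) a} {state (suc k) (suc m) a} {state m m a}
    (Chain-congʳ (block m k) {state k (suc m) a} {state k k a} {state (suc k) (suc m) a}
      (block-chain k (ℕP.<⇒≤ k<m)) (≈-at-a (next-block k k<m)))
    (blocks-chain c (suc k) (P.trans (P.sym (ℕP.+-suc k c)) k+1+c≡m))
    where
    k<m : k ℕ.< m
    k<m = P.subst (k ℕ.<_) k+1+c≡m (ℕP.m<m+n k (ℕ.s≤s ℕ.z≤n))

lemma4 : (m : ℕ) (a : Vec ℕ (suc m)) → Chain (Φops m) (ΩA (suc m) a) (ΩBC (suc m) a)
lemma4 m a = P.subst (λ ks → Chain (concatMap (block m) ks) (ΩA (suc m) a) (ΩBC (suc m) a)) (P.sym (upTo≡upFrom (suc m)))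
  (Chain-congˡ (concatMap (block m) (upFrom 0 (suc m))) {state 0 (suc m) a} {ΩA (suc m) a} {ΩBC (suc m) a} (≈-at-a ΩA≈start)
    (Chain-congʳ (concatMap (block m) (upFrom 0 (suc m))) {state 0 (suc m) a} {state m m a} {ΩBC (suc m) a} (blocks-chain m 0 P.refl) (≈-at-a end≈ΩBC)))
  where
  open PhiChain m a
  open KernelStates m using (state; ΩA≈start; end≈ΩBC)
  open Chains m using (Chain-congˡ; Chain-congʳ)
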